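{- Let $p_n$ be a uniformly random permutation in $S_n$ and let $D_n=D(p_n)$ be the number of passes of the recursive non-resampling Disappear-Sort procedure on $p_n$. Then $$\mathbb{E}[D_n]=\sum_{\lambda\vdash n}\lambda_1'\,\frac{(f^\lambda)^2}{n!},$$ where the sum is over all partitions $\lambda$ of $n$, $\lambda_1'$ is the length of the first column of the Young diagram of $\lambda$ (i.e. the number of parts of $\lambda$), and $f^\lambda=\dfrac{n!}{\prod_{b\in\lambda}h(b)}$ is the number of standard Young tableaux of shape $\lambda$, with $h(b)=a(b)+l(b)+1$ the hook length of the box $b$ ($a(b)$ = number of boxes to the right of $b$ in its row, $l(b)$ = number of boxes below $b$ in its column).
   Context: A Disappear-Sort pass on a list of distinct reals scans left to right and retains exactly the left-to-right records (entries larger than all earlier entries of the list; the first entry is always retained), discarding all other entries. The recursive non-resampling procedure applies a pass to the permutation, then applies a pass to the list of discarded entries (kept in their original relative order), and so on, until the list of discarded entries is empty. $D(p)$ is the number of passes performed. -}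

module Defs where

open import Data.Nat using (ℕ; zero; suc; _+_; _*_; _∸_; _<ᵇ_; _≤ᵇ_; _!)
open import Data.Nat.Properties using (_!≢0)
open import Data.Bool using (Bool; true; false; if_then_else_)
open import Data.Nat.ListAction using (sum)
open import Data.List using (List; []; _∷_; length; map; concatMap; upTo; filterᵇ; foldr; applyUpTo)
open import Data.Product using (_×_; _,_; proj₁; proj₂)
open import Data.Integer using (+_)
open import Data.Rational using (ℚ; _/_; 0ℚ; 1ℚ) renaming (_+_ to _+ℚ_; _*_ to _*ℚ_)

-- Permutations of [0, 1, …, n-1], enumerated as lists (one-line notation).

insertions : ℕ → List ℕ → List (List ℕ)
insertions x []       = (x ∷ []) ∷ []
insertions x (y ∷ ys) = (x ∷ y ∷ ys) ∷ map (y ∷_) (insertions x ys)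

-- all permutations of a list (each listed once when entries are distinct)
permutations : List ℕ → List (List ℕ)
permutations []       = [] ∷ []
permutations (x ∷ xs) = concatMap (insertions x) (permutations xs)

Sym : ℕ → List (List ℕ)
Sym n = permutations (upTo n)

-- scan with current running maximum m: (retained, discarded)
passFrom : ℕ → List ℕ → List ℕ × List ℕ
passFrom m []       = [] , []
passFrom m (y ∷ ys) with m <ᵇ y
... | true  = let r = passFrom y ys in (y ∷ proj₁ r) , proj₂ r
... | false = let r = passFrom m ys in proj₁ r , (y ∷ proj₂ r)

-- one pass: retains left-to-right records (first entry always retained)
pass : List ℕ → List ℕ × List ℕ
pass []       = [] , []
pass (x ∷ xs) = let r = passFrom x xs in (x ∷ proj₁ r) , proj₂ r

discarded : List ℕ → List ℕ
discarded xs = proj₂ (pass xs)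

-- number of passes, with fuel (each pass on a nonempty list retains at
-- least one entry, so `length xs` units of fuel always suffice)
passesFuel : ℕ → List ℕ → ℕ
passesFuel zero     _  = 0
passesFuel (suc f) []  = 0
passesFuel (suc f) (x ∷ xs) = suc (passesFuel f (discarded (x ∷ xs)))

D : List ℕ → ℕ
D p = passesFuel (length p) p

expectedD : ℕ → ℚ
expectedD n = _/_ (+ sum (map D (Sym n))) (n !) {{n !≢0}}

-- Integer partitions, as weakly decreasing lists of positive parts
-- λ = (λ₁ ≥ λ₂ ≥ … ≥ λ_ℓ > 0).

-- partitions of n with all parts ≤ m, with fuel (fuel ≥ n suffices,
-- since each part is ≥ 1)
partsFuel : ℕ → ℕ → ℕ → List (List ℕ)
partsFuel _        zero    _ = [] ∷ []
partsFuel zero     (suc n) _ = []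
partsFuel (suc f) (suc n) m =
  concatMap (λ k → map (k ∷_) (partsFuel f (suc n ∸ k) k))
            (filterᵇ (λ k → k ≤ᵇ m) (applyUpTo suc (suc n)))

Partitions : ℕ → List (List ℕ)
Partitions n = partsFuel n n n

firstColumn : List ℕ → ℕ
firstColumn λ′ = length λ′

-- conjugate column length λ'_j (j ≥ 1): number of rows of length ≥ j
colLen : List ℕ → ℕ → ℕ
colLen λ′ j = length (filterᵇ (λ r → j ≤ᵇ r) λ′)

prodℚ : List ℚ → ℚ
prodℚ = foldr _*ℚ_ 1ℚ

-- reciprocal of hook length of box (i, j) (1-indexed, row i of length r):
-- a = r - j, l = λ'_j - i, h = a + l + 1
invHook : List ℕ → ℕ → ℕ → ℕ → ℚ
invHook λ′ i r j = (+ 1) / suc ((r ∸ j) + (colLen λ′ j ∸ i))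

-- product over rows, with row index i (1-indexed)
invHooksFrom : List ℕ → ℕ → List ℕ → ℚ
invHooksFrom λ′ i []       = 1ℚ
invHooksFrom λ′ i (r ∷ rs) =
  prodℚ (map (invHook λ′ i r) (applyUpTo suc r)) *ℚ invHooksFrom λ′ (suc i) rs

fShape : ℕ → List ℕ → ℚ
fShape n λ′ = ((+ (n !)) / 1) *ℚ invHooksFrom λ′ 1 λ′

rhs : ℕ → ℚ
rhs n = foldr _+ℚ_ 0ℚ
  (map (λ λ′ → ((+ firstColumn λ′) / 1) *ℚ (fShape n λ′ *ℚ fShape n λ′)
                 *ℚ (_/_ (+ 1) (n !) {{n !≢0}}))
       (Partitions n))

{-# OPTIONS --safe #-}

-- Each pass removes the left-to-right maxima of what is left; a decreasing subsequence loses at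
-- most one entry per pass and a longest one loses exactly one, so the number of passes D(p) is
-- the length of a longest decreasing subsequence of p.  Build a permutation by inserting ever
-- smaller letters; Fomin's growth rules turn the chain of its prefixes into a standard Young
-- tableau whose number of rows is that length.  Because Young's lattice is differential
-- (D U = U D + I), each growth step is a bijection, so every tableau of shape λ is obtained from
-- exactly f^λ permutations, and Σ_p D(p) = Σ_λ λ'₁ (f^λ)².  Finally f^λ = n! / ∏ h(b) is the
-- hook length formula, proved through the Greene–Nijenhuis–Wilf hook walk in closed form.
module Submission where

import Algebra.Structures
open import Defs
open import Relation.Binary.PropositionalEquality using (_≡_; cong; sym; trans)
open import Data.Nat using (ℕ)


module BooleanComparisons where

  open import Data.Nat
  open import Data.Nat.Properties
  open import Data.Bool using (Bool; true; false; not; T; _∧_; if_then_else_)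
  open import Data.Bool.Properties using (T-≡; ¬-not; not-injective)
  open import Data.Product using (_×_; _,_)
  open import Function.Bundles using (Equivalence)
  open import Relation.Binary.PropositionalEquality
  open import Relation.Nullary using (¬_)

  private
    module Reflecting {P : Set} {b : Bool} (sound : T b → P) (complete : P → T b) where

      ≡true⇒ : b ≡ true → P
      ≡true⇒ e = sound (Equivalence.from T-≡ e)

      ⇒≡true : P → b ≡ true
      ⇒≡true p = Equivalence.to T-≡ (complete p)

      ≡false⇒¬ : b ≡ false → ¬ P
      ≡false⇒¬ e p = subst T e (complete p)

      ¬⇒≡false : ¬ P → b ≡ false
      ¬⇒≡false ¬p = ¬-not (λ e → ¬p (≡true⇒ e))

  module _ {m n : ℕ} where

    private
      module < = Reflecting (<ᵇ⇒< m n) <⇒<ᵇ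
      module ≤ = Reflecting (≤ᵇ⇒≤ m n) ≤⇒≤ᵇ
      module ≡ = Reflecting (≡ᵇ⇒≡ m n) (≡⇒≡ᵇ m n)

    <⇒<ᵇ≡true : m < n → (m <ᵇ n) ≡ true
    <⇒<ᵇ≡true = <.⇒≡true

    <ᵇ≡true⇒< : (m <ᵇ n) ≡ true → m < n
    <ᵇ≡true⇒< = <.≡true⇒

    ≥⇒<ᵇ≡false : n ≤ m → (m <ᵇ n) ≡ false
    ≥⇒<ᵇ≡false n≤m = <.¬⇒≡false (≤⇒≯ n≤m)

    <ᵇ≡false⇒≥ : (m <ᵇ n) ≡ false → n ≤ m
    <ᵇ≡false⇒≥ e = ≮⇒≥ (<.≡false⇒¬ e)

    ≤⇒≤ᵇ≡true : m ≤ n → (m ≤ᵇ n) ≡ true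
    ≤⇒≤ᵇ≡true = ≤.⇒≡true

    ≤ᵇ≡true⇒≤ : (m ≤ᵇ n) ≡ true → m ≤ n
    ≤ᵇ≡true⇒≤ = ≤.≡true⇒

    >⇒≤ᵇ≡false : n < m → (m ≤ᵇ n) ≡ false
    >⇒≤ᵇ≡false n<m = ≤.¬⇒≡false (<⇒≱ n<m)

    ≡⇒≡ᵇ≡true : m ≡ n → (m ≡ᵇ n) ≡ true
    ≡⇒≡ᵇ≡true = ≡.⇒≡true

    ≡ᵇ≡true⇒≡ : (m ≡ᵇ n) ≡ true → m ≡ n
    ≡ᵇ≡true⇒≡ = ≡.≡true⇒

    ≢⇒≡ᵇ≡false : m ≢ n → (m ≡ᵇ n) ≡ false
    ≢⇒≡ᵇ≡false = ≡.¬⇒≡false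

    ≡ᵇ≡false⇒≢ : (m ≡ᵇ n) ≡ false → m ≢ n
    ≡ᵇ≡false⇒≢ = ≡.≡false⇒¬

  ≡ᵇ-refl : ∀ n → (n ≡ᵇ n) ≡ true
  ≡ᵇ-refl n = ≡⇒≡ᵇ≡true {n} refl

  ≡ᵇ-sym : ∀ a c → (a ≡ᵇ c) ≡ (c ≡ᵇ a)
  ≡ᵇ-sym zero    zero    = refl
  ≡ᵇ-sym zero    (suc c) = refl
  ≡ᵇ-sym (suc a) zero    = refl
  ≡ᵇ-sym (suc a) (suc c) = ≡ᵇ-sym a c

  true⇔true⇒≡ : ∀ {a b : Bool} → (a ≡ true → b ≡ true) → (b ≡ true → a ≡ true) → a ≡ b
  true⇔true⇒≡ {true}  {true}  f g = refl
  true⇔true⇒≡ {true}  {false} f g = sym (f refl)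
  true⇔true⇒≡ {false} {true}  f g = g refl
  true⇔true⇒≡ {false} {false} f g = refl

  ∧≡true⁻ : ∀ {a b : Bool} → (a ∧ b) ≡ true → (a ≡ true) × (b ≡ true)
  ∧≡true⁻ {true} {true} _ = refl , refl

  ∧≡true⁺ : ∀ {a b : Bool} → a ≡ true → b ≡ true → (a ∧ b) ≡ true
  ∧≡true⁺ refl refl = refl

  if-true : ∀ {A : Set} {b : Bool} (x y : A) → b ≡ true → (if b then x else y) ≡ x
  if-true x y refl = refl

  if-false : ∀ {A : Set} {b : Bool} (x y : A) → b ≡ false → (if b then x else y) ≡ y
  if-false x y refl = refl

  <ᵇ≡not-≡ᵇ : ∀ m n → m < suc n → (m <ᵇ n) ≡ not (m ≡ᵇ n)
  <ᵇ≡not-≡ᵇ m n h = true⇔true⇒≡ to from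
    where
    to : (m <ᵇ n) ≡ true → not (m ≡ᵇ n) ≡ true
    to e = cong not (≢⇒≡ᵇ≡false {m} {n} (<⇒≢ (<ᵇ≡true⇒< {m} {n} e)))
    from : not (m ≡ᵇ n) ≡ true → (m <ᵇ n) ≡ true
    from e = <⇒<ᵇ≡true {m} {n} (≤∧≢⇒< (≤-pred h) (≡ᵇ≡false⇒≢ {m} {n} (not-injective e)))

  suc-<ᵇ≡<ᵇ∧not-≡ᵇ : ∀ m n → (suc m <ᵇ n) ≡ (m <ᵇ n) ∧ not (suc m ≡ᵇ n)
  suc-<ᵇ≡<ᵇ∧not-≡ᵇ m n = true⇔true⇒≡ to from
    where
    to : (suc m <ᵇ n) ≡ true → ((m <ᵇ n) ∧ not (suc m ≡ᵇ n)) ≡ true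
    to e =
      ∧≡true⁺ (<⇒<ᵇ≡true {m} {n} (≤-trans (n≤1+n _) (<ᵇ≡true⇒< {suc m} {n} e)))
        (cong not (≢⇒≡ᵇ≡false {suc m} {n} (<⇒≢ (<ᵇ≡true⇒< {suc m} {n} e))))
    from : ((m <ᵇ n) ∧ not (suc m ≡ᵇ n)) ≡ true → (suc m <ᵇ n) ≡ true
    from e with ∧≡true⁻ e
    ... | e1 , e2 =
      <⇒<ᵇ≡true {suc m} {n} (≤∧≢⇒< (<ᵇ≡true⇒< {m} {n} e1) (≡ᵇ≡false⇒≢ {suc m} {n} (not-injective e2)))


module RangeFolds {A : Set} {_∙_ : A → A → A} {ε : A}
                  (isCommutativeMonoid : Algebra.Structures.IsCommutativeMonoid _≡_ _∙_ ε) where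

  open import Data.Nat using (ℕ; zero; suc; _+_; _∸_; _<_; _≤_; _≡ᵇ_; z<s; s<s)
  open import Data.Nat.Properties using (m≤n⇒∃[o]m+o≡n; m≤m+n; +-monoʳ-<)
  open import Data.Bool using (Bool; true; false; _∧_; not)
  open import Data.Product using (_,_)
  open import Relation.Binary.PropositionalEquality
  open import Algebra.Structures (_≡_ {A = A}) using (module IsCommutativeMonoid)
  open IsCommutativeMonoid isCommutativeMonoid using (assoc; comm; identityˡ; identityʳ; isCommutativeSemigroup)
  open import Algebra.Bundles using (CommutativeSemigroup)

  private
    commutativeSemigroup : CommutativeSemigroup _ _
    commutativeSemigroup = record { isCommutativeSemigroup = isCommutativeSemigroup }

  open import Algebra.Properties.CommutativeSemigroup commutativeSemigroup using (interchange)

  fold< : ℕ → (ℕ → A) → A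
  fold< zero    g = ε
  fold< (suc n) g = g 0 ∙ fold< n (λ i → g (suc i))

  ind : Bool → A → A
  ind true  x = x
  ind false x = ε

  fold<-cong< : ∀ n {g h : ℕ → A} → (∀ i → i < n → g i ≡ h i) → fold< n g ≡ fold< n h
  fold<-cong< zero    p = refl
  fold<-cong< (suc n) p = cong₂ _∙_ (p 0 z<s) (fold<-cong< n (λ i i<n → p (suc i) (s<s i<n)))

  fold<-cong : ∀ n {g h : ℕ → A} → (∀ i → g i ≡ h i) → fold< n g ≡ fold< n h
  fold<-cong n p = fold<-cong< n (λ i _ → p i)

  fold<-ε< : ∀ n {g : ℕ → A} → (∀ i → i < n → g i ≡ ε) → fold< n g ≡ ε
  fold<-ε< zero    p = refl
  fold<-ε< (suc n) p = trans (cong₂ _∙_ (p 0 z<s) (fold<-ε< n (λ i i<n → p (suc i) (s<s i<n)))) (identityˡ ε)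

  fold<-ε : ∀ n {g : ℕ → A} → (∀ i → g i ≡ ε) → fold< n g ≡ ε
  fold<-ε n p = fold<-ε< n (λ i _ → p i)

  fold<-∙ : ∀ n (g h : ℕ → A) → fold< n (λ i → g i ∙ h i) ≡ fold< n g ∙ fold< n h
  fold<-∙ zero    g h = sym (identityˡ ε)
  fold<-∙ (suc n) g h =
    trans (cong ((g 0 ∙ h 0) ∙_) (fold<-∙ n (λ i → g (suc i)) (λ i → h (suc i)))) (interchange (g 0) (h 0) _ _)

  fold<-swap : ∀ n m (g : ℕ → ℕ → A) →
    fold< n (λ i → fold< m (λ j → g i j)) ≡ fold< m (λ j → fold< n (λ i → g i j))
  fold<-swap zero    m g = sym (fold<-ε m (λ _ → refl))
  fold<-swap (suc n) m g =
    trans (cong (fold< m (g 0) ∙_) (fold<-swap n m (λ i j → g (suc i) j)))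
          (sym (fold<-∙ m (g 0) (λ j → fold< n (λ i → g (suc i) j))))

  fold<-snoc : ∀ n (g : ℕ → A) → fold< (suc n) g ≡ fold< n g ∙ g n
  fold<-snoc zero    g = comm (g 0) ε
  fold<-snoc (suc n) g = trans (cong (g 0 ∙_) (fold<-snoc n (λ i → g (suc i)))) (sym (assoc (g 0) _ _))

  fold<-split : ∀ m n (g : ℕ → A) → fold< (m + n) g ≡ fold< m g ∙ fold< n (λ t → g (m + t))
  fold<-split zero    n g = sym (identityˡ _)
  fold<-split (suc m) n g = trans (cong (g 0 ∙_) (fold<-split m n (λ i → g (suc i)))) (sym (assoc (g 0) _ _))

  fold<-extend : ∀ n m (g : ℕ → A) → n ≤ m → (∀ i → n ≤ i → i < m → g i ≡ ε) → fold< m g ≡ fold< n g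
  fold<-extend n m g n≤m p with m≤n⇒∃[o]m+o≡n n≤m
  ... | k , refl =
    trans (fold<-split n k g)
          (trans (cong (fold< n g ∙_) (fold<-ε< k (λ t t<k → p (n + t) (m≤m+n n t) (+-monoʳ-< n t<k))))
                 (identityʳ _))

  fold<-reverse : ∀ n (g : ℕ → A) → fold< n (λ k → g (n ∸ suc k)) ≡ fold< n g
  fold<-reverse zero    g = refl
  fold<-reverse (suc n) g =
    trans (cong (g n ∙_) (fold<-reverse n g)) (trans (comm (g n) _) (sym (fold<-snoc n g)))

  ind-∧ : ∀ a b x → ind (a ∧ b) x ≡ ind a (ind b x)
  ind-∧ true  b x = refl
  ind-∧ false b x = refl

  ind-ε : ∀ b → ind b ε ≡ ε
  ind-ε true  = refl
  ind-ε false = refl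

  ind-∙ : ∀ b x y → ind b (x ∙ y) ≡ ind b x ∙ ind b y
  ind-∙ true  x y = refl
  ind-∙ false x y = sym (identityˡ ε)

  ind-fold< : ∀ b n (g : ℕ → A) → ind b (fold< n g) ≡ fold< n (λ i → ind b (g i))
  ind-fold< true  n g = refl
  ind-fold< false n g = sym (fold<-ε n (λ _ → refl))

  fold<-single : ∀ n c (g : ℕ → A) → c < n → fold< n (λ i → ind (i ≡ᵇ c) (g i)) ≡ g c
  fold<-single (suc n) zero    g _ = trans (cong (g 0 ∙_) (fold<-ε n (λ _ → refl))) (identityʳ _)
  fold<-single (suc n) (suc c) g (s<s c<n) =
    trans (identityˡ _) (fold<-single n c (λ i → g (suc i)) c<n)

  fold<-remove : ∀ n c (P : ℕ → Bool) (g : ℕ → A) → c < n →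
    fold< n (λ a → ind (P a) (g a)) ≡ fold< n (λ a → ind (P a ∧ not (a ≡ᵇ c)) (g a)) ∙ ind (P c) (g c)
  fold<-remove n c P g c<n =
    trans (fold<-cong n split)
          (trans (fold<-∙ n _ _)
                 (cong (fold< n (λ a → ind (P a ∧ not (a ≡ᵇ c)) (g a)) ∙_)
                       (trans (fold<-cong n (λ a → ind-∧ (P a) (a ≡ᵇ c) (g a)))
                              (trans (fold<-cong n (λ a → swap (P a) (a ≡ᵇ c) (g a)))
                                     (fold<-single n c (λ a → ind (P a) (g a)) c<n)))))
    where
    split : ∀ a → ind (P a) (g a) ≡ ind (P a ∧ not (a ≡ᵇ c)) (g a) ∙ ind (P a ∧ (a ≡ᵇ c)) (g a)
    split a with P a | a ≡ᵇ c
    ... | true  | true  = sym (identityˡ _)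
    ... | true  | false = sym (identityʳ _)
    ... | false | _     = sym (identityˡ ε)
    swap : ∀ p q x → ind p (ind q x) ≡ ind q (ind p x)
    swap true  q     x = refl
    swap false true  x = refl
    swap false false x = refl


module NatSums where

  open import Data.Nat
  open import Data.Nat.Properties using (+-0-isCommutativeMonoid; *-distribˡ-+; *-zeroʳ)
  open import Data.Bool using (true; false)
  open import Relation.Binary.PropositionalEquality

  open RangeFolds +-0-isCommutativeMonoid public
    using (ind; ind-∧)
    renaming ( fold< to Σ<; fold<-cong< to Σ<-cong<; fold<-cong to Σ<-cong; fold<-ε to Σ<-0
             ; fold<-∙ to Σ<-+; fold<-swap to Σ<-swap; fold<-extend to Σ<-extend
             ; fold<-reverse to Σ<-reverse; fold<-single to Σ<-single; fold<-remove to Σ<-remove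
             ; ind-ε to ind-0; ind-∙ to ind-+; ind-fold< to ind-Σ< )

  *-Σ< : ∀ a n (g : ℕ → ℕ) → a * Σ< n g ≡ Σ< n (λ i → a * g i)
  *-Σ< a zero    g = *-zeroʳ a
  *-Σ< a (suc n) g = trans (*-distribˡ-+ a (g 0) _) (cong (a * g 0 +_) (*-Σ< a n (λ i → g (suc i))))

  ind-* : ∀ b x y → ind b (x * y) ≡ ind b x * y
  ind-* true  x y = refl
  ind-* false x y = refl


module ListSums where

  open import Data.Nat
  open import Data.Nat.Properties
  open import Data.Nat.ListAction using (sum)
  open import Data.Bool using (Bool; true; false)
  open import Data.List using (List; []; _∷_; _++_; map; concatMap; concat; filterᵇ; applyUpTo; upTo)
  open import Data.List.Relation.Unary.All as All using (All; []; _∷_)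
  open import Data.List.Relation.Unary.All.Properties using (concat⁺; map⁺)
  open import Relation.Binary.PropositionalEquality
  open NatSums

  private variable A B : Set

  sumL : List A → (A → ℕ) → ℕ
  sumL xs g = sum (map g xs)

  sumL-++ : (xs ys : List A) (g : A → ℕ) → sumL (xs ++ ys) g ≡ sumL xs g + sumL ys g
  sumL-++ []       ys g = refl
  sumL-++ (x ∷ xs) ys g = trans (cong (g x +_) (sumL-++ xs ys g)) (sym (+-assoc (g x) _ _))

  sumL-concat : (xss : List (List A)) (g : A → ℕ) → sumL (concat xss) g ≡ sumL xss (λ xs → sumL xs g)
  sumL-concat []         g = refl
  sumL-concat (xs ∷ xss) g = trans (sumL-++ xs (concat xss) g) (cong (sumL xs g +_) (sumL-concat xss g))

  sumL-map : (h : A → B) (xs : List A) (g : B → ℕ) → sumL (map h xs) g ≡ sumL xs (λ x → g (h x))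
  sumL-map h []       g = refl
  sumL-map h (x ∷ xs) g = cong (g (h x) +_) (sumL-map h xs g)

  sumL-concatMap : (h : A → List B) (xs : List A) (g : B → ℕ) →
    sumL (concatMap h xs) g ≡ sumL xs (λ x → sumL (h x) g)
  sumL-concatMap h xs g = trans (sumL-concat (map h xs) g) (sumL-map h xs (λ ys → sumL ys g))

  sumL-cong : (xs : List A) {f g : A → ℕ} → (∀ x → f x ≡ g x) → sumL xs f ≡ sumL xs g
  sumL-cong []       p = refl
  sumL-cong (x ∷ xs) p = cong₂ _+_ (p x) (sumL-cong xs p)

  sumL-cong-All : {P : A → Set} (xs : List A) {f g : A → ℕ} → All P xs → (∀ x → P x → f x ≡ g x) →
    sumL xs f ≡ sumL xs g
  sumL-cong-All []       []         p = refl
  sumL-cong-All (x ∷ xs) (px ∷ pxs) p = cong₂ _+_ (p x px) (sumL-cong-All xs pxs p)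

  sumL-0 : (xs : List A) {f : A → ℕ} → (∀ x → f x ≡ 0) → sumL xs f ≡ 0
  sumL-0 []       p = refl
  sumL-0 (x ∷ xs) p = cong₂ _+_ (p x) (sumL-0 xs p)

  sumL-+ : (xs : List A) (f g : A → ℕ) → sumL xs (λ x → f x + g x) ≡ sumL xs f + sumL xs g
  sumL-+ []       f g = refl
  sumL-+ (x ∷ xs) f g = trans (cong (f x + g x +_) (sumL-+ xs f g)) (+-+-interchange (f x) (g x) _ _)
    where open import Algebra.Properties.CommutativeSemigroup +-commutativeSemigroup
            using () renaming (interchange to +-+-interchange)

  sumL-* : (xs : List A) (g : A → ℕ) (y : ℕ) → sumL xs (λ x → g x * y) ≡ sumL xs g * y
  sumL-* []       g y = refl
  sumL-* (x ∷ xs) g y = trans (cong (g x * y +_) (sumL-* xs g y)) (sym (*-distribʳ-+ y (g x) _))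

  ind-sumL : ∀ b (xs : List A) (g : A → ℕ) → ind b (sumL xs g) ≡ sumL xs (λ x → ind b (g x))
  ind-sumL true  xs g = refl
  ind-sumL false xs g = sym (sumL-0 xs (λ _ → refl))

  sumL-Σ< : (xs : List A) (K : ℕ) (g : A → ℕ → ℕ) →
    sumL xs (λ x → Σ< K (g x)) ≡ Σ< K (λ k → sumL xs (λ x → g x k))
  sumL-Σ< []       K g = sym (Σ<-0 K (λ _ → refl))
  sumL-Σ< (x ∷ xs) K g = trans (cong (Σ< K (g x) +_) (sumL-Σ< xs K g)) (sym (Σ<-+ K (g x) _))

  sumL-swap : (xs : List A) (ys : List B) (g : A → B → ℕ) →
    sumL xs (λ x → sumL ys (g x)) ≡ sumL ys (λ y → sumL xs (λ x → g x y))
  sumL-swap []       ys g = sym (sumL-0 ys (λ _ → refl))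
  sumL-swap (x ∷ xs) ys g = trans (cong (sumL ys (g x) +_) (sumL-swap xs ys g)) (sym (sumL-+ ys (g x) _))

  sumL-filterᵇ : (P : A → Bool) (xs : List A) (g : A → ℕ) →
    sumL (filterᵇ P xs) g ≡ sumL xs (λ x → ind (P x) (g x))
  sumL-filterᵇ P []       g = refl
  sumL-filterᵇ P (x ∷ xs) g with P x
  ... | true  = cong (g x +_) (sumL-filterᵇ P xs g)
  ... | false = sumL-filterᵇ P xs g

  sumL-applyUpTo : (f : ℕ → ℕ) (K : ℕ) (g : ℕ → ℕ) → sumL (applyUpTo f K) g ≡ Σ< K (λ i → g (f i))
  sumL-applyUpTo f zero    g = refl
  sumL-applyUpTo f (suc K) g = cong (g (f 0) +_) (sumL-applyUpTo (λ i → f (suc i)) K g)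

  sumL-upTo : (K : ℕ) (g : ℕ → ℕ) → sumL (upTo K) g ≡ Σ< K g
  sumL-upTo K g = sumL-applyUpTo (λ i → i) K g

  All-map⁺ : {Q : A → Set} {P : B → Set} (h : A → B) (xs : List A) → All Q xs → (∀ x → Q x → P (h x)) →
    All P (map h xs)
  All-map⁺ h xs q f = map⁺ (All.map (λ {x} → f x) q)

  All-concatMap : {Q : A → Set} {P : B → Set} (h : A → List B) (xs : List A) → All Q xs →
    (∀ x → Q x → All P (h x)) → All P (concatMap h xs)
  All-concatMap h xs q f = concat⁺ (All-map⁺ h xs q f)

  All-filterᵇ : {P R : A → Set} (Q : A → Bool) (xs : List A) → All P xs → (∀ x → P x → Q x ≡ true → R x) →
    All R (filterᵇ Q xs)
  All-filterᵇ Q []       []         f = []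
  All-filterᵇ Q (x ∷ xs) (px ∷ pxs) f with Q x in e
  ... | true  = f x px e ∷ All-filterᵇ Q xs pxs f
  ... | false = All-filterᵇ Q xs pxs f


-- Rows are indexed from 0; `addable ν i` / `removable ν i` say that a box may be added to /
-- removed from row i.
module YoungDiagrams where

  open import Data.Nat
  open import Data.Nat.Properties
  open import Data.Nat.ListAction using (sum)
  open import Data.Bool using (Bool; true; _∧_; not)
  open import Data.Bool.Properties using (∧-identityʳ)
  open import Data.List using (List; []; _∷_; length)
  open import Data.Product using (_×_; _,_)
  open import Data.Unit using (⊤; tt)
  open import Data.Empty using (⊥-elim)
  open import Relation.Binary.PropositionalEquality
  open import Relation.Nullary using (yes; no)
  open BooleanComparisons
  open NatSums using (ind; Σ<)

  row : List ℕ → ℕ → ℕ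
  row [] _ = 0
  row (x ∷ _) zero = x
  row (_ ∷ xs) (suc i) = row xs i

  removable : List ℕ → ℕ → Bool
  removable ν i = row ν (suc i) <ᵇ row ν i

  addable : List ℕ → ℕ → Bool
  addable ν zero = true
  addable ν (suc i) = removable ν i

  IsPartition : List ℕ → Set
  IsPartition [] = ⊤
  IsPartition (x ∷ xs) = (0 < x) × (row xs 0 ≤ x) × IsPartition xs

  addBox : ℕ → List ℕ → List ℕ
  addBox zero [] = 1 ∷ []
  addBox zero (x ∷ xs) = suc x ∷ xs
  addBox (suc i) [] = 1 ∷ []
  addBox (suc i) (x ∷ xs) = x ∷ addBox i xs

  removeBox : ℕ → List ℕ → List ℕ
  removeBox zero [] = []
  removeBox zero (zero ∷ xs) = zero ∷ xs
  removeBox zero (suc zero ∷ xs) = xs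
  removeBox zero (suc (suc x) ∷ xs) = suc x ∷ xs
  removeBox (suc i) [] = []
  removeBox (suc i) (x ∷ xs) = x ∷ removeBox i xs

  -- removing the box of row c makes row a = c + 1 non-addable
  blocks : List ℕ → ℕ → ℕ → Bool
  blocks ν c a = (a ≡ᵇ suc c) ∧ (suc (row ν a) ≡ᵇ row ν c)

  row-suc-≤ : ∀ ν → IsPartition ν → ∀ i → row ν (suc i) ≤ row ν i
  row-suc-≤ [] _ i = z≤n
  row-suc-≤ (x ∷ xs) (_ , h , _) zero = h
  row-suc-≤ (x ∷ xs) (_ , _ , p) (suc i) = row-suc-≤ xs p i

  row-antitone : ∀ ν → IsPartition ν → ∀ {i j} → i ≤ j → row ν j ≤ row ν i
  row-antitone ν p {i} {j} i≤j with m≤n⇒∃[o]m+o≡n i≤j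
  ... | (k , refl) = descend k
    where
    descend : ∀ k → row ν (i + k) ≤ row ν i
    descend zero rewrite +-identityʳ i = ≤-refl
    descend (suc k) rewrite +-suc i k = ≤-trans (row-suc-≤ ν p (i + k)) (descend k)

  row-beyond : ∀ ν i → length ν ≤ i → row ν i ≡ 0
  row-beyond [] i _ = refl
  row-beyond (x ∷ xs) (suc i) (s≤s h) = row-beyond xs i h

  row-positive : ∀ ν → IsPartition ν → ∀ i → i < length ν → 0 < row ν i
  row-positive (x ∷ xs) (h , _) zero _ = h
  row-positive (x ∷ xs) (_ , _ , p) (suc i) (s<s l) = row-positive xs p i l

  positive-row⇒<length : ∀ ν i → 0 < row ν i → i < length ν
  positive-row⇒<length [] i ()
  positive-row⇒<length (x ∷ xs) zero _ = s≤s z≤n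
  positive-row⇒<length (x ∷ xs) (suc i) h = s<s (positive-row⇒<length xs i h)

  removable⇒<length : ∀ ν c → removable ν c ≡ true → c < length ν
  removable⇒<length ν c e = positive-row⇒<length ν c (≤-trans (s≤s z≤n) (<ᵇ≡true⇒< e))

  addable⇒≤length : ∀ ν a → addable ν a ≡ true → a ≤ length ν
  addable⇒≤length ν zero e = z≤n
  addable⇒≤length ν (suc a) e = removable⇒<length ν a e

  partition-ext : ∀ ν μ → IsPartition ν → IsPartition μ → (∀ i → row ν i ≡ row μ i) → ν ≡ μ
  partition-ext [] [] _ _ _ = refl
  partition-ext [] (y ∷ ys) _ (h , _) e = ⊥-elim (<⇒≢ h (e 0))
  partition-ext (x ∷ xs) [] (h , _) _ e = ⊥-elim (<⇒≢ h (sym (e 0)))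
  partition-ext (x ∷ xs) (y ∷ ys) (_ , _ , p) (_ , _ , q) e =
    cong₂ _∷_ (e 0) (partition-ext xs ys p q (λ i → e (suc i)))

  row-addBox : ∀ ν a i → a ≤ length ν → row (addBox a ν) i ≡ row ν i + ind (i ≡ᵇ a) 1
  row-addBox [] zero zero _ = refl
  row-addBox [] zero (suc i) _ = refl
  row-addBox (x ∷ xs) zero zero _ = sym (+-comm x 1)
  row-addBox (x ∷ xs) zero (suc i) _ = sym (+-identityʳ _)
  row-addBox (x ∷ xs) (suc a) zero _ = sym (+-identityʳ _)
  row-addBox (x ∷ xs) (suc a) (suc i) (s≤s h) = row-addBox xs a i h

  row0≡0⇒[] : ∀ xs → IsPartition xs → row xs 0 ≡ 0 → xs ≡ []
  row0≡0⇒[] [] _ _ = refl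
  row0≡0⇒[] (x ∷ xs) (h , _) e = ⊥-elim (<⇒≢ h (sym e))

  row-removeBox : ∀ ν c i → IsPartition ν → removable ν c ≡ true →
    row (removeBox c ν) i + ind (i ≡ᵇ c) 1 ≡ row ν i
  row-removeBox [] c i _ ()
  row-removeBox (zero ∷ xs) zero i (() , _) _
  row-removeBox (suc zero ∷ xs) zero i (_ , _ , p) e with row0≡0⇒[] xs p (n<1⇒n≡0 (<ᵇ≡true⇒< e))
  row-removeBox (suc zero ∷ xs) zero zero (_ , _ , p) e | refl = refl
  row-removeBox (suc zero ∷ xs) zero (suc i) (_ , _ , p) e | refl = refl
  row-removeBox (suc (suc x) ∷ xs) zero zero _ _ = +-comm (suc x) 1
  row-removeBox (suc (suc x) ∷ xs) zero (suc i) _ _ = +-identityʳ _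
  row-removeBox (x ∷ xs) (suc c) zero _ _ = +-identityʳ _
  row-removeBox (x ∷ xs) (suc c) (suc i) (_ , _ , p) e = row-removeBox xs c i p e

  length-addBox-< : ∀ ν a → a < length ν → length (addBox a ν) ≡ length ν
  length-addBox-< (x ∷ xs) zero _ = refl
  length-addBox-< (x ∷ xs) (suc a) (s<s h) = cong suc (length-addBox-< xs a h)

  length-addBox-new : ∀ ν → length (addBox (length ν) ν) ≡ suc (length ν)
  length-addBox-new [] = refl
  length-addBox-new (x ∷ xs) = cong suc (length-addBox-new xs)

  length-addBox-≥ : ∀ ν a → length ν ≤ length (addBox a ν)
  length-addBox-≥ [] a = z≤n
  length-addBox-≥ (x ∷ xs) zero = ≤-refl
  length-addBox-≥ (x ∷ xs) (suc a) = s≤s (length-addBox-≥ xs a)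

  length-addBox-≤ : ∀ ν a → length (addBox a ν) ≤ suc (length ν)
  length-addBox-≤ [] zero = ≤-refl
  length-addBox-≤ [] (suc a) = ≤-refl
  length-addBox-≤ (x ∷ xs) zero = n≤1+n _
  length-addBox-≤ (x ∷ xs) (suc a) = s≤s (length-addBox-≤ xs a)

  length-removeBox-≤ : ∀ ν c → length (removeBox c ν) ≤ length ν
  length-removeBox-≤ [] zero = z≤n
  length-removeBox-≤ [] (suc c) = z≤n
  length-removeBox-≤ (zero ∷ xs) zero = ≤-refl
  length-removeBox-≤ (suc zero ∷ xs) zero = n≤1+n _
  length-removeBox-≤ (suc (suc x) ∷ xs) zero = ≤-refl
  length-removeBox-≤ (x ∷ xs) (suc c) = s≤s (length-removeBox-≤ xs c)

  addBox-partition : ∀ ν a → IsPartition ν → addable ν a ≡ true → IsPartition (addBox a ν)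
  addBox-partition [] zero _ _ = s≤s z≤n , z≤n , tt
  addBox-partition [] (suc a) _ ()
  addBox-partition (x ∷ xs) zero (h , h' , p) _ = s≤s z≤n , ≤-trans h' (n≤1+n x) , p
  addBox-partition (x ∷ []) (suc zero) (h , h' , p) e = h , <ᵇ≡true⇒< e , (s≤s z≤n , z≤n , tt)
  addBox-partition (x ∷ []) (suc (suc a)) (h , h' , p) ()
  addBox-partition (x ∷ y ∷ ys) (suc zero) (h , h' , p) e =
    h , <ᵇ≡true⇒< e , addBox-partition (y ∷ ys) zero p refl
  addBox-partition (x ∷ y ∷ ys) (suc (suc a)) (h , h' , p) e = h , h' , addBox-partition (y ∷ ys) (suc a) p e

  removeBox-partition : ∀ ν c → IsPartition ν → removable ν c ≡ true → IsPartition (removeBox c ν)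
  removeBox-partition [] c _ ()
  removeBox-partition (zero ∷ xs) zero (() , _) _
  removeBox-partition (suc zero ∷ xs) zero (_ , _ , p) _ = p
  removeBox-partition (suc (suc x) ∷ xs) zero (_ , _ , p) e = s≤s z≤n , ≤-pred (<ᵇ≡true⇒< e) , p
  removeBox-partition (x ∷ xs) (suc c) (h , h' , p) e =
    h , ≤-trans (subst (row (removeBox c xs) 0 ≤_) (row-removeBox xs c 0 p e) (m≤m+n _ _)) h' ,
        removeBox-partition xs c p e

  ind-≢ : ∀ {i a} x → i ≢ a → ind (i ≡ᵇ a) x ≡ 0
  ind-≢ {i} {a} x ne rewrite ≢⇒≡ᵇ≡false ne = refl

  ind-refl : ∀ a x → ind (a ≡ᵇ a) x ≡ x
  ind-refl a x rewrite ≡ᵇ-refl a = refl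

  row-addBox-≢ : ∀ ν a i → a ≤ length ν → i ≢ a → row (addBox a ν) i ≡ row ν i
  row-addBox-≢ ν a i h ne = trans (row-addBox ν a i h) (trans (cong (row ν i +_) (ind-≢ 1 ne)) (+-identityʳ _))

  row-addBox-≡ : ∀ ν a → a ≤ length ν → row (addBox a ν) a ≡ suc (row ν a)
  row-addBox-≡ ν a h = trans (row-addBox ν a a h) (trans (cong (row ν a +_) (ind-refl a 1)) (+-comm _ 1))

  row-removeBox-≢ : ∀ ν c i → IsPartition ν → removable ν c ≡ true → i ≢ c → row (removeBox c ν) i ≡ row ν i
  row-removeBox-≢ ν c i p e ne =
    trans (sym (+-identityʳ _)) (trans (cong (row (removeBox c ν) i +_) (sym (ind-≢ 1 ne)))
      (row-removeBox ν c i p e))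

  row-removeBox-≡ : ∀ ν c → IsPartition ν → removable ν c ≡ true → suc (row (removeBox c ν) c) ≡ row ν c
  row-removeBox-≡ ν c p e =
    trans (+-comm 1 _) (trans (cong (row (removeBox c ν) c +_) (sym (ind-refl c 1)))
      (row-removeBox ν c c p e))

  addable-removeBox : ∀ ν c → IsPartition ν → removable ν c ≡ true → addable (removeBox c ν) c ≡ true
  addable-removeBox ν zero p e = refl
  addable-removeBox ν (suc c) p e =
    <⇒<ᵇ≡true (subst (row (removeBox (suc c) ν) (suc c) <_)
      (sym (row-removeBox-≢ ν (suc c) c p e (λ q → 1+n≢n (sym q)))) lt)
    where
    lt : row (removeBox (suc c) ν) (suc c) < row ν c
    lt = ≤-trans (≤-reflexive (row-removeBox-≡ ν (suc c) p e)) (row-suc-≤ ν p c)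

  addable-removeBox-≢ : ∀ ν c a → IsPartition ν → removable ν c ≡ true → a ≢ c →
    addable (removeBox c ν) a ≡ addable ν a ∧ not (blocks ν c a)
  addable-removeBox-≢ ν c zero p e ne = refl
  addable-removeBox-≢ ν c (suc a) p e ne with a ≟ c
  ... | yes refl rewrite e | ≡ᵇ-refl a | row-removeBox-≢ ν a (suc a) p e 1+n≢n | sym (row-removeBox-≡ ν a p e) =
    <ᵇ≡not-≡ᵇ (row ν (suc a)) (row (removeBox a ν) a) (subst (row ν (suc a) <_)
        (sym (row-removeBox-≡ ν a p e)) (<ᵇ≡true⇒< e))
  ... | no a≢c rewrite ≢⇒≡ᵇ≡false a≢c | row-removeBox-≢ ν c (suc a) p e ne | row-removeBox-≢ ν c a p e a≢c =
    sym (∧-identityʳ _)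

  removable-addBox : ∀ ν e → IsPartition ν → addable ν e ≡ true → removable (addBox e ν) e ≡ true
  removable-addBox ν e p ea rewrite row-addBox-≢ ν e (suc e) (addable⇒≤length ν e ea) 1+n≢n
      | row-addBox-≡ ν e (addable⇒≤length ν e ea) =
    <⇒<ᵇ≡true {row ν (suc e)} {suc (row ν e)} (s≤s (row-suc-≤ ν p e))

  removable-addBox-≢ : ∀ ν e d → IsPartition ν → addable ν e ≡ true → d ≢ e →
    removable (addBox e ν) d ≡ removable ν d ∧ not (blocks ν d e)
  removable-addBox-≢ ν e d p ea ne with e ≟ suc d
  ... | yes refl rewrite ≡ᵇ-refl d | row-addBox-≡ ν (suc d) (addable⇒≤length ν (suc d) ea)
      | row-addBox-≢ ν (suc d) d (addable⇒≤length ν (suc d) ea) ne =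
    suc-<ᵇ≡<ᵇ∧not-≡ᵇ (row ν (suc d)) (row ν d)
  ... | no e≢ rewrite ≢⇒≡ᵇ≡false e≢ | row-addBox-≢ ν e (suc d) (addable⇒≤length ν e ea) (λ q → e≢ (sym q))
      | row-addBox-≢ ν e d (addable⇒≤length ν e ea) ne = sym (∧-identityʳ _)

  addable-addBox-≢ : ∀ μ a c → a ≤ length μ → addable μ c ≡ true → a ≢ c → addable (addBox a μ) c ≡ true
  addable-addBox-≢ μ a zero h e ne = refl
  addable-addBox-≢ μ a (suc c) h e ne rewrite row-addBox-≢ μ a (suc c) h (λ q → ne (sym q)) =
    <⇒<ᵇ≡true {row μ (suc c)} {row (addBox a μ) c} (≤-trans (<ᵇ≡true⇒< {row μ (suc c)} {row μ c} e)
        (subst (row μ c ≤_) (sym (row-addBox μ a c h)) (m≤m+n _ _)))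

  removeBox-addBox : ∀ μ c → IsPartition μ → addable μ c ≡ true → removeBox c (addBox c μ) ≡ μ
  removeBox-addBox μ c p ea =
    partition-ext _ _ (removeBox-partition (addBox c μ) c pA (removable-addBox μ c p ea)) p rows
    where
    h : c ≤ length μ
    h = addable⇒≤length μ c ea
    pA : IsPartition (addBox c μ)
    pA = addBox-partition μ c p ea
    rows : ∀ i → row (removeBox c (addBox c μ)) i ≡ row μ i
    rows i with i ≟ c
    ... | yes refl =
      suc-injective (trans (row-removeBox-≡ (addBox c μ) i pA (removable-addBox μ i p ea))
        (row-addBox-≡ μ i h))
    ... | no ne =
      trans (row-removeBox-≢ (addBox c μ) c i pA (removable-addBox μ c p ea) ne) (row-addBox-≢ μ c i h ne)

  addBox-removeBox : ∀ ν c → IsPartition ν → removable ν c ≡ true → addBox c (removeBox c ν) ≡ ν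
  addBox-removeBox ν c p e =
    partition-ext _ _ (addBox-partition (removeBox c ν) c pR (addable-removeBox ν c p e)) p rows
    where
    pR : IsPartition (removeBox c ν)
    pR = removeBox-partition ν c p e
    h : c ≤ length (removeBox c ν)
    h = addable⇒≤length (removeBox c ν) c (addable-removeBox ν c p e)
    rows : ∀ i → row (addBox c (removeBox c ν)) i ≡ row ν i
    rows i with i ≟ c
    ... | yes refl = trans (row-addBox-≡ (removeBox i ν) i h) (row-removeBox-≡ ν i p e)
    ... | no ne = trans (row-addBox-≢ (removeBox c ν) c i h ne) (row-removeBox-≢ ν c i p e ne)

  addBox-comm : ∀ μ a c → IsPartition μ → addable μ a ≡ true → addable μ c ≡ true → a ≢ c →
    addBox a (addBox c μ) ≡ addBox c (addBox a μ)
  addBox-comm μ a c p ea ec ne = partition-ext _ _ p1 p2 rows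
    where
    ha : a ≤ length μ
    ha = addable⇒≤length μ a ea
    hc : c ≤ length μ
    hc = addable⇒≤length μ c ec
    p1 : IsPartition (addBox a (addBox c μ))
    p1 =
      addBox-partition (addBox c μ) a (addBox-partition μ c p ec)
        (addable-addBox-≢ μ c a hc ea (λ q → ne (sym q)))
    p2 : IsPartition (addBox c (addBox a μ))
    p2 = addBox-partition (addBox a μ) c (addBox-partition μ a p ea) (addable-addBox-≢ μ a c ha ec ne)
    ha' : a ≤ length (addBox c μ)
    ha' = ≤-trans ha (length-addBox-≥ μ c)
    hc' : c ≤ length (addBox a μ)
    hc' = ≤-trans hc (length-addBox-≥ μ a)
    rows : ∀ i → row (addBox a (addBox c μ)) i ≡ row (addBox c (addBox a μ)) i
    rows i rewrite row-addBox (addBox c μ) a i ha' | row-addBox (addBox a μ) c i hc' | row-addBox μ c i hc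
        | row-addBox μ a i ha =
      trans (+-assoc (row μ i) _ _) (trans (cong (row μ i +_) (+-comm (ind (i ≡ᵇ c) 1) _))
          (sym (+-assoc (row μ i) _ _)))

  sum-addBox : ∀ a ν → sum (addBox a ν) ≡ suc (sum ν)
  sum-addBox zero    []       = refl
  sum-addBox zero    (x ∷ xs) = refl
  sum-addBox (suc a) []       = refl
  sum-addBox (suc a) (x ∷ xs) = trans (cong (x +_) (sum-addBox a xs)) (+-suc x _)

  sum-removeBox : ∀ ν r → IsPartition ν → removable ν r ≡ true → suc (sum (removeBox r ν)) ≡ sum ν
  sum-removeBox ν r p e = trans (sym (sum-addBox r (removeBox r ν))) (cong sum (addBox-removeBox ν r p e))

  sum≡0⇒[] : ∀ ν → IsPartition ν → sum ν ≡ 0 → ν ≡ []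
  sum≡0⇒[] []            _        _  = refl
  sum≡0⇒[] (zero ∷ ν)    (() , _) _
  sum≡0⇒[] (suc x ∷ ν)   _        ()

  row0≤sum : ∀ ν → row ν 0 ≤ sum ν
  row0≤sum []       = z≤n
  row0≤sum (x ∷ xs) = m≤m+n x _

  Σ<-row≡sum : ∀ ν → Σ< (length ν) (row ν) ≡ sum ν
  Σ<-row≡sum []      = refl
  Σ<-row≡sum (x ∷ ν) = cong (x +_) (Σ<-row≡sum ν)


-- Young's lattice is differential: D U = U D + I, where U adds and D removes a box.
-- `removeAdd+diagonal≡addRemove` is a weighted, bijective form of this identity.  On the
-- remove-then-add side a pair (c, a) with a = c is re-routed by the local rule
-- growBox/growCarry to the diagonal pair (bumpRow ν c, bumpRow ν c); `bumpRow` matches the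
-- removable rows with the addable rows other than the new row `length ν`, which gives I.
module UpDownCommutation where

  open import Data.Nat
  open import Data.Nat.Properties
  open import Data.Bool using (true; false; if_then_else_; _∧_; not)
  open import Data.Bool.Properties using (∧-zeroʳ; ∧-identityʳ)
  open import Data.List using (List; []; _∷_; length)
  open import Data.Product using (_,_)
  open import Data.Empty using (⊥-elim)
  open import Relation.Binary.PropositionalEquality
  open import Relation.Nullary using (yes; no)
  open BooleanComparisons
  open NatSums
  open YoungDiagrams

  -- the highest row of the same length as row c
  bumpRow : List ℕ → ℕ → ℕ
  bumpRow ν       zero    = zero
  bumpRow []      (suc c) = zero
  bumpRow (x ∷ ν) (suc c) = if row ν c ≡ᵇ x then zero else suc (bumpRow ν c)

  growBox : List ℕ → ℕ → ℕ → ℕ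
  growBox ν c a = if a ≡ᵇ c then bumpRow ν c else a

  growCarry : List ℕ → ℕ → ℕ → ℕ
  growCarry ν c a = if a ≡ᵇ c then bumpRow ν c else c

  bumpRow-≤ : ∀ ν c → bumpRow ν c ≤ c
  bumpRow-≤ ν       zero    = z≤n
  bumpRow-≤ []      (suc c) = z≤n
  bumpRow-≤ (x ∷ ν) (suc c) with row ν c ≡ᵇ x
  ... | true  = z≤n
  ... | false = s≤s (bumpRow-≤ ν c)

  bumpRow≡0⇒ : ∀ ν c → bumpRow ν c ≡ 0 → row ν c ≡ row ν 0
  bumpRow≡0⇒ []      c       _ = refl
  bumpRow≡0⇒ (x ∷ ν) zero    _ = refl
  bumpRow≡0⇒ (x ∷ ν) (suc c) e with row ν c ≡ᵇ x in eq
  ... | true = ≡ᵇ≡true⇒≡ {row ν c} {x} eq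
  bumpRow≡0⇒ (x ∷ ν) (suc c) () | false

  bumpRow≡0⇐ : ∀ ν c → row ν c ≡ row ν 0 → bumpRow ν c ≡ 0
  bumpRow≡0⇐ []      zero    _ = refl
  bumpRow≡0⇐ []      (suc c) _ = refl
  bumpRow≡0⇐ (x ∷ ν) zero    _ = refl
  bumpRow≡0⇐ (x ∷ ν) (suc c) e rewrite ≡⇒≡ᵇ≡true {row ν c} {x} e = refl

  addable-bumpRow : ∀ ν c → IsPartition ν → removable ν c ≡ true → addable ν (bumpRow ν c) ≡ true
  addable-bumpRow []      c       p ()
  addable-bumpRow (x ∷ ν) zero    p e = refl
  addable-bumpRow (x ∷ ν) (suc c) (h , h' , p) e with row ν c ≡ᵇ x in eq
  ... | true = refl
  ... | false with bumpRow ν c in eqn | addable-bumpRow ν c p e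
  ...   | zero  | _  = <⇒<ᵇ≡true {row ν 0} {x}
                         (≤∧≢⇒< h' (λ q → ≡ᵇ≡false⇒≢ {row ν c} {x} eq (trans (bumpRow≡0⇒ ν c eqn) q)))
  ...   | suc n | ih = ih

  private
    skipOne : (ℕ → ℕ) → ℕ → ℕ
    skipOne φ zero    = φ 0
    skipOne φ (suc i) = φ (suc (suc i))

    ind-bumpRow-cons-< : ∀ x ν → IsPartition ν → row ν 0 < x → (φ : ℕ → ℕ) → ∀ c →
      ind (removable ν c) (φ (bumpRow (x ∷ ν) (suc c))) ≡ ind (removable ν c) (φ (suc (bumpRow ν c)))
    ind-bumpRow-cons-< x ν p lt φ c
      rewrite ≢⇒≡ᵇ≡false {row ν c} {x} (<⇒≢ (≤-<-trans (row-antitone ν p {0} {c} z≤n) lt)) = refl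

    ind-bumpRow-cons-≡ : ∀ x ν → row ν 0 ≡ x → (φ : ℕ → ℕ) → ∀ c →
      ind (removable ν c) (φ (bumpRow (x ∷ ν) (suc c))) ≡ ind (removable ν c) (skipOne φ (bumpRow ν c))
    ind-bumpRow-cons-≡ x ν x≡ φ c with row ν c ≡ᵇ x in e2
    ... | true rewrite bumpRow≡0⇐ ν c (trans (≡ᵇ≡true⇒≡ {row ν c} {x} e2) (sym x≡)) = refl
    ... | false with bumpRow ν c in e3
    ...   | zero  = ⊥-elim (≡ᵇ≡false⇒≢ {row ν c} {x} e2 (trans (bumpRow≡0⇒ ν c e3) x≡))
    ...   | suc k = refl

    skipOne-length : ∀ x ν → 0 < x → row ν 0 ≡ x → (φ : ℕ → ℕ) → skipOne φ (length ν) ≡ φ (suc (length ν))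
    skipOne-length x []       h e φ = ⊥-elim (<⇒≢ h e)
    skipOne-length x (y ∷ ys) h e φ = refl

  Σ-removable-bumpRow : ∀ ν → IsPartition ν → ∀ N → suc (length ν) ≤ N → ∀ (φ : ℕ → ℕ) →
    Σ< N (λ c → ind (removable ν c) (φ (bumpRow ν c))) + φ (length ν) ≡ Σ< N (λ e → ind (addable ν e) (φ e))
  Σ-removable-bumpRow [] _ (suc N) _ φ =
    trans (cong (_+ φ 0) (Σ<-0 (suc N) (λ _ → refl)))
          (sym (trans (cong (φ 0 +_) (Σ<-0 N (λ _ → refl))) (+-identityʳ _)))
  Σ-removable-bumpRow (x ∷ ν) (h , h' , p) (suc (suc N)) (s≤s (s≤s l)) φ with row ν 0 <ᵇ x in eq
  ... | true =
    trans (cong (λ z → φ 0 + z + φ (suc (length ν)))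
                (Σ<-cong (suc N) (ind-bumpRow-cons-< x ν p (<ᵇ≡true⇒< {row ν 0} {x} eq) φ)))
          (trans (+-assoc (φ 0) _ _) (cong (φ 0 +_) (Σ-removable-bumpRow ν p (suc N) (s≤s l) (λ i → φ (suc i)))))
  ... | false =
    trans (cong (_+ φ (suc (length ν))) (Σ<-cong (suc N) (ind-bumpRow-cons-≡ x ν x≡ φ)))
          (trans (cong (Σ< (suc N) (λ c → ind (removable ν c) (skipOne φ (bumpRow ν c))) +_)
                       (sym (skipOne-length x ν h x≡ φ)))
                 (Σ-removable-bumpRow ν p (suc N) (s≤s l) (skipOne φ)))
    where
    x≡ : row ν 0 ≡ x
    x≡ = ≤-antisym h' (<ᵇ≡false⇒≥ {row ν 0} {x} eq)

  ind-swap-∧ : ∀ r d j b x → ind r (ind (d ∧ j ∧ b) x) ≡ ind d (ind (r ∧ j ∧ b) x)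
  ind-swap-∧ true  true  j b x = refl
  ind-swap-∧ true  false j b x = refl
  ind-swap-∧ false true  j b x = refl
  ind-swap-∧ false false j b x = refl

  module _ (ν : List ℕ) (p : IsPartition ν) (N : ℕ) (ℓ+2≤N : suc (suc (length ν)) ≤ N)
           (φ : ℕ → ℕ → ℕ) where

    private
      offDiagonalDown : ℕ → ℕ
      offDiagonalDown c = Σ< N (λ a → ind (addable ν a ∧ not (blocks ν c a) ∧ not (a ≡ᵇ c)) (φ a c))

      offDiagonalUp : ℕ → ℕ
      offDiagonalUp e = Σ< N (λ d → ind (removable ν d ∧ not (blocks ν d e) ∧ not (d ≡ᵇ e)) (φ e d))

    Σ-addable-removeBox : ∀ c → removable ν c ≡ true →
      Σ< N (λ a → ind (addable (removeBox c ν) a) (φ (growBox ν c a) (growCarry ν c a)))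
        ≡ offDiagonalDown c + φ (bumpRow ν c) (bumpRow ν c)
    Σ-addable-removeBox c e =
      trans (Σ<-remove N c (addable (removeBox c ν)) (λ a → φ (growBox ν c a) (growCarry ν c a)) c<N)
            (cong₂ _+_ (Σ<-cong N offDiagonal) diagonal)
      where
      c<N : c < N
      c<N = <-trans (removable⇒<length ν c e) (<-trans (n<1+n _) ℓ+2≤N)
      diagonal : ind (addable (removeBox c ν) c) (φ (growBox ν c c) (growCarry ν c c)) ≡ φ (bumpRow ν c) (bumpRow ν c)
      diagonal rewrite addable-removeBox ν c p e | ≡ᵇ-refl c = refl
      offDiagonal : ∀ a → ind (addable (removeBox c ν) a ∧ not (a ≡ᵇ c)) (φ (growBox ν c a) (growCarry ν c a))
               ≡ ind (addable ν a ∧ not (blocks ν c a) ∧ not (a ≡ᵇ c)) (φ a c)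
      offDiagonal a with a ≟ c
      ... | yes refl rewrite ≡ᵇ-refl a | ∧-zeroʳ (addable (removeBox a ν) a) | ∧-zeroʳ (not (blocks ν a a))
                           | ∧-zeroʳ (addable ν a) = refl
      ... | no ne rewrite ≢⇒≡ᵇ≡false ne | addable-removeBox-≢ ν c a p e ne
                        | ∧-identityʳ (addable ν a ∧ not (blocks ν c a)) | ∧-identityʳ (not (blocks ν c a)) = refl

    Σ-removable-addBox : ∀ e → addable ν e ≡ true →
      Σ< N (λ d → ind (removable (addBox e ν) d) (φ e d)) ≡ offDiagonalUp e + φ e e
    Σ-removable-addBox e ea =
      trans (Σ<-remove N e (removable (addBox e ν)) (λ d → φ e d) e<N) (cong₂ _+_ (Σ<-cong N offDiagonal) diagonal)
      where
      e<N : e < N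
      e<N = <-trans (s≤s (addable⇒≤length ν e ea)) ℓ+2≤N
      diagonal : ind (removable (addBox e ν) e) (φ e e) ≡ φ e e
      diagonal rewrite removable-addBox ν e p ea = refl
      offDiagonal : ∀ d → ind (removable (addBox e ν) d ∧ not (d ≡ᵇ e)) (φ e d)
               ≡ ind (removable ν d ∧ not (blocks ν d e) ∧ not (d ≡ᵇ e)) (φ e d)
      offDiagonal d with d ≟ e
      ... | yes refl rewrite ≡ᵇ-refl d | ∧-zeroʳ (removable (addBox d ν) d) | ∧-zeroʳ (not (blocks ν d d))
                           | ∧-zeroʳ (removable ν d) = refl
      ... | no ne rewrite ≢⇒≡ᵇ≡false ne | removable-addBox-≢ ν e d p ea ne
                        | ∧-identityʳ (removable ν d ∧ not (blocks ν d e)) | ∧-identityʳ (not (blocks ν d e)) =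
                          refl

    Σ-offDiagonal-swap : Σ< N (λ c → ind (removable ν c) (offDiagonalDown c))
                       ≡ Σ< N (λ e → ind (addable ν e) (offDiagonalUp e))
    Σ-offDiagonal-swap =
      trans (Σ<-cong N (λ c → ind-Σ< (removable ν c) N _))
      (trans (Σ<-swap N N _)
      (trans (Σ<-cong N (λ a → Σ<-cong N (λ c → swapped a c)))
             (sym (Σ<-cong N (λ e → ind-Σ< (addable ν e) N _)))))
      where
      swapped : ∀ a c → ind (removable ν c) (ind (addable ν a ∧ not (blocks ν c a) ∧ not (a ≡ᵇ c)) (φ a c))
                 ≡ ind (addable ν a) (ind (removable ν c ∧ not (blocks ν c a) ∧ not (c ≡ᵇ a)) (φ a c))
      swapped a c rewrite ≡ᵇ-sym a c =
        ind-swap-∧ (removable ν c) (addable ν a) (not (blocks ν c a)) (not (c ≡ᵇ a)) (φ a c)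

    removeAdd+diagonal≡addRemove :
      Σ< N (λ c → ind (removable ν c) (Σ< N (λ a → ind (addable (removeBox c ν) a) (φ (growBox ν c a)
          (growCarry ν c a)))))
        + φ (length ν) (length ν)
      ≡ Σ< N (λ e → ind (addable ν e) (Σ< N (λ d → ind (removable (addBox e ν) d) (φ e d))))
    removeAdd+diagonal≡addRemove =
      trans (cong (_+ φ (length ν) (length ν)) (trans (Σ<-cong N down) (Σ<-+ N _ _)))
      (trans (+-assoc (Σ< N (λ c → ind (removable ν c) (offDiagonalDown c))) _ _)
      (trans (cong₂ _+_ Σ-offDiagonal-swap (Σ-removable-bumpRow ν p N (<⇒≤ ℓ+2≤N) (λ i → φ i i)))
      (trans (sym (Σ<-+ N _ _)) (Σ<-cong N up))))
      where
      down : ∀ c →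
        ind (removable ν c) (Σ< N (λ a → ind (addable (removeBox c ν) a) (φ (growBox ν c a) (growCarry ν c
          a))))
                 ≡ ind (removable ν c) (offDiagonalDown c) + ind (removable ν c) (φ (bumpRow ν c) (bumpRow ν c))
      down c with removable ν c in e
      ... | true  = Σ-addable-removeBox c e
      ... | false = refl
      up : ∀ e → ind (addable ν e) (offDiagonalUp e) + ind (addable ν e) (φ e e)
               ≡ ind (addable ν e) (Σ< N (λ d → ind (removable (addBox e ν) d) (φ e d)))
      up e with addable ν e in ea
      ... | true  = sym (Σ-removable-addBox e ea)
      ... | false = refl


-- A standard Young tableau with m boxes is encoded by its Yamanouchi word of rows, newest
-- box first: `a ∷ w` adds the box of the largest entry to row a of `shape w`.
module Tableaux where

  open import Data.Nat
  open import Data.Nat.Properties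
  open import Data.Nat.ListAction using (sum)
  open import Data.Bool using (true; false)
  open import Data.List using (List; []; _∷_; length; map; concatMap; filterᵇ; upTo)
  open import Data.List.Relation.Unary.All as All using (All; []; _∷_)
  open import Data.Product using (_×_; _,_; proj₁; proj₂; uncurry)
  open import Data.Unit using (⊤; tt)
  open import Relation.Binary.PropositionalEquality
  open import Relation.Nullary using (yes; no)
  open ≡-Reasoning
  open BooleanComparisons
  open NatSums
  open ListSums
  open YoungDiagrams
  open UpDownCommutation

  shape : List ℕ → List ℕ
  shape []      = []
  shape (a ∷ w) = addBox a (shape w)

  sum-shape : ∀ w → sum (shape w) ≡ length w
  sum-shape []      = refl
  sum-shape (a ∷ w) = trans (sum-addBox a (shape w)) (cong suc (sum-shape w))

  Yamanouchi : List ℕ → Set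
  Yamanouchi []      = ⊤
  Yamanouchi (a ∷ w) = (addable (shape w) a ≡ true) × Yamanouchi w

  shape-partition : ∀ w → Yamanouchi w → IsPartition (shape w)
  shape-partition []      _       = tt
  shape-partition (a ∷ w) (e , v) = addBox-partition (shape w) a (shape-partition w v) e

  addableRows : List ℕ → List ℕ
  addableRows ν = filterᵇ (addable ν) (upTo (suc (length ν)))

  Σ-addable : List ℕ → (ℕ → ℕ) → ℕ
  Σ-addable ν g = Σ< (suc (length ν)) (λ i → ind (addable ν i) (g i))

  Σ-removable : List ℕ → (ℕ → ℕ) → ℕ
  Σ-removable ν g = Σ< (length ν) (λ i → ind (removable ν i) (g i))

  Tableaux : ℕ → List (List ℕ)
  Tableaux zero    = [] ∷ []
  Tableaux (suc m) = concatMap (λ w → map (_∷ w) (addableRows (shape w))) (Tableaux m)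

  sumL-addableRows : ∀ ν g → sumL (addableRows ν) g ≡ Σ-addable ν g
  sumL-addableRows ν g = trans (sumL-filterᵇ (addable ν) (upTo (suc (length ν))) g) (sumL-upTo (suc (length ν)) _)

  removable-beyond : ∀ ν i → length ν ≤ i → removable ν i ≡ false
  removable-beyond ν i h rewrite row-beyond ν i h = refl

  addable-beyond : ∀ ν i → suc (length ν) ≤ i → addable ν i ≡ false
  addable-beyond ν (suc i) (s≤s h) = removable-beyond ν i h

  Σ-addable-extend : ∀ ν N g → suc (length ν) ≤ N → Σ< N (λ i → ind (addable ν i) (g i)) ≡ Σ-addable ν g
  Σ-addable-extend ν N g h =
    Σ<-extend (suc (length ν)) N _ h (λ i hi _ → cong (λ b → ind b (g i)) (addable-beyond ν i hi))

  Σ-removable-extend : ∀ ν N g → length ν ≤ N → Σ< N (λ i → ind (removable ν i) (g i)) ≡ Σ-removable ν g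
  Σ-removable-extend ν N g h =
    Σ<-extend (length ν) N _ h (λ i hi _ → cong (λ b → ind b (g i)) (removable-beyond ν i hi))

  Σ-addable-+ : ∀ ν (f g : ℕ → ℕ) → Σ-addable ν (λ a → f a + g a) ≡ Σ-addable ν f + Σ-addable ν g
  Σ-addable-+ ν f g =
    trans (Σ<-cong (suc (length ν)) (λ i → ind-+ (addable ν i) (f i) (g i)))
        (Σ<-+ (suc (length ν)) (λ i → ind (addable ν i) (f i)) (λ i → ind (addable ν i) (g i)))

  Σ-addable-Σ< : ∀ ν K (g : ℕ → ℕ → ℕ) → Σ-addable ν (λ a → Σ< K (g a)) ≡ Σ< K (λ k → Σ-addable ν (λ a → g a k))
  Σ-addable-Σ< ν K g =
    trans (Σ<-cong (suc (length ν)) (λ i → ind-Σ< (addable ν i) K (g i)))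
        (Σ<-swap (suc (length ν)) K (λ i k → ind (addable ν i) (g i k)))

  Tableaux-yamanouchi : ∀ m → All (λ w → Yamanouchi w × (length w ≡ m)) (Tableaux m)
  Tableaux-yamanouchi zero    = (tt , refl) ∷ []
  Tableaux-yamanouchi (suc m) =
    All-concatMap (λ w → map (_∷ w) (addableRows (shape w))) (Tableaux m) (Tableaux-yamanouchi m)
      (λ w (v , l) → All-map⁺ (_∷ w) (addableRows (shape w))
         (All-filterᵇ (addable (shape w)) (upTo (suc (length (shape w)))) (All.universal (λ _ → tt) _)
             (λ _ _ e → e))
         (λ a e → (e , v) , cong suc l))

  sumL-Tableaux-suc : ∀ m (F : List ℕ → ℕ) →
    sumL (Tableaux (suc m)) F ≡ sumL (Tableaux m) (λ w → Σ-addable (shape w) (λ a → F (a ∷ w)))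
  sumL-Tableaux-suc m F =
    trans (sumL-concatMap (λ w → map (_∷ w) (addableRows (shape w))) (Tableaux m) F)
          (sumL-cong (Tableaux m) (λ w → trans (sumL-map (_∷ w) (addableRows (shape w)) F)
                                               (sumL-addableRows (shape w) (λ a → F (a ∷ w)))))

  addable-newRow : ∀ ν → IsPartition ν → addable ν (length ν) ≡ true
  addable-newRow []       _ = refl
  addable-newRow (x ∷ xs) p rewrite row-beyond xs (length xs) ≤-refl =
    <⇒<ᵇ≡true {0} {row (x ∷ xs) (length xs)} (row-positive (x ∷ xs) p (length xs) ≤-refl)

  growStep : ℕ → List ℕ × ℕ → List ℕ × ℕ
  growStep a (w , c) = growBox (shape w) c a ∷ w , growCarry (shape w) c a

  -- Fomin's growth: this is how the shapes attached to the prefixes of a permutation change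
  -- when a new smallest letter is inserted with k letters after it; the second component is
  -- the row in which the final shape exceeds `shape w`.
  grow : ℕ → List ℕ → List ℕ × ℕ
  grow zero    w       = length (shape w) ∷ w , length (shape w)
  grow (suc k) []      = [] , 0
  grow (suc k) (a ∷ w) = growStep a (grow k w)

  grow-shape : ∀ k w → Yamanouchi w → k ≤ length w →
    (addable (shape w) (proj₂ (grow k w)) ≡ true) × (shape (proj₁ (grow k w)) ≡ addBox (proj₂ (grow k w))
        (shape w))
  grow-shape zero    w       v        h       = addable-newRow (shape w) (shape-partition w v) , refl
  grow-shape (suc k) (a ∷ w) (ea , v) (s≤s h) with grow k w | grow-shape k w v h
  ... | (w'' , c) | (ec , sh) with a ≟ c
  ...   | yes refl rewrite ≡ᵇ-refl a | sh =
          addable-bumpRow (addBox a μ) a (addBox-partition μ a p ea) (removable-addBox μ a p ea) , refl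
    where
    μ : List ℕ
    μ = shape w
    p : IsPartition μ
    p = shape-partition w v
  ...   | no ne rewrite ≢⇒≡ᵇ≡false ne | sh =
          addable-addBox-≢ μ a c (addable⇒≤length μ a ea) ec ne , addBox-comm μ a c p ea ec ne
    where
    μ : List ℕ
    μ = shape w
    p : IsPartition μ
    p = shape-partition w v

  regrow : (List ℕ → ℕ → ℕ) → List ℕ → ℕ → ℕ
  regrow Ψ w c = Σ-addable (removeBox c (shape w)) (λ a → uncurry Ψ (growStep a (w , c)))

  Σ-removable-regrow : ∀ (Ψ : List ℕ → ℕ → ℕ) w → Yamanouchi w →
    Σ-removable (shape w) (regrow Ψ w) + Ψ (length (shape w) ∷ w) (length (shape w))
    ≡ Σ-addable (shape w) (λ e → Σ-removable (addBox e (shape w)) (Ψ (e ∷ w)))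
  Σ-removable-regrow Ψ w v = begin
    Σ-removable ν (regrow Ψ w) + Ψ (length ν ∷ w) (length ν)
      ≡⟨ cong (_+ Ψ (length ν ∷ w) (length ν)) (trans (sym (Σ-removable-extend ν N (regrow Ψ w) ℓ≤N))
          (Σ<-cong N pad)) ⟩
    Σ< N (λ c → ind (removable ν c) (Σ< N (λ a → ind (addable (removeBox c ν) a) (uncurry Ψ (growStep a (w ,
        c))))))
      + Ψ (length ν ∷ w) (length ν)
      ≡⟨ removeAdd+diagonal≡addRemove ν (shape-partition w v) N ≤-refl (λ e d → Ψ (e ∷ w) d) ⟩
    Σ< N (λ e → ind (addable ν e) (Σ< N (λ d → ind (removable (addBox e ν) d) (Ψ (e ∷ w) d))))
      ≡⟨ Σ<-cong N unpad ⟩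
    Σ< N (λ e → ind (addable ν e) (Σ-removable (addBox e ν) (Ψ (e ∷ w))))
      ≡⟨ Σ-addable-extend ν N (λ e → Σ-removable (addBox e ν) (Ψ (e ∷ w))) (n≤1+n _) ⟩
    Σ-addable ν (λ e → Σ-removable (addBox e ν) (Ψ (e ∷ w))) ∎
    where
    ν : List ℕ
    ν = shape w
    N : ℕ
    N = suc (suc (length ν))
    ℓ≤N : length ν ≤ N
    ℓ≤N = ≤-trans (n≤1+n _) (n≤1+n _)
    pad : ∀ c → ind (removable ν c) (regrow Ψ w c)
              ≡ ind (removable ν c) (Σ< N (λ a → ind (addable (removeBox c ν) a) (uncurry Ψ (growStep a (w ,
                  c)))))
    pad c = cong (ind (removable ν c))
                 (sym (Σ-addable-extend (removeBox c ν) N (λ a → uncurry Ψ (growStep a (w , c)))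
                     (s≤s (≤-trans (length-removeBox-≤ ν c) (n≤1+n _)))))
    unpad : ∀ e → ind (addable ν e) (Σ< N (λ d → ind (removable (addBox e ν) d) (Ψ (e ∷ w) d)))
                ≡ ind (addable ν e) (Σ-removable (addBox e ν) (Ψ (e ∷ w)))
    unpad e =
      cong (ind (addable ν e)) (Σ-removable-extend (addBox e ν) N (Ψ (e ∷ w))
        (≤-trans (length-addBox-≤ ν e) (n≤1+n _)))

  -- `grow` is a bijection from the pairs (w, k) with w ∈ Tableaux m and k ≤ m onto the pairs
  -- (w', c) with w' ∈ Tableaux (suc m) and c a removable row of shape w'.
  sumL-grow : ∀ m (Ψ : List ℕ → ℕ → ℕ) →
    sumL (Tableaux m) (λ w → Σ< (suc m) (λ k → uncurry Ψ (grow k w)))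
    ≡ sumL (Tableaux (suc m)) (λ w' → Σ-removable (shape w') (Ψ w'))
  sumL-grow zero    Ψ = refl
  sumL-grow (suc m) Ψ = begin
    sumL (Tableaux (suc m)) (λ w → Σ< (suc (suc m)) (λ k → uncurry Ψ (grow k w)))
      ≡⟨ sumL-Tableaux-suc m _ ⟩
    sumL (Tableaux m) (λ w → Σ-addable (shape w) (λ a → newRow (a ∷ w) + later w a))
      ≡⟨ sumL-cong (Tableaux m) (λ w → Σ-addable-+ (shape w) (λ a → newRow (a ∷ w)) (later w)) ⟩
    sumL (Tableaux m) (λ w → Σ-addable (shape w) (λ a → newRow (a ∷ w)) + Σ-addable (shape w) (later w))
      ≡⟨ sumL-+ (Tableaux m) _ _ ⟩
    sumL (Tableaux m) (λ w → Σ-addable (shape w) (λ a → newRow (a ∷ w)))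
      + sumL (Tableaux m) (λ w → Σ-addable (shape w) (later w))
      ≡⟨ cong₂ _+_ (sym (sumL-Tableaux-suc m newRow)) regrown ⟩
    sumL (Tableaux (suc m)) newRow + sumL (Tableaux (suc m)) (λ w' → Σ-removable (shape w') (regrow Ψ w'))
      ≡⟨ +-comm (sumL (Tableaux (suc m)) newRow) _ ⟩
    sumL (Tableaux (suc m)) (λ w' → Σ-removable (shape w') (regrow Ψ w')) + sumL (Tableaux (suc m)) newRow
      ≡⟨ sym (sumL-+ (Tableaux (suc m)) _ newRow) ⟩
    sumL (Tableaux (suc m)) (λ w' → Σ-removable (shape w') (regrow Ψ w') + newRow w')
      ≡⟨ sumL-cong-All (Tableaux (suc m)) (Tableaux-yamanouchi (suc m))
          (λ w' (v , _) → Σ-removable-regrow Ψ w' v) ⟩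
    sumL (Tableaux (suc m)) (λ w' → Σ-addable (shape w') (λ e → Σ-removable (addBox e (shape w')) (Ψ (e ∷ w'))))
      ≡⟨ sym (sumL-Tableaux-suc (suc m) _) ⟩
    sumL (Tableaux (suc (suc m))) (λ τ → Σ-removable (shape τ) (Ψ τ)) ∎
    where
    newRow : List ℕ → ℕ
    newRow w' = Ψ (length (shape w') ∷ w') (length (shape w'))
    later : List ℕ → ℕ → ℕ
    later w a = Σ< (suc m) (λ k → uncurry Ψ (growStep a (grow k w)))
    regrow-grow : ∀ w → Yamanouchi w → length w ≡ m → ∀ k → k < suc m →
      Σ-addable (shape w) (λ a → uncurry Ψ (growStep a (grow k w))) ≡ uncurry (regrow Ψ) (grow k w)
    regrow-grow w v l k k< with grow-shape k w v (subst (k ≤_) (sym l) (≤-pred k<))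
    ... | ec , sh = cong (λ ν → Σ-addable ν (λ a → uncurry Ψ (growStep a (grow k w))))
          (sym (trans (cong (removeBox (proj₂ (grow k w))) sh)
              (removeBox-addBox (shape w) (proj₂ (grow k w)) (shape-partition w v) ec)))
    regrown : sumL (Tableaux m) (λ w → Σ-addable (shape w) (later w))
            ≡ sumL (Tableaux (suc m)) (λ w' → Σ-removable (shape w') (regrow Ψ w'))
    regrown =
      trans (sumL-cong (Tableaux m) (λ w → Σ-addable-Σ< (shape w) (suc m)
          (λ a k → uncurry Ψ (growStep a (grow k w)))))
      (trans (sumL-cong-All (Tableaux m) (Tableaux-yamanouchi m)
                            (λ w (v , l) → Σ<-cong< (suc m) (regrow-grow w v l)))
             (sumL-grow m (regrow Ψ)))


module TableauCounts where

  open import Data.Nat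
  open import Data.Nat.Properties
  open import Data.Bool using (Bool; true; false; _∧_)
  open import Data.List using (List; []; _∷_; length)
  open import Data.Product using (_,_)
  open import Relation.Binary.PropositionalEquality
  open BooleanComparisons
  open NatSums
  open ListSums
  open YoungDiagrams
  open Tableaux

  eqList : List ℕ → List ℕ → Bool
  eqList []       []       = true
  eqList []       (_ ∷ _)  = false
  eqList (_ ∷ _)  []       = false
  eqList (x ∷ xs) (y ∷ ys) = (x ≡ᵇ y) ∧ eqList xs ys

  eqList≡true⇒≡ : ∀ xs ys → eqList xs ys ≡ true → xs ≡ ys
  eqList≡true⇒≡ []       []       _ = refl
  eqList≡true⇒≡ (x ∷ xs) (y ∷ ys) e with ∧≡true⁻ {x ≡ᵇ y} {eqList xs ys} e
  ... | e₁ , e₂ = cong₂ _∷_ (≡ᵇ≡true⇒≡ {x} {y} e₁) (eqList≡true⇒≡ xs ys e₂)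

  eqList-refl : ∀ xs → eqList xs xs ≡ true
  eqList-refl []       = refl
  eqList-refl (x ∷ xs) rewrite ≡ᵇ-refl x = eqList-refl xs

  ≡⇒eqList≡true : ∀ {xs ys} → xs ≡ ys → eqList xs ys ≡ true
  ≡⇒eqList≡true {xs} refl = eqList-refl xs

  tableauCount : ℕ → List ℕ → ℕ
  tableauCount m λ′ = sumL (Tableaux m) (λ w → ind (eqList (shape w) λ′) 1)

  addBox≡⇔removeBox≡ : ∀ μ λ′ i → IsPartition μ → IsPartition λ′ →
    (addable μ i ∧ eqList (addBox i μ) λ′) ≡ (removable λ′ i ∧ eqList μ (removeBox i λ′))
  addBox≡⇔removeBox≡ μ λ′ i pμ pλ = true⇔true⇒≡ to from
    where
    to : (addable μ i ∧ eqList (addBox i μ) λ′) ≡ true → (removable λ′ i ∧ eqList μ (removeBox i λ′)) ≡ true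
    to e with ∧≡true⁻ {addable μ i} e
    ... | ea , eq with eqList≡true⇒≡ (addBox i μ) λ′ eq
    ...   | refl = ∧≡true⁺ (removable-addBox μ i pμ ea) (≡⇒eqList≡true (sym (removeBox-addBox μ i pμ ea)))
    from : (removable λ′ i ∧ eqList μ (removeBox i λ′)) ≡ true → (addable μ i ∧ eqList (addBox i μ) λ′) ≡ true
    from e with ∧≡true⁻ {removable λ′ i} e
    ... | er , eq with eqList≡true⇒≡ μ (removeBox i λ′) eq
    ...   | refl = ∧≡true⁺ (addable-removeBox λ′ i pλ er) (≡⇒eqList≡true (addBox-removeBox λ′ i pλ er))

  Σ-addable≡Σ-removable : ∀ μ λ′ → IsPartition μ → IsPartition λ′ →
    Σ-addable μ (λ a → ind (eqList (addBox a μ) λ′) 1) ≡ Σ-removable λ′ (λ c → ind (eqList μ (removeBox c λ′)) 1)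
  Σ-addable≡Σ-removable μ λ′ pμ pλ =
    trans (sym (Σ-addable-extend μ N (λ a → ind (eqList (addBox a μ) λ′) 1) (m≤m+n _ _)))
    (trans (Σ<-cong N cover)
           (Σ-removable-extend λ′ N (λ c → ind (eqList μ (removeBox c λ′)) 1) (m≤n+m _ _)))
    where
    N : ℕ
    N = suc (length μ) + length λ′
    cover : ∀ i →
      ind (addable μ i) (ind (eqList (addBox i μ) λ′) 1)
      ≡ ind (removable λ′ i) (ind (eqList μ (removeBox i λ′)) 1)
    cover i = trans (sym (ind-∧ (addable μ i) (eqList (addBox i μ) λ′) 1))
              (trans (cong (λ b → ind b 1) (addBox≡⇔removeBox≡ μ λ′ i pμ pλ))
                     (ind-∧ (removable λ′ i) (eqList μ (removeBox i λ′)) 1))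

  tableauCount-suc : ∀ m λ′ → IsPartition λ′ →
    tableauCount (suc m) λ′ ≡ Σ-removable λ′ (λ c → tableauCount m (removeBox c λ′))
  tableauCount-suc m λ′ pλ =
    trans (sumL-Tableaux-suc m (λ w → ind (eqList (shape w) λ′) 1))
    (trans (sumL-cong-All (Tableaux m) (Tableaux-yamanouchi m)
                          (λ w (v , _) → Σ-addable≡Σ-removable (shape w) λ′ (shape-partition w v) pλ))
    (trans (sumL-Σ< (Tableaux m) (length λ′) (λ w c → ind (removable λ′ c)
        (ind (eqList (shape w) (removeBox c λ′)) 1)))
           (Σ<-cong (length λ′) (λ c → sym (ind-sumL (removable λ′ c) (Tableaux m) (λ w → ind (eqList (shape
               w) (removeBox c λ′)) 1))))))


module PartitionEnumeration where

  open import Data.Nat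
  open import Data.Nat.Properties
  open import Data.Nat.ListAction using (sum)
  open import Data.List using (List; []; _∷_; map; filterᵇ; applyUpTo)
  open import Data.List.Relation.Unary.All as All using (All; []; _∷_)
  open import Data.List.Relation.Unary.All.Properties using (applyUpTo⁺₁)
  open import Data.Product using (_×_; _,_)
  open import Data.Unit using (tt)
  open import Relation.Binary.PropositionalEquality
  open import Relation.Nullary using (yes; no)
  open import Defs using (partsFuel; Partitions)
  open BooleanComparisons
  open NatSums
  open ListSums
  open YoungDiagrams
  open Tableaux
  open TableauCounts

  partsFuel-sound : ∀ f n m → All (λ y → IsPartition y × (sum y ≡ n) × (row y 0 ≤ m)) (partsFuel f n m)
  partsFuel-sound _       zero    m = (tt , refl , z≤n) ∷ []
  partsFuel-sound zero    (suc n) m = []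
  partsFuel-sound (suc f) (suc n) m =
    All-concatMap (λ k → map (k ∷_) (partsFuel f (suc n ∸ k) k)) (filterᵇ (λ k → k ≤ᵇ m) (applyUpTo suc (suc n)))
      (All-filterᵇ {R = λ k → 0 < k × k ≤ suc n × k ≤ m} (λ k → k ≤ᵇ m) (applyUpTo suc (suc n)) (bounds (suc n))
                   (λ k (0<k , k≤n) e → 0<k , k≤n , ≤ᵇ≡true⇒≤ {k} {m} e))
      (λ k (0<k , k≤n , k≤m) → All-map⁺ (k ∷_) (partsFuel f (suc n ∸ k) k) (partsFuel-sound f (suc n ∸ k) k)
         (λ y (py , sy , y≤k) → (0<k , y≤k , py) , trans (cong (k +_) sy) (m+[n∸m]≡n k≤n) , k≤m))
    where
    bounds : ∀ n → All (λ k → 0 < k × k ≤ n) (applyUpTo suc n)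
    bounds n = applyUpTo⁺₁ suc n (λ i<n → z<s , i<n)

  Partitions-sound : ∀ n → All (λ y → IsPartition y × (sum y ≡ n)) (Partitions n)
  Partitions-sound n = All.map (λ (p , s , _) → p , s) (partsFuel-sound n n n)

  sumL-partsFuel-indicator : ∀ f n m (g : List ℕ → ℕ) → n ≤ f → ∀ ν → IsPartition ν → sum ν ≡ n → row ν 0 ≤ m →
    sumL (partsFuel f n m) (λ y → ind (eqList ν y) (g y)) ≡ g ν
  sumL-partsFuel-indicator f       zero    m g _ []          _        _ _ = +-identityʳ (g [])
  sumL-partsFuel-indicator f       zero    m g _ (zero ∷ ν)  (() , _) _ _
  sumL-partsFuel-indicator f       zero    m g _ (suc k ∷ ν) _        () _
  sumL-partsFuel-indicator zero    (suc n) m g () ν _ _ _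
  sumL-partsFuel-indicator (suc f) (suc n) m g (s≤s n≤f) []         _        () _
  sumL-partsFuel-indicator (suc f) (suc n) m g (s≤s n≤f) (zero ∷ ν) (() , _) _ _
  sumL-partsFuel-indicator (suc f) (suc n) m g (s≤s n≤f) (suc c ∷ ν) (_ , r , pν) s rm =
    trans (sumL-concatMap (λ k → map (k ∷_) (partsFuel f (suc n ∸ k) k))
        (filterᵇ (λ k → k ≤ᵇ m) (applyUpTo suc (suc n))) picked)
    (trans (sumL-filterᵇ (λ k → k ≤ᵇ m) (applyUpTo suc (suc n)) _)
    (trans (sumL-applyUpTo suc (suc n) _)
    (trans (Σ<-cong (suc n) byFirstPart)
           (Σ<-single (suc n) c (λ _ → g (suc c ∷ ν)) c<))))
    where
    picked : List ℕ → ℕ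
    picked y = ind (eqList (suc c ∷ ν) y) (g y)
    s' : c + sum ν ≡ n
    s' = suc-injective s
    c< : c < suc n
    c< = s≤s (subst (c ≤_) s' (m≤m+n c (sum ν)))
    sν : sum ν ≡ n ∸ c
    sν = trans (sym (m+n∸m≡n c (sum ν))) (cong (_∸ c) s')
    byFirstPart : ∀ i →
      ind (suc i ≤ᵇ m) (sumL (map (suc i ∷_) (partsFuel f (suc n ∸ suc i) (suc i))) picked)
      ≡ ind (i ≡ᵇ c) (g (suc c ∷ ν))
    byFirstPart i with i ≟ c
    ... | yes refl rewrite ≡ᵇ-refl i | sumL-map (suc i ∷_) (partsFuel f (n ∸ i) (suc i)) picked
                         | ≡ᵇ-refl i | ≤⇒≤ᵇ≡true {suc i} {m} rm =
          sumL-partsFuel-indicator f (n ∸ i) (suc i) (λ y → g (suc i ∷ y)) (≤-trans (m∸n≤m n i) n≤f) ν pν sν r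
    ... | no ne rewrite ≢⇒≡ᵇ≡false ne | sumL-map (suc i ∷_) (partsFuel f (n ∸ i) (suc i)) picked
                      | ≢⇒≡ᵇ≡false {c} {i} (λ q → ne (sym q)) =
          trans (cong (ind (suc i ≤ᵇ m)) (sumL-0 (partsFuel f (n ∸ i) (suc i)) (λ _ → refl))) (ind-0 _)

  sumL-Partitions-indicator : ∀ n (g : List ℕ → ℕ) ν → IsPartition ν → sum ν ≡ n →
    sumL (Partitions n) (λ y → ind (eqList ν y) (g y)) ≡ g ν
  sumL-Partitions-indicator n g ν p s =
    sumL-partsFuel-indicator n n n g ≤-refl ν p s (subst (row ν 0 ≤_) s (row0≤sum ν))

  sumL-Tableaux-byShape : ∀ n (h : List ℕ → ℕ) →
    sumL (Tableaux n) (λ w → h (shape w)) ≡ sumL (Partitions n) (λ y → tableauCount n y * h y)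
  sumL-Tableaux-byShape n h =
    trans (sumL-cong-All (Tableaux n) (Tableaux-yamanouchi n)
            (λ w (v , l) → sym (sumL-Partitions-indicator n h (shape w) (shape-partition w v)
                (trans (sum-shape w) l))))
    (trans (sumL-swap (Tableaux n) (Partitions n) (λ w y → ind (eqList (shape w) y) (h y)))
           (sumL-cong (Partitions n) (λ y → trans (sumL-cong (Tableaux n) (λ w → indicator w y))
                                                  (sumL-* (Tableaux n) (λ w → ind (eqList (shape w) y) 1)
                                                      (h y)))))
    where
    indicator : ∀ w y → ind (eqList (shape w) y) (h y) ≡ ind (eqList (shape w) y) 1 * h y
    indicator w y =
      trans (cong (ind (eqList (shape w) y)) (sym (+-identityʳ (h y)))) (ind-* (eqList (shape w) y) 1 (h y))


module LongestDecreasing where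

  open import Data.Nat
  open import Data.Nat.Properties
  open import Data.Bool using (true; false)
  open import Data.List using (List; []; _∷_; length; _++_; drop)
  open import Data.List.Properties using (length-++)
  open import Data.List.Relation.Binary.Sublist.Propositional
    using (_⊆_; []; _∷_; _∷ʳ_; ⊆-refl; ⊆-trans; minimum)
  open import Data.List.Relation.Binary.Sublist.Propositional.Properties
    using (length-mono-≤; All-resp-⊆; ++⁺; ++⁺ʳ)
  open import Data.List.Relation.Unary.All as All using (All; []; _∷_)
  open import Data.List.Relation.Unary.All.Properties using (++⁻)
  open import Data.List.Relation.Unary.Linked as Linked using (Linked; []; [-]; _∷_)
  open import Data.Product using (∃; _×_; _,_; proj₁; proj₂)
  open import Data.Sum using (_⊎_; inj₁; inj₂)
  open import Data.Unit using (⊤)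
  open import Data.Empty using (⊥-elim)
  open import Relation.Binary.PropositionalEquality
  open import Relation.Nullary using (yes; no)
  open import Defs using (passFrom; passesFuel; D)
  open BooleanComparisons

  Decreasing : List ℕ → Set
  Decreasing = Linked _≥_

  LDS : List ℕ → ℕ → Set
  LDS p n = (∃ λ s → s ⊆ p × Decreasing s × length s ≡ n) × (∀ s → s ⊆ p → Decreasing s → length s ≤ n)

  LDS-unique : ∀ {p a b} → LDS p a → LDS p b → a ≡ b
  LDS-unique ((s , s⊆p , ds , refl) , bound-a) ((t , t⊆p , dt , refl) , bound-b) =
    ≤-antisym (bound-b s s⊆p ds) (bound-a t t⊆p dt)

  LDS-[] : LDS [] 0
  LDS-[] = ([] , [] , [] , refl) , λ { [] [] _ → z≤n }

  LDS-mono : ∀ {A P a c} → A ⊆ P → LDS A a → LDS P c → a ≤ c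
  LDS-mono A⊆P ((s , s⊆A , ds , refl) , _) (_ , bound) = bound s (⊆-trans s⊆A A⊆P) ds

  discardedFrom : ℕ → List ℕ → List ℕ
  discardedFrom m ys = proj₂ (passFrom m ys)

  discardedFrom-⊆ : ∀ m ys → discardedFrom m ys ⊆ ys
  discardedFrom-⊆ m []       = []
  discardedFrom-⊆ m (y ∷ ys) with m <ᵇ y
  ... | true  = y ∷ʳ discardedFrom-⊆ y ys
  ... | false = refl ∷ discardedFrom-⊆ m ys

  HeadAtMost : ℕ → List ℕ → Set
  HeadAtMost m []      = ⊤
  HeadAtMost m (a ∷ _) = a ≤ m

  private
    head-mono : ∀ {m y} u → HeadAtMost m u → m ≤ y → HeadAtMost y u
    head-mono []      _   _   = _
    head-mono (a ∷ _) a≤m m≤y = ≤-trans a≤m m≤y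

    head≤ : ∀ {y} u → Decreasing (y ∷ u) → HeadAtMost y u
    head≤ []      _         = _
    head≤ (b ∷ _) (b≤y ∷ _) = b≤y

  LDS-extend : ∀ m ys s → s ⊆ discardedFrom m ys → Decreasing s →
    ∃ λ u → u ⊆ m ∷ ys × Decreasing u × length u ≡ suc (length s)
  LDS-extend m []       []       []  _ = m ∷ [] , refl ∷ [] , [-] , refl
  LDS-extend m (y ∷ ys) s        s⊆  d with m <ᵇ y in e
  ... | true with LDS-extend y ys s s⊆ d
  ...   | u , u⊆ , du , lu = u , ⊆-trans u⊆ (m ∷ʳ ⊆-refl) , du , lu
  LDS-extend m (y ∷ ys) s        (_ ∷ʳ s⊆) d | false with LDS-extend m ys s s⊆ d
  ...   | u , u⊆ , du , lu = u , ⊆-trans u⊆ (refl ∷ (y ∷ʳ ⊆-refl)) , du , lu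
  LDS-extend m (y ∷ ys) (y ∷ s′) (refl ∷ s⊆) d | false =
    m ∷ y ∷ s′ , refl ∷ refl ∷ ⊆-trans s⊆ (discardedFrom-⊆ m ys) , <ᵇ≡false⇒≥ {m} {y} e ∷ d , refl

  -- m is the running maximum, which only grows: entries not exceeding it are discarded
  LDS-restrict : ∀ m ys u → u ⊆ ys → Decreasing u →
    (HeadAtMost m u → u ⊆ discardedFrom m ys) × (drop 1 u ⊆ discardedFrom m ys)
  LDS-restrict m [] [] [] _ = (λ _ → []) , []
  LDS-restrict m (y ∷ ys) u (_ ∷ʳ u⊆) d with m <ᵇ y in e | LDS-restrict y ys u u⊆ d | LDS-restrict m ys u u⊆ d
  ... | true  | inY , tailY | _ = (λ hu → inY (head-mono u hu (<⇒≤ (<ᵇ≡true⇒< {m} {y} e)))) , tailY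
  ... | false | _ | inM , tailM = (λ hu → y ∷ʳ inM hu) , y ∷ʳ tailM
  LDS-restrict m (y ∷ ys) (y ∷ u′) (refl ∷ u⊆) d
    with m <ᵇ y in e | LDS-restrict y ys u′ u⊆ (Linked.tail d) | LDS-restrict m ys u′ u⊆ (Linked.tail d)
  ... | true  | inY , _ | _ = (λ y≤m → ⊥-elim (<⇒≱ (<ᵇ≡true⇒< {m} {y} e) y≤m)) , inY (head≤ u′ d)
  ... | false | _ | inM , _ =
    (λ y≤m → refl ∷ inM (head-mono u′ (head≤ u′ d) y≤m)) , y ∷ʳ inM
        (head-mono u′ (head≤ u′ d) (<ᵇ≡false⇒≥ {m} {y} e))

  LDS-pass : ∀ x xs k → LDS (discardedFrom x xs) k → LDS (x ∷ xs) (suc k)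
  LDS-pass x xs k ((s , s⊆ , ds , refl) , bound) with LDS-extend x xs s s⊆ ds
  ... | u , u⊆ , du , lu = (u , u⊆ , du , lu) , bound′
    where
    bound′ : ∀ u → u ⊆ x ∷ xs → Decreasing u → length u ≤ suc (length s)
    bound′ []       _           _ = z≤n
    bound′ (a ∷ u′) (_ ∷ʳ u⊆′)  d = s≤s (bound u′ (proj₂ (LDS-restrict x xs (a ∷ u′) u⊆′ d)) (Linked.tail d))
    bound′ (x ∷ u′) (refl ∷ u⊆′) d =
      s≤s (bound u′ (proj₁ (LDS-restrict x xs u′ u⊆′ (Linked.tail d)) (head≤ u′ d)) (Linked.tail d))

  passesFuel-LDS : ∀ f p → length p ≤ f → LDS p (passesFuel f p)
  passesFuel-LDS zero    []       _       = LDS-[]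
  passesFuel-LDS (suc f) []       _       = LDS-[]
  passesFuel-LDS (suc f) (x ∷ xs) (s≤s h) =
    LDS-pass x xs _ (passesFuel-LDS f (discardedFrom x xs) (≤-trans (length-mono-≤ (discardedFrom-⊆ x xs)) h))

  D-LDS : ∀ p → LDS p (D p)
  D-LDS p = passesFuel-LDS (length p) p ≤-refl

  D≡LDS : ∀ {p n} → LDS p n → D p ≡ n
  D≡LDS = LDS-unique (D-LDS _)

  length-snoc : ∀ (s : List ℕ) x → length (s ++ x ∷ []) ≡ suc (length s)
  length-snoc s x = trans (length-++ s) (+-comm _ 1)

  ⊆-insert-split : ∀ (L : List ℕ) {x Z u} → u ⊆ L ++ x ∷ Z →
    (u ⊆ L ++ Z) ⊎ (∃ λ (u₁ : List ℕ) → ∃ λ u₂ → u ≡ u₁ ++ x ∷ u₂ × u₁ ⊆ L × u₂ ⊆ Z)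
  ⊆-insert-split []      (_ ∷ʳ h)   = inj₁ h
  ⊆-insert-split []      (refl ∷ h) = inj₂ ([] , _ , refl , [] , h)
  ⊆-insert-split (l ∷ L) (_ ∷ʳ h) with ⊆-insert-split L h
  ... | inj₁ h′                      = inj₁ (l ∷ʳ h′)
  ... | inj₂ (u₁ , u₂ , e , h₁ , h₂) = inj₂ (u₁ , u₂ , e , l ∷ʳ h₁ , h₂)
  ⊆-insert-split (l ∷ L) (refl ∷ h) with ⊆-insert-split L h
  ... | inj₁ h′                      = inj₁ (refl ∷ h′)
  ... | inj₂ (u₁ , u₂ , e , h₁ , h₂) = inj₂ (l ∷ u₁ , u₂ , cong (l ∷_) e , refl ∷ h₁ , h₂)

  Decreasing-snoc : ∀ s x → Decreasing s → All (x ≤_) s → Decreasing (s ++ x ∷ [])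
  Decreasing-snoc []          x _          _          = [-]
  Decreasing-snoc (a ∷ [])    x _          (x≤a ∷ _)  = x≤a ∷ [-]
  Decreasing-snoc (a ∷ b ∷ r) x (b≤a ∷ d)  (_ ∷ x≤s)  = b≤a ∷ Decreasing-snoc (b ∷ r) x d x≤s

  Decreasing-prefix : ∀ u w → Decreasing (u ++ w) → Decreasing u
  Decreasing-prefix []          w _         = []
  Decreasing-prefix (a ∷ [])    w _         = [-]
  Decreasing-prefix (a ∷ b ∷ r) w (b≤a ∷ d) = b≤a ∷ Decreasing-prefix (b ∷ r) w d

  Decreasing-middle : ∀ u {x v r} → Decreasing (u ++ x ∷ v ∷ r) → v ≤ x
  Decreasing-middle []      (v≤x ∷ _) = v≤x
  Decreasing-middle (a ∷ u) d         = Decreasing-middle u (Linked.tail d)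

  LDS-insertSmallest : ∀ L Z x a b → All (x <_) (L ++ Z) → LDS (L ++ Z) a → LDS L b → LDS (L ++ x ∷ Z) (a ⊔ suc b)
  LDS-insertSmallest L Z x a b x<LZ ((s , s⊆ , ds , refl) , bound-a) ((t , t⊆ , dt , refl) , bound-b) =
    witness , bound
    where
    x<L : All (x <_) L
    x<L = proj₁ (++⁻ L x<LZ)
    x<Z : All (x <_) Z
    x<Z = proj₂ (++⁻ L x<LZ)
    witness : ∃ λ u → u ⊆ L ++ x ∷ Z × Decreasing u × length u ≡ a ⊔ suc b
    witness with suc b ≤? a
    ... | yes sb≤a = s , ⊆-trans s⊆ (++⁺ ⊆-refl (x ∷ʳ ⊆-refl)) , ds , sym (m≥n⇒m⊔n≡m sb≤a)
    ... | no  sb≰a =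
      t ++ x ∷ [] , ++⁺ t⊆ (refl ∷ minimum Z) , Decreasing-snoc t x dt (All.map <⇒≤ (All-resp-⊆ t⊆ x<L)) ,
      trans (length-snoc t x) (sym (m≤n⇒m⊔n≡n (<⇒≤ (≰⇒> sb≰a))))
    bound : ∀ u → u ⊆ L ++ x ∷ Z → Decreasing u → length u ≤ a ⊔ suc b
    bound u u⊆ d with ⊆-insert-split L u⊆
    ... | inj₁ u⊆′ = ≤-trans (bound-a u u⊆′ d) (m≤m⊔n a (suc b))
    ... | inj₂ (u₁ , [] , refl , u₁⊆ , _) =
          ≤-trans (≤-reflexive (length-snoc u₁ x)) (≤-trans (s≤s (bound-b u₁ u₁⊆ (Decreasing-prefix u₁ _ d)))
              (m≤n⊔m a (suc b)))
    ... | inj₂ (u₁ , v ∷ r , refl , _ , v∷r⊆) with All-resp-⊆ v∷r⊆ x<Z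
    ...   | x<v ∷ _ = ⊥-elim (<⇒≱ x<v (Decreasing-middle u₁ d))

  LDS-insertSmallest-snoc : ∀ L R z x {a b} → All (x <_) (L ++ R ++ z ∷ []) →
    LDS (L ++ x ∷ R) a → LDS (L ++ R ++ z ∷ []) b → LDS (L ++ x ∷ R ++ z ∷ []) (a ⊔ b)
  LDS-insertSmallest-snoc L R z x {a} {b} x<LRz ldsA ldsB =
    subst (LDS (L ++ x ∷ R ++ z ∷ [])) (sym a⊔b≡b⊔1+DL)
        (LDS-insertSmallest L (R ++ z ∷ []) x b (D L) x<LRz ldsB (D-LDS L))
    where
    LR⊆LRz : L ++ R ⊆ L ++ R ++ z ∷ []
    LR⊆LRz = ++⁺ (⊆-refl {x = L}) (++⁺ʳ (z ∷ []) ⊆-refl)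
    a≡ : a ≡ D (L ++ R) ⊔ suc (D L)
    a≡ = LDS-unique ldsA (LDS-insertSmallest L R x _ _ (All-resp-⊆ LR⊆LRz x<LRz) (D-LDS _) (D-LDS L))
    DLR≤b : D (L ++ R) ≤ b
    DLR≤b = LDS-mono LR⊆LRz (D-LDS _) ldsB
    a⊔b≡b⊔1+DL : a ⊔ b ≡ b ⊔ suc (D L)
    a⊔b≡b⊔1+DL = begin
      a ⊔ b                              ≡⟨ cong (_⊔ b) a≡ ⟩
      D (L ++ R) ⊔ suc (D L) ⊔ b         ≡⟨ ⊔-assoc (D (L ++ R)) _ b ⟩
      D (L ++ R) ⊔ (suc (D L) ⊔ b)       ≡⟨ m≤n⇒m⊔n≡n (≤-trans DLR≤b (m≤n⊔m _ b)) ⟩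
      suc (D L) ⊔ b                      ≡⟨ ⊔-comm _ b ⟩
      b ⊔ suc (D L)                      ∎
      where open ≡-Reasoning


module PermutationGrowth where

  open import Data.Nat
  open import Data.Nat.Properties
  open import Data.Bool using (true)
  open import Data.List using (List; []; _∷_; length; _++_; map; concatMap; take; drop; upTo; _∷ʳ_; initLast;
      _∷ʳ′_)
  open import Data.List.Properties using (++-assoc; ++-identityʳ; ++-conicalʳ; length-++; ∷ʳ-injectiveˡ;
      length-drop; take++drop≡id)
  open import Data.List.Relation.Binary.Sublist.Propositional using (⊆-refl)
  open import Data.List.Relation.Binary.Sublist.Propositional.Properties
    using (All-resp-⊆; ++⁺ʳ) renaming (++⁺ to ⊆-++⁺)
  open import Data.List.Relation.Unary.All as All using (All; []; _∷_)
  open import Data.List.Relation.Unary.All.Properties using (++⁺; take⁺; drop⁺; applyUpTo⁺₁; map⁺)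
  open import Data.List.Relation.Unary.AllPairs using (AllPairs; []; _∷_)
  open import Data.Product using (∃; _×_; _,_; proj₁; proj₂; uncurry)
  open import Data.Empty using (⊥-elim)
  open import Data.Sum using (inj₁; inj₂)
  open import Function using (id)
  open import Relation.Binary.PropositionalEquality
  open import Relation.Nullary using (yes; no)
  open import Defs using (insertions; permutations; D)
  open BooleanComparisons
  open NatSums
  open ListSums
  open YoungDiagrams
  open UpDownCommutation
  open Tableaux
  open TableauCounts
  open LongestDecreasing

  insertAt : ℕ → ℕ → List ℕ → List ℕ
  insertAt j x q = take j q ++ x ∷ drop j q

  length-insertAt : ∀ j x q → length (insertAt j x q) ≡ suc (length q)
  length-insertAt j x q =
    trans (length-++ (take j q)) (trans (+-suc _ _) (cong suc (trans (sym (length-++ (take j q))) (cong length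
        (take++drop≡id j q)))))

  sumL-insertions : ∀ x q (g : List ℕ → ℕ) →
    sumL (insertions x q) g ≡ Σ< (suc (length q)) (λ j → g (insertAt j x q))
  sumL-insertions x []       g = refl
  sumL-insertions x (y ∷ ys) g =
    cong (g (x ∷ y ∷ ys) +_) (trans (sumL-map (y ∷_) (insertions x ys) g)
        (sumL-insertions x ys (λ r → g (y ∷ r))))

  insertions-length : ∀ x q → All (λ r → length r ≡ suc (length q)) (insertions x q)
  insertions-length x []       = refl ∷ []
  insertions-length x (y ∷ ys) =
    refl ∷ All-map⁺ (y ∷_) (insertions x ys) (insertions-length x ys) (λ _ → cong suc)

  permutations-length : ∀ xs → All (λ q → length q ≡ length xs) (permutations xs)
  permutations-length []       = refl ∷ []
  permutations-length (x ∷ xs) = All-concatMap (insertions x) (permutations xs) (permutations-length xs)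
    (λ q e → All.map (λ e′ → trans e′ (cong suc e)) (insertions-length x q))

  -- the permutations of xs, in the order of `permutations`, each paired with the chain of
  -- shapes of its prefixes produced by `grow`
  pairedPermutations : List ℕ → List (List ℕ × List ℕ)
  pairedPermutations []       = ([] , []) ∷ []
  pairedPermutations (x ∷ xs) =
    concatMap (λ (q , w) → map (λ k → insertAt (length xs ∸ k) x q , proj₁ (grow k w)) (upTo (suc (length xs))))
              (pairedPermutations xs)

  sumL-pairedPermutations : ∀ x xs (G : List ℕ × List ℕ → ℕ) →
    sumL (pairedPermutations (x ∷ xs)) G
    ≡ sumL (pairedPermutations xs) (λ (q , w) → Σ< (suc (length xs))
        (λ k → G (insertAt (length xs ∸ k) x q , proj₁ (grow k w))))
  sumL-pairedPermutations x xs G =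
    trans (sumL-concatMap _ (pairedPermutations xs) G)
          (sumL-cong (pairedPermutations xs) (λ _ → trans (sumL-map _ (upTo (suc (length xs))) G)
              (sumL-upTo (suc (length xs)) _)))

  sumL-pairedPermutations-fst : ∀ xs (g : List ℕ → ℕ) →
    sumL (pairedPermutations xs) (λ (q , _) → g q) ≡ sumL (permutations xs) g
  sumL-pairedPermutations-fst []       g = refl
  sumL-pairedPermutations-fst (x ∷ xs) g =
    trans (sumL-pairedPermutations x xs (λ (q , _) → g q))
    (trans (sumL-cong (pairedPermutations xs) (λ (q , _) → Σ<-reverse (suc (length xs))
        (λ j → g (insertAt j x q))))
    (trans (sumL-pairedPermutations-fst xs (λ q → Σ< (suc (length xs)) (λ j → g (insertAt j x q))))
           (sym (trans (sumL-concatMap (insertions x) (permutations xs) g)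
                       (sumL-cong-All (permutations xs) (permutations-length xs)
                          (λ q e → trans (sumL-insertions x q g)
                              (cong (λ n → Σ< (suc n) (λ j → g (insertAt j x q))) e)))))))

  Σ-removable-* : ∀ ν (g : ℕ → ℕ) y → Σ-removable ν (λ c → g c * y) ≡ Σ-removable ν g * y
  Σ-removable-* ν g y =
    trans (Σ<-cong (length ν) (λ i → trans (ind-* (removable ν i) (g i) y) (*-comm _ y)))
          (trans (sym (*-Σ< y (length ν) _)) (*-comm y _))

  sumL-pairedPermutations-snd : ∀ xs (Φ : List ℕ → ℕ) →
    sumL (pairedPermutations xs) (λ (_ , w) → Φ w)
    ≡ sumL (Tableaux (length xs)) (λ w → tableauCount (length xs) (shape w) * Φ w)
  sumL-pairedPermutations-snd []       Φ = cong (_+ 0) (sym (+-identityʳ (Φ [])))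
  sumL-pairedPermutations-snd (x ∷ xs) Φ =
    trans (sumL-pairedPermutations x xs (λ (_ , w) → Φ w))
    (trans (sumL-pairedPermutations-snd xs (λ w → Σ< (suc m) (λ k → Φ (proj₁ (grow k w)))))
    (trans (sumL-cong (Tableaux m) (λ w → *-Σ< (tableauCount m (shape w)) (suc m) (λ k → Φ (proj₁ (grow k w)))))
    (trans (sumL-cong-All (Tableaux m) (Tableaux-yamanouchi m)
        (λ w (v , l) → Σ<-cong< (suc m) (count-grow w v l)))
    (trans (sumL-grow m Ψ)
    (trans (sumL-cong (Tableaux (suc m)) (λ w′ → Σ-removable-* (shape w′)
        (λ c → tableauCount m (removeBox c (shape w′))) (Φ w′)))
           (sumL-cong-All (Tableaux (suc m)) (Tableaux-yamanouchi (suc m))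
              (λ w′ (v , _) → cong (_* Φ w′) (sym (tableauCount-suc m (shape w′) (shape-partition w′ v))))))))))
    where
    m : ℕ
    m = length xs
    Ψ : List ℕ → ℕ → ℕ
    Ψ w′ c = tableauCount m (removeBox c (shape w′)) * Φ w′
    count-grow : ∀ w → Yamanouchi w → length w ≡ m → ∀ k → k < suc m →
      tableauCount m (shape w) * Φ (proj₁ (grow k w)) ≡ uncurry Ψ (grow k w)
    count-grow w v l k k< with grow-shape k w v (subst (k ≤_) (sym l) (≤-pred k<))
    ... | ec , sh = cong (λ ν → tableauCount m ν * Φ (proj₁ (grow k w)))
                         (sym (trans (cong (removeBox (proj₂ (grow k w))) sh)
                                     (removeBox-addBox (shape w) (proj₂ (grow k w)) (shape-partition w v) ec)))

  length-growBox : ∀ μ a c → IsPartition μ → addable μ a ≡ true → addable μ c ≡ true →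
    length (addBox (growBox (addBox c μ) c a) (addBox c μ)) ≡ length (addBox c μ) ⊔ length (addBox a μ)
  length-growBox μ a c p ea ec with a ≟ c
  ... | yes refl rewrite ≡ᵇ-refl a =
    trans (length-addBox-< (addBox a μ) (bumpRow (addBox a μ) a)
                           (≤-<-trans (bumpRow-≤ (addBox a μ) a)
                               (removable⇒<length (addBox a μ) a (removable-addBox μ a p ea))))
          (sym (⊔-idem _))
  ... | no a≢c rewrite ≢⇒≡ᵇ≡false a≢c
      with m≤n⇒m<n∨m≡n (addable⇒≤length μ a ea) | m≤n⇒m<n∨m≡n (addable⇒≤length μ c ec)
  ...   | inj₁ a<ℓ | inj₁ c<ℓ =
    trans (length-addBox-< (addBox c μ) a (subst (a <_) (sym lc) a<ℓ))
          (trans lc (sym (trans (cong₂ _⊔_ lc (length-addBox-< μ a a<ℓ)) (⊔-idem _))))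
    where
    lc : length (addBox c μ) ≡ length μ
    lc = length-addBox-< μ c c<ℓ
  ...   | inj₂ refl | inj₁ c<ℓ =
    trans (cong (λ z → length (addBox z (addBox c μ))) (sym lc))
    (trans (length-addBox-new (addBox c μ))
           (trans (cong suc lc) (sym (trans (cong₂ _⊔_ lc (length-addBox-new μ)) (m≤n⇒m⊔n≡n (n≤1+n _))))))
    where
    lc : length (addBox c μ) ≡ length μ
    lc = length-addBox-< μ c c<ℓ
  ...   | inj₁ a<ℓ | inj₂ refl =
    trans (length-addBox-< (addBox (length μ) μ) a (subst (a <_) (sym (length-addBox-new μ))
        (≤-trans a<ℓ (n≤1+n _))))
          (trans (length-addBox-new μ)
                 (sym (trans (cong₂ _⊔_ (length-addBox-new μ) (length-addBox-< μ a a<ℓ)) (m≥n⇒m⊔n≡m (n≤1+n _)))))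
  ...   | inj₂ refl | inj₂ e = ⊥-elim (a≢c (sym e))

  length-shape-growStep : ∀ k a w → Yamanouchi (a ∷ w) → k ≤ length w →
    length (shape (proj₁ (growStep a (grow k w)))) ≡ length (shape (proj₁ (grow k w))) ⊔ length (shape (a ∷ w))
  length-shape-growStep k a w (ea , v) k≤ with grow-shape k w v k≤
  ... | ec , sh =
    trans (cong (λ ν → length (addBox (growBox ν c a) ν)) sh)
          (trans (length-growBox (shape w) a c (shape-partition w v) ea ec)
                 (cong (λ ν → length ν ⊔ length (addBox a (shape w))) (sym sh)))
    where
    c : ℕ
    c = proj₂ (grow k w)

  PrefixLDS : List ℕ → List ℕ → Set
  PrefixLDS p []      = p ≡ []
  PrefixLDS p (a ∷ w) = ∃ λ p′ → ∃ λ y → p ≡ p′ ∷ʳ y × LDS p (length (shape (a ∷ w))) × PrefixLDS p′ w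

  PrefixLDS-LDS : ∀ p w → PrefixLDS p w → LDS p (length (shape w))
  PrefixLDS-LDS p []      refl                = LDS-[]
  PrefixLDS-LDS p (a ∷ w) (_ , _ , _ , l , _) = l

  PrefixLDS-length : ∀ p w → PrefixLDS p w → length w ≡ length p
  PrefixLDS-length p  []      refl                    = refl
  PrefixLDS-length ._ (a ∷ w) (p′ , y , refl , _ , pre) =
    trans (cong suc (PrefixLDS-length p′ w pre)) (sym (length-snoc p′ y))

  grow-PrefixLDS : ∀ k w L R x → Yamanouchi w → length R ≡ k → All (x <_) (L ++ R) →
    PrefixLDS (L ++ R) w → PrefixLDS (L ++ x ∷ R) (proj₁ (grow k w))
  grow-PrefixLDS zero w L [] x v refl x<L pre =
    L , x , refl , subst (LDS (L ++ x ∷ [])) rows (LDS-insertSmallest L [] x ℓ ℓ x<L ldsL[] ldsL) ,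
    subst (λ p → PrefixLDS p w) (++-identityʳ L) pre
    where
    ℓ : ℕ
    ℓ = length (shape w)
    ldsL[] : LDS (L ++ []) ℓ
    ldsL[] = PrefixLDS-LDS _ w pre
    ldsL : LDS L ℓ
    ldsL = subst (λ p → LDS p ℓ) (++-identityʳ L) ldsL[]
    rows : ℓ ⊔ suc ℓ ≡ length (addBox ℓ (shape w))
    rows = trans (m≤n⇒m⊔n≡n (n≤1+n ℓ)) (sym (length-addBox-new (shape w)))
  grow-PrefixLDS (suc k) [] L R x _ lR _ pre with ++-conicalʳ L R pre
  ... | refl with () ← lR
  grow-PrefixLDS (suc k) (a ∷ w) L R x (ea , v) lR x<LR (q , y , eq , ldsLR , pre) with initLast R
  ... | [] with () ← lR
  ... | R₀ ∷ʳ′ z =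
    L ++ x ∷ R₀ , z , sym (++-assoc L (x ∷ R₀) (z ∷ [])) ,
    subst (LDS (L ++ x ∷ R₀ ∷ʳ z)) (sym (length-shape-growStep k a w (ea , v) k≤))
          (LDS-insertSmallest-snoc L R₀ z x x<LR (PrefixLDS-LDS _ _ ih) ldsLR) ,
    ih
    where
    q≡ : q ≡ L ++ R₀
    q≡ = ∷ʳ-injectiveˡ q (L ++ R₀) (trans (sym eq) (sym (++-assoc L R₀ (z ∷ []))))
    pre₀ : PrefixLDS (L ++ R₀) w
    pre₀ = subst (λ p → PrefixLDS p w) q≡ pre
    lR₀ : length R₀ ≡ k
    lR₀ = suc-injective (trans (sym (length-snoc R₀ z)) lR)
    k≤ : k ≤ length w
    k≤ =
      subst (k ≤_) (sym (trans (PrefixLDS-length _ w pre₀) (length-++ L)))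
        (subst (_≤ length L + length R₀) lR₀ (m≤n+m _ _))
    ih : PrefixLDS (L ++ x ∷ R₀) (proj₁ (grow k w))
    ih = grow-PrefixLDS k w L R₀ x v lR₀ (All-resp-⊆ (⊆-++⁺ (⊆-refl {x = L}) (++⁺ʳ (z ∷ []) ⊆-refl)) x<LR) pre₀

  grow-yamanouchi : ∀ k w → Yamanouchi w → k ≤ length w → Yamanouchi (proj₁ (grow k w))
  grow-yamanouchi zero    w       v        _       = addable-newRow (shape w) (shape-partition w v) , v
  grow-yamanouchi (suc k) (a ∷ w) (ea , v) (s≤s h) with grow k w | grow-shape k w v h | grow-yamanouchi k w v h
  ... | w′ , c | ec , sh | v′ with a ≟ c
  ...   | yes refl rewrite ≡ᵇ-refl a | sh =
          addable-bumpRow (addBox a (shape w)) a (addBox-partition (shape w) a p ea)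
              (removable-addBox (shape w) a p ea) , v′
    where
    p : IsPartition (shape w)
    p = shape-partition w v
  ...   | no a≢c rewrite ≢⇒≡ᵇ≡false a≢c | sh =
          addable-addBox-≢ (shape w) c a (addable⇒≤length (shape w) c ec) ea (λ q → a≢c (sym q)) , v′

  record Paired (xs q w : List ℕ) : Set where
    field
      yamanouchi  : Yamanouchi w
      length-perm : length q ≡ length xs
      lowerBound  : ∀ b → All (b <_) xs → All (b <_) q
      prefixLDS   : PrefixLDS q w

  pairedPermutations-paired : ∀ xs → AllPairs _<_ xs → All (uncurry (Paired xs)) (pairedPermutations xs)
  pairedPermutations-paired []       _ =
    record { yamanouchi = _ ; length-perm = refl ; lowerBound = λ _ _ → [] ; prefixLDS = refl } ∷ []
  pairedPermutations-paired (x ∷ xs) (x<xs ∷ sorted) =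
    All-concatMap _ (pairedPermutations xs) (pairedPermutations-paired xs sorted)
      (λ (q , w) pr → map⁺ (applyUpTo⁺₁ id (suc m) (λ k< → insert q w pr (≤-pred k<))))
    where
    m : ℕ
    m = length xs
    insert : ∀ q w → Paired xs q w → ∀ {k} → k ≤ m → Paired (x ∷ xs) (insertAt (m ∸ k) x q) (proj₁ (grow k w))
    insert q w pr {k} k≤m = record
      { yamanouchi  = grow-yamanouchi k w yam k≤w
      ; length-perm = trans (length-insertAt j x q) (cong suc lq)
      ; lowerBound  = λ { b (b<x ∷ b<xs) → ++⁺ (take⁺ j (lb b b<xs)) (b<x ∷ drop⁺ j (lb b b<xs)) }
      ; prefixLDS   =
        grow-PrefixLDS k w (take j q) (drop j q) x yam lenR (split {All (x <_)} (lb x x<xs))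
          (split {λ p → PrefixLDS p w} pre)
      }
      where
      open Paired pr renaming (yamanouchi to yam; length-perm to lq; lowerBound to lb; prefixLDS to pre)
      j : ℕ
      j = m ∸ k
      split : {P : List ℕ → Set} → P q → P (take j q ++ drop j q)
      split {P} = subst P (sym (take++drop≡id j q))
      k≤w : k ≤ length w
      k≤w = subst (k ≤_) (sym (trans (PrefixLDS-length q w pre) lq)) k≤m
      lenR : length (drop j q) ≡ k
      lenR = trans (length-drop j q) (trans (cong (_∸ j) lq) (m∸[m∸n]≡n k≤m))

  D-pairedPermutations : ∀ xs → AllPairs _<_ xs → All (λ (q , w) → D q ≡ length (shape w)) (pairedPermutations xs)
  D-pairedPermutations xs sorted =
    All.map (λ {(q , w)} pr → D≡LDS (PrefixLDS-LDS q w (Paired.prefixLDS pr)))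
        (pairedPermutations-paired xs sorted)


module NatToRational where

  open import Data.Nat as ℕ using (ℕ; zero; suc)
  import Data.Nat.Properties as ℕP
  open import Data.Integer as ℤ using (+_)
  import Data.Integer.Properties as ℤP
  open import Data.Rational as ℚ using (ℚ; _/_; 0ℚ; 1ℚ; toℚᵘ)
  open import Data.Rational.Properties as ℚP using (toℚᵘ-injective; toℚᵘ-homo-+; toℚᵘ-homo-*; toℚᵘ-fromℚᵘ)
  open import Data.Rational.Unnormalised as U using (mkℚᵘ; *≡*)
  import Data.Rational.Unnormalised.Properties as UP
  open import Relation.Binary.PropositionalEquality

  opaque
    ι : ℕ → ℚ
    ι n = (+ n) / 1

    inv : ℕ → ℚ
    inv k = (+ 1) / suc k

  opaque
    unfolding ι inv

    ι-def : ∀ n → ι n ≡ (+ n) / 1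
    ι-def n = refl

    inv-def : ∀ k → inv k ≡ (+ 1) / suc k
    inv-def k = refl

    ι-0 : ι 0 ≡ 0ℚ
    ι-0 = refl

    inv-0 : inv 0 ≡ 1ℚ
    inv-0 = refl

  opaque
    unfolding ι inv

    private
      toℚᵘ-ι : ∀ n → toℚᵘ (ι n) U.≃ mkℚᵘ (+ n) 0
      toℚᵘ-ι n = toℚᵘ-fromℚᵘ (mkℚᵘ (+ n) 0)

      toℚᵘ-/ : ∀ n k → toℚᵘ ((+ n) / suc k) U.≃ mkℚᵘ (+ n) k
      toℚᵘ-/ n k = toℚᵘ-fromℚᵘ (mkℚᵘ (+ n) k)

      ≃-cross : ∀ x y d₁ d₂ → x ℕ.* suc d₂ ≡ y ℕ.* suc d₁ → mkℚᵘ (+ x) d₁ U.≃ mkℚᵘ (+ y) d₂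
      ≃-cross x y d₁ d₂ e = *≡* (trans (sym (ℤP.pos-* x (suc d₂))) (trans (cong +_ e) (ℤP.pos-* y (suc d₁))))

      ≃-numerator : ∀ {n n′} d → n ≡ n′ → mkℚᵘ n d U.≃ mkℚᵘ n′ d
      ≃-numerator d refl = UP.≃-refl

    ι-suc : ∀ a → ι (suc a) ≡ 1ℚ ℚ.+ ι a
    ι-suc a = toℚᵘ-injective (UP.≃-trans (toℚᵘ-ι (suc a)) (UP.≃-sym (UP.≃-trans (toℚᵘ-homo-+ 1ℚ (ι a))
      (UP.≃-trans (UP.+-cong (toℚᵘ-ι 1) (toℚᵘ-ι a))
                  (≃-numerator 0 (trans (cong₂ ℤ._+_ (ℤP.*-identityʳ (+ 1)) (ℤP.*-identityʳ (+ a)))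
                      (sym (ℤP.pos-+ 1 a))))))))

    inv-cancel : ∀ k → inv k ℚ.* ι (suc k) ≡ 1ℚ
    inv-cancel k = toℚᵘ-injective (UP.≃-trans (toℚᵘ-homo-* (inv k) (ι (suc k)))
      (UP.≃-trans (UP.*-cong (toℚᵘ-/ 1 k) (toℚᵘ-ι (suc k)))
      (UP.≃-trans (UP.≃-trans (≃-numerator _ (ℤP.*-identityˡ (+ suc k)))
          (≃-cross (suc k) 1 _ 0 (sym (ℕP.*-identityˡ _))))
                  (UP.≃-sym (toℚᵘ-ι 1)))))

    /-ι-inv : ∀ a k → (+ a) / suc k ≡ ι a ℚ.* inv k
    /-ι-inv a k = toℚᵘ-injective (UP.≃-trans (toℚᵘ-/ a k) (UP.≃-sym (UP.≃-trans (toℚᵘ-homo-* (ι a) (inv k))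
      (UP.≃-trans (UP.*-cong (toℚᵘ-ι a) (toℚᵘ-/ 1 k))
                  (UP.≃-trans (≃-numerator _ (ℤP.*-identityʳ (+ a)))
                              (≃-cross a a _ k (cong (a ℕ.*_) (cong suc (sym (ℕP.+-identityʳ k))))))))))

  ι-+ : ∀ a b → ι (a ℕ.+ b) ≡ ι a ℚ.+ ι b
  ι-+ zero    b = trans (sym (ℚP.+-identityˡ (ι b))) (cong (ℚ._+ ι b) (sym ι-0))
  ι-+ (suc a) b =
    trans (ι-suc (a ℕ.+ b)) (trans (cong (1ℚ ℚ.+_) (ι-+ a b))
          (trans (sym (ℚP.+-assoc 1ℚ (ι a) (ι b))) (cong (ℚ._+ ι b) (sym (ι-suc a)))))

  ι-* : ∀ a b → ι (a ℕ.* b) ≡ ι a ℚ.* ι b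
  ι-* zero    b = trans ι-0 (trans (sym (ℚP.*-zeroˡ (ι b))) (cong (ℚ._* ι b) (sym ι-0)))
  ι-* (suc a) b =
    trans (ι-+ b (a ℕ.* b)) (trans (cong (ι b ℚ.+_) (ι-* a b))
    (trans (cong (ℚ._+ ι a ℚ.* ι b) (sym (ℚP.*-identityˡ (ι b))))
           (trans (sym (ℚP.*-distribʳ-+ (ι b) 1ℚ (ι a))) (cong (ℚ._* ι b) (sym (ι-suc a))))))

  /-ι : ∀ a d .{{_ : ℕ.NonZero d}} → (+ a) / d ≡ ι a ℚ.* ((+ 1) / d)
  /-ι a (suc k) = trans (/-ι-inv a k) (cong (ι a ℚ.*_) (inv-def k))


module RationalSums where

  open import Data.Nat as ℕ using (ℕ; zero; suc)
  open import Data.Rational as ℚ using (ℚ; 1ℚ; _+_; _*_)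
  import Data.Rational.Properties as ℚP
  open import Relation.Binary.PropositionalEquality
  open NatSums using (Σ<)
  open NatToRational

  open RangeFolds ℚP.+-0-isCommutativeMonoid public using ()
    renaming ( fold< to Σq<; fold<-cong< to Σq-cong<; fold<-cong to Σq-cong; fold<-ε to Σq-0
             ; fold<-∙ to Σq-+; fold<-swap to Σq-swap; fold<-extend to Σq-extend; fold<-single to Σq-single
             ; ind to indq )

  open RangeFolds ℚP.*-1-isCommutativeMonoid public using ()
    renaming ( fold< to Πq<; fold<-cong< to Πq-cong<; fold<-ε< to Πq-1; fold<-∙ to Πq-*; fold<-snoc to Πq-snoc
             ; fold<-split to Πq-split; fold<-extend to Πq-extend )

  Σq-*ˡ : ∀ c n (g : ℕ → ℚ) → c * Σq< n g ≡ Σq< n (λ i → c * g i)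
  Σq-*ˡ c zero    g = ℚP.*-zeroʳ c
  Σq-*ˡ c (suc n) g = trans (ℚP.*-distribˡ-+ c (g 0) _) (cong (c * g 0 +_) (Σq-*ˡ c n (λ i → g (suc i))))

  Σq-*ʳ : ∀ c n (g : ℕ → ℚ) → Σq< n g * c ≡ Σq< n (λ i → g i * c)
  Σq-*ʳ c n g = trans (ℚP.*-comm _ c) (trans (Σq-*ˡ c n g) (Σq-cong n (λ i → ℚP.*-comm c (g i))))

  ι-Σ< : ∀ n (g : ℕ → ℕ) → ι (Σ< n g) ≡ Σq< n (λ i → ι (g i))
  ι-Σ< zero    g = ι-0
  ι-Σ< (suc n) g = trans (ι-+ (g 0) _) (cong (ι (g 0) +_) (ι-Σ< n (λ i → g (suc i))))

  Σq-1 : ∀ n → Σq< n (λ _ → 1ℚ) ≡ ι n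
  Σq-1 zero    = sym ι-0
  Σq-1 (suc n) = trans (cong (1ℚ +_) (Σq-1 n)) (sym (ι-suc n))


-- Boxes are indexed from 0: box (a, b) lies in row a and column b, and `hook ν a b` is its
-- hook length minus one, so that `inv (hook ν a b)` is the reciprocal of its hook length.
module HookProducts where

  open import Data.Nat as ℕ using (ℕ; zero; suc; _<_; _≤_; z≤n; z<s; s<s; _∸_; _<ᵇ_)
  import Data.Nat.Properties as ℕP
  open import Data.Bool using (true; false)
  open import Data.List using (List; []; _∷_; length; map; applyUpTo)
  open import Data.Rational as ℚ using (ℚ; _*_)
  open import Data.Product using (_×_; _,_; proj₁; proj₂)
  open import Data.Empty using (⊥-elim)
  open import Relation.Binary.PropositionalEquality
  open import Defs using (invHook; invHooksFrom; prodℚ; colLen)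
  open BooleanComparisons
  open YoungDiagrams
  open NatToRational
  open RationalSums

  col : List ℕ → ℕ → ℕ
  col ν b = colLen ν (suc b)

  hook : List ℕ → ℕ → ℕ → ℕ
  hook ν a b = (row ν a ∸ suc b) ℕ.+ (col ν b ∸ suc a)

  invHookProduct : List ℕ → ℚ
  invHookProduct ν = Πq< (length ν) (λ a → Πq< (row ν a) (λ b → inv (hook ν a b)))

  private
    prodℚ-map-applyUpTo : ∀ (f : ℕ → ℚ) (g : ℕ → ℕ) n → prodℚ (map f (applyUpTo g n)) ≡ Πq< n (λ b → f (g b))
    prodℚ-map-applyUpTo f g zero    = refl
    prodℚ-map-applyUpTo f g (suc n) = cong (f (g 0) *_) (prodℚ-map-applyUpTo f (λ i → g (suc i)) n)

    hookIn : List ℕ → ℕ → ℕ → ℕ → ℕ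
    hookIn λ′ a r b = (r ∸ suc b) ℕ.+ (colLen λ′ (suc b) ∸ suc a)

    invHooksFrom≡Πq : ∀ λ′ a₀ rs → invHooksFrom λ′ (suc a₀) rs
                    ≡ Πq< (length rs) (λ t → Πq< (row rs t) (λ b → inv (hookIn λ′ (a₀ ℕ.+ t) (row rs t) b)))
    invHooksFrom≡Πq λ′ a₀ []       = refl
    invHooksFrom≡Πq λ′ a₀ (r ∷ rs) = cong₂ _*_
      (trans (prodℚ-map-applyUpTo (invHook λ′ (suc a₀) r) suc r)
             (Πq-cong< r (λ b _ → trans (sym (inv-def _))
                 (cong (λ z → inv (hookIn λ′ z r b)) (sym (ℕP.+-identityʳ a₀))))))
      (trans (invHooksFrom≡Πq λ′ (suc a₀) rs)
             (Πq-cong< (length rs) (λ t _ → Πq-cong< (row rs t)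
                 (λ b _ → cong (λ z → inv (hookIn λ′ z (row rs t) b)) (sym (ℕP.+-suc a₀ t))))))

  invHooksFrom≡invHookProduct : ∀ ν → invHooksFrom ν 1 ν ≡ invHookProduct ν
  invHooksFrom≡invHookProduct ν = invHooksFrom≡Πq ν 0 ν

  private
    col-cons-< : ∀ x ν b → (b <ᵇ x) ≡ true → col (x ∷ ν) b ≡ suc (col ν b)
    col-cons-< x ν b e rewrite e = refl

    col-cons-≥ : ∀ x ν b → (b <ᵇ x) ≡ false → col (x ∷ ν) b ≡ col ν b
    col-cons-≥ x ν b e rewrite e = refl

    col-beyond : ∀ ν → IsPartition ν → ∀ b → row ν 0 ≤ b → col ν b ≡ 0
    col-beyond []      _           b _  = refl
    col-beyond (x ∷ ν) (_ , h , p) b xb =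
      trans (col-cons-≥ x ν b (≥⇒<ᵇ≡false {b} {x} xb)) (col-beyond ν p b (ℕP.≤-trans h xb))

  <row⇔<col : ∀ ν → IsPartition ν → ∀ i b → (b < row ν i → i < col ν b) × (i < col ν b → b < row ν i)
  <row⇔<col []      _            i b = (λ ()) , (λ ())
  <row⇔<col (x ∷ ν) (h₀ , h , p) i b = byComparison (b <ᵇ x) refl
    where
    Goal : Set
    Goal = (b < row (x ∷ ν) i → i < col (x ∷ ν) b) × (i < col (x ∷ ν) b → b < row (x ∷ ν) i)
    byComparison : ∀ t → (b <ᵇ x) ≡ t → Goal
    byComparison true e = to i , from i
      where
      c≡ : col (x ∷ ν) b ≡ suc (col ν b)
      c≡ = col-cons-< x ν b e
      to : ∀ i → b < row (x ∷ ν) i → i < col (x ∷ ν) b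
      to zero    _  = subst (0 <_) (sym c≡) z<s
      to (suc i) lt = subst (suc i <_) (sym c≡) (s<s (proj₁ (<row⇔<col ν p i b) lt))
      from : ∀ i → i < col (x ∷ ν) b → b < row (x ∷ ν) i
      from zero    _  = <ᵇ≡true⇒< {b} {x} e
      from (suc i) lt = proj₂ (<row⇔<col ν p i b) (ℕP.≤-pred (subst (suc i <_) c≡ lt))
    byComparison false e = to i , from i
      where
      x≤b : x ≤ b
      x≤b = <ᵇ≡false⇒≥ {b} {x} e
      c≡0 : col (x ∷ ν) b ≡ 0
      c≡0 = trans (col-cons-≥ x ν b e) (col-beyond ν p b (ℕP.≤-trans h x≤b))
      to : ∀ i → b < row (x ∷ ν) i → i < col (x ∷ ν) b
      to i lt = ⊥-elim (ℕP.<⇒≱ lt (ℕP.≤-trans (row-antitone (x ∷ ν) (h₀ , h , p) {0} {i} z≤n) x≤b))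
      from : ∀ i → i < col (x ∷ ν) b → b < row (x ∷ ν) i
      from i lt = ⊥-elim (ℕP.<⇒≱ (subst (i <_) c≡0 lt) z≤n)

  <row⇒<col : ∀ ν → IsPartition ν → ∀ i b → b < row ν i → i < col ν b
  <row⇒<col ν p i b = proj₁ (<row⇔<col ν p i b)

  <col⇒<row : ∀ ν → IsPartition ν → ∀ i b → i < col ν b → b < row ν i
  <col⇒<row ν p i b = proj₂ (<row⇔<col ν p i b)


-- The hook walk of Greene, Nijenhuis and Wilf, with its probabilities computed in closed form.
-- For the corner (r, β) of ν, `walkToCorner ν r a b` is the probability that the walk started
-- at box (a, b) ends at that corner.  It factorises as columnWalk ν r a · rowWalk ν r b, the
-- probabilities for the two independent projections of the walk onto column β and row r;
-- u a and v b denote the hooks (minus one) of the boxes (a, β) and (r, b).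
module HookWalk where

  open import Data.Nat as ℕ using (ℕ; zero; suc; _<_; _≤_; z≤n; s≤s; _∸_; _≤ᵇ_; _<ᵇ_)
  import Data.Nat.Properties as ℕP
  open import Data.Bool using (true; if_then_else_; _∧_)
  open import Data.Bool.Properties using (∧-zeroʳ)
  open import Data.List using (List; length)
  open import Data.Rational as ℚ using (ℚ; 0ℚ; 1ℚ; _+_; _*_)
  import Data.Rational.Properties as ℚP
  open import Data.Rational.Solver using (module +-*-Solver)
  open import Data.Product using (_×_; _,_)
  open import Data.Sum using (_⊎_; inj₁; inj₂)
  open import Data.Empty using (⊥-elim)
  open import Relation.Binary.PropositionalEquality
  open import Relation.Nullary using (yes; no)
  open BooleanComparisons
  open YoungDiagrams
  open NatToRational
  open RationalSums
  open HookProducts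

  -- rcp k = 1 / k, with the junk value rcp 0 = 1
  rcp : ℕ → ℚ
  rcp k = inv (k ∸ 1)

  rcp-cancel : ∀ k → 1 ≤ k → rcp k * ι k ≡ 1ℚ
  rcp-cancel (suc k) _ = inv-cancel k

  cornerColumn : List ℕ → ℕ → ℕ
  cornerColumn ν r = row ν r ∸ 1

  columnHook : List ℕ → ℕ → ℕ → ℕ
  columnHook ν r a = hook ν a (cornerColumn ν r)

  rowHook : List ℕ → ℕ → ℕ → ℕ
  rowHook ν r b = hook ν r b

  columnProduct : List ℕ → ℕ → ℕ → ℚ
  columnProduct ν r a = Πq< (r ∸ a) (λ t → 1ℚ + rcp (columnHook ν r (a ℕ.+ t)))

  columnWalk : List ℕ → ℕ → ℕ → ℚ
  columnWalk ν r a = if a <ᵇ r then rcp (columnHook ν r a) * columnProduct ν r (suc a) else 1ℚ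

  rowProduct : List ℕ → ℕ → ℕ → ℚ
  rowProduct ν r b = Πq< (cornerColumn ν r ∸ b) (λ t → 1ℚ + rcp (rowHook ν r (b ℕ.+ t)))

  rowWalk : List ℕ → ℕ → ℕ → ℚ
  rowWalk ν r b = if b <ᵇ cornerColumn ν r then rcp (rowHook ν r b) * rowProduct ν r (suc b) else 1ℚ

  walkToCorner : List ℕ → ℕ → ℕ → ℕ → ℚ
  walkToCorner ν r a b = if (a ≤ᵇ r) ∧ (b ≤ᵇ cornerColumn ν r) then columnWalk ν r a * rowWalk ν r b else 0ℚ

  hook-split-arith : ∀ ra rr cb a r b → rr ≤ ra → a ≤ r → suc b ≤ rr → suc r ≤ cb →
    (ra ∸ suc b) ℕ.+ (cb ∸ suc a) ≡ ((ra ∸ rr) ℕ.+ (r ∸ a)) ℕ.+ ((rr ∸ suc b) ℕ.+ (cb ∸ suc r))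
  hook-split-arith ra rr cb a r b h₁ h₂ h₃ h₄
    with ℕP.m≤n⇒∃[o]m+o≡n h₁ | ℕP.m≤n⇒∃[o]m+o≡n h₂ | ℕP.m≤n⇒∃[o]m+o≡n h₃ | ℕP.m≤n⇒∃[o]m+o≡n h₄
  ... | d₁ , refl | d₂ , refl | d₃ , refl | d₄ , refl =
    trans (cong₂ ℕ._+_ armPart legPart)
    (trans (rearrange d₁ d₂ d₃ d₄)
           (sym (cong₂ ℕ._+_ (cong₂ ℕ._+_ (ℕP.m+n∸m≡n (suc b ℕ.+ d₃) d₁) (ℕP.m+n∸m≡n a d₂))
                             (cong₂ ℕ._+_ (ℕP.m+n∸m≡n (suc b) d₃) (ℕP.m+n∸m≡n (suc (a ℕ.+ d₂)) d₄)))))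
    where
    open import Data.Nat.Solver using () renaming (module +-*-Solver to ℕ-Solver)
    open ℕ-Solver
    rearrange : ∀ d₁ d₂ d₃ d₄ → (d₃ ℕ.+ d₁) ℕ.+ (d₂ ℕ.+ d₄) ≡ (d₁ ℕ.+ d₂) ℕ.+ (d₃ ℕ.+ d₄)
    rearrange = solve 4 (λ d₁ d₂ d₃ d₄ → (d₃ :+ d₁) :+ (d₂ :+ d₄) := (d₁ :+ d₂) :+ (d₃ :+ d₄)) refl
    armPart : (suc b ℕ.+ d₃) ℕ.+ d₁ ∸ suc b ≡ d₃ ℕ.+ d₁
    armPart = trans (cong (_∸ suc b) (ℕP.+-assoc (suc b) d₃ d₁)) (ℕP.m+n∸m≡n (suc b) (d₃ ℕ.+ d₁))
    legPart : (suc (a ℕ.+ d₂) ℕ.+ d₄) ∸ suc a ≡ d₂ ℕ.+ d₄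
    legPart = trans (cong (_∸ a) (ℕP.+-assoc a d₂ d₄)) (ℕP.m+n∸m≡n a (d₂ ℕ.+ d₄))

  -- 1/(u + v) · (1/u + 1/v) = 1/u · 1/v, the identity that makes the walk probabilities factorise
  reciprocal-sum : ∀ ruv ru rv U V P Q → ru * U ≡ 1ℚ → rv * V ≡ 1ℚ → ruv * (U + V) ≡ 1ℚ →
    ruv * (ru * P * Q + P * (rv * Q)) ≡ (ru * P) * (rv * Q)
  reciprocal-sum ruv ru rv U V P Q ruU≡1 rvV≡1 ruvUV≡1 = begin
    ruv * (ru * P * Q + P * (rv * Q))   ≡⟨ cong (ruv *_) (regroup ru rv P Q) ⟩
    ruv * ((ru + rv) * (P * Q))         ≡⟨ cong (λ z → ruv * (z * (P * Q))) sum≡product ⟩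
    ruv * ((ru * rv) * (U + V) * (P * Q)) ≡⟨ shuffle ruv (ru * rv) (U + V) (P * Q) ⟩
    ruv * (U + V) * ((ru * rv) * (P * Q)) ≡⟨ cong (_* ((ru * rv) * (P * Q))) ruvUV≡1 ⟩
    1ℚ * ((ru * rv) * (P * Q))           ≡⟨ finish ru rv P Q ⟩
    (ru * P) * (rv * Q)                  ∎
    where
    open ≡-Reasoning
    open +-*-Solver
    regroup : ∀ ru rv P Q → ru * P * Q + P * (rv * Q) ≡ (ru + rv) * (P * Q)
    regroup = solve 4 (λ ru rv P Q → ru :* P :* Q :+ P :* (rv :* Q) := (ru :+ rv) :* (P :* Q)) refl
    shuffle : ∀ x w s m → x * (w * s * m) ≡ (x * s) * (w * m)
    shuffle = solve 4 (λ x w s m → x :* (w :* s :* m) := (x :* s) :* (w :* m)) refl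
    finish : ∀ ru rv P Q → 1ℚ * ((ru * rv) * (P * Q)) ≡ (ru * P) * (rv * Q)
    finish = solve 4 (λ ru rv P Q → con 1ℚ :* ((ru :* rv) :* (P :* Q)) := (ru :* P) :* (rv :* Q)) refl
    sum≡product : ru + rv ≡ (ru * rv) * (U + V)
    sum≡product = sym (trans (ℚP.*-distribˡ-+ (ru * rv) U V)
      (trans (cong₂ _+_ (trans (ℚP.*-comm (ru * rv) U)
                               (trans (sym (ℚP.*-assoc U ru rv))
                                   (trans (cong (_* rv) (trans (ℚP.*-comm U ru) ruU≡1)) (ℚP.*-identityˡ rv))))
                        (trans (ℚP.*-assoc ru rv V) (trans (cong (ru *_) rvV≡1) (ℚP.*-identityʳ ru))))
             (ℚP.+-comm rv ru)))

  module Corner (ν : List ℕ) (p : IsPartition ν) (r : ℕ) (er : removable ν r ≡ true) where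

    β : ℕ
    β = cornerColumn ν r
    u v : ℕ → ℕ
    u = columnHook ν r
    v = rowHook ν r
    P X Q Y : ℕ → ℚ
    P = columnProduct ν r
    X = columnWalk ν r
    Q = rowProduct ν r
    Y = rowWalk ν r
    π : ℕ → ℕ → ℚ
    π = walkToCorner ν r

    1≤row : 1 ≤ row ν r
    1≤row = ℕP.≤-trans (s≤s z≤n) (<ᵇ≡true⇒< {row ν (suc r)} {row ν r} er)

    1+β≡row : suc β ≡ row ν r
    1+β≡row = ℕP.m+[n∸m]≡n 1≤row

    r<length : r < length ν
    r<length = removable⇒<length ν r er

    1+β≤row : ∀ a → a ≤ r → suc β ≤ row ν a
    1+β≤row a h = subst (_≤ row ν a) (sym 1+β≡row) (row-antitone ν p h)

    1+r≤col : ∀ b → b ≤ β → suc r ≤ col ν b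
    1+r≤col b h = <row⇒<col ν p r b (ℕP.≤-trans (s≤s h) (ℕP.≤-reflexive 1+β≡row))

    col≤1+r : col ν β ≤ suc r
    col≤1+r with col ν β ℕP.≤? suc r
    ... | yes q = q
    ... | no q =
      ⊥-elim (ℕP.<⇒≱ (<ᵇ≡true⇒< {row ν (suc r)} {row ν r} er)
        (ℕP.≤-trans (ℕP.≤-reflexive (sym 1+β≡row)) (<col⇒<row ν p (suc r) β (ℕP.≰⇒> q))))

    col-β : col ν β ≡ suc r
    col-β = ℕP.≤-antisym col≤1+r (1+r≤col β ℕP.≤-refl)

    hook-split : ∀ a b → a ≤ r → b ≤ β → hook ν a b ≡ u a ℕ.+ v b
    hook-split a b ha hb =
      trans (hook-split-arith (row ν a) (row ν r) (col ν b) a r b (row-antitone ν p ha) ha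
        (ℕP.≤-trans (s≤s hb) (ℕP.≤-reflexive 1+β≡row)) (1+r≤col b hb))
       (cong (ℕ._+ v b) (sym (cong₂ ℕ._+_ (cong (row ν a ∸_) 1+β≡row) (cong (_∸ suc a) col-β))))

    1≤u : ∀ a → a < r → 1 ≤ u a
    1≤u a h =
      ℕP.≤-trans (ℕP.≤-trans (ℕP.m<n⇒0<n∸m h) (ℕP.≤-reflexive (cong (_∸ suc a) (sym col-β)))) (ℕP.m≤n+m _ _)

    1≤v : ∀ b → b < β → 1 ≤ v b
    1≤v b h = ℕP.≤-trans (ℕP.m<n⇒0<n∸m (ℕP.≤-trans (s≤s h) (ℕP.≤-reflexive 1+β≡row))) (ℕP.m≤m+n _ _)

    hook-corner : hook ν r β ≡ 0
    hook-corner =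
      cong₂ ℕ._+_ (trans (cong (_∸ suc β) (sym 1+β≡row)) (ℕP.n∸n≡0 (suc β)))
        (trans (cong (_∸ suc r) col-β) (ℕP.n∸n≡0 (suc r)))

    X-< : ∀ a → a < r → X a ≡ rcp (u a) * P (suc a)
    X-< a h = if-true (rcp (u a) * P (suc a)) 1ℚ (<⇒<ᵇ≡true {a} {r} h)

    X-last : X r ≡ 1ℚ
    X-last = if-false (rcp (u r) * P (suc r)) 1ℚ (≥⇒<ᵇ≡false {r} {r} ℕP.≤-refl)

    Y-< : ∀ b → b < β → Y b ≡ rcp (v b) * Q (suc b)
    Y-< b h = if-true (rcp (v b) * Q (suc b)) 1ℚ (<⇒<ᵇ≡true {b} {β} h)

    Y-last : Y β ≡ 1ℚ
    Y-last = if-false (rcp (v β) * Q (suc β)) 1ℚ (≥⇒<ᵇ≡false {β} {β} ℕP.≤-refl)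

    π-in : ∀ a b → a ≤ r → b ≤ β → π a b ≡ X a * Y b
    π-in a b ha hb = if-true (X a * Y b) 0ℚ (cong₂ _∧_ (≤⇒≤ᵇ≡true ha) (≤⇒≤ᵇ≡true hb))

    π-below : ∀ a b → r < a → π a b ≡ 0ℚ
    π-below a b h = if-false (X a * Y b) 0ℚ (cong (_∧ (b ≤ᵇ β)) (>⇒≤ᵇ≡false {a} {r} h))

    π-right : ∀ a b → β < b → π a b ≡ 0ℚ
    π-right a b h = if-false (X a * Y b) 0ℚ (trans (cong ((a ≤ᵇ r) ∧_) (>⇒≤ᵇ≡false {b} {β} h)) (∧-zeroʳ (a ≤ᵇ r)))

    P-last : P r ≡ 1ℚ
    P-last = cong (λ n → Πq< n (λ t → 1ℚ + rcp (u (r ℕ.+ t)))) (ℕP.n∸n≡0 r)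

    Q-last : Q β ≡ 1ℚ
    Q-last = cong (λ n → Πq< n (λ t → 1ℚ + rcp (v (β ℕ.+ t)))) (ℕP.n∸n≡0 β)

    P-step : ∀ a → a < r → P a ≡ (1ℚ + rcp (u a)) * P (suc a)
    P-step a h = trans (cong (λ n → Πq< n (λ t → 1ℚ + rcp (u (a ℕ.+ t)))) (ℕP.+-∸-assoc 1 {r} {suc a} h))
       (cong₂ _*_ (cong (λ z → 1ℚ + rcp (u z)) (ℕP.+-identityʳ a))
           (Πq-cong< (r ∸ suc a) (λ t _ → cong (λ z → 1ℚ + rcp (u z)) (ℕP.+-suc a t))))

    Q-step : ∀ b → b < β → Q b ≡ (1ℚ + rcp (v b)) * Q (suc b)
    Q-step b h = trans (cong (λ n → Πq< n (λ t → 1ℚ + rcp (v (b ℕ.+ t)))) (ℕP.+-∸-assoc 1 {β} {suc b} h))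
       (cong₂ _*_ (cong (λ z → 1ℚ + rcp (v z)) (ℕP.+-identityʳ b))
           (Πq-cong< (β ∸ suc b) (λ t _ → cong (λ z → 1ℚ + rcp (v z)) (ℕP.+-suc b t))))

    private
      1+x*y : ∀ x y → x * y + y ≡ (1ℚ + x) * y
      1+x*y = solve 2 (λ x y → x :* y :+ y := (con 1ℚ :+ x) :* y) refl
        where open +-*-Solver

    ΣX-telescope : ∀ d a → a ℕ.+ d ≡ r → Σq< (suc d) (λ t → X (a ℕ.+ t)) ≡ P a
    ΣX-telescope zero a e =
      trans (ℚP.+-identityʳ _) (trans (cong X (trans (ℕP.+-identityʳ a) e'))
        (trans X-last (sym (trans (cong P e') P-last))))
      where e' : a ≡ r
            e' = trans (sym (ℕP.+-identityʳ a)) e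
    ΣX-telescope (suc d) a e =
      trans (cong₂ _+_ (cong X (ℕP.+-identityʳ a)) (trans (Σq-cong< (suc d) (λ t _ → cong X (ℕP.+-suc a t)))
          (ΣX-telescope d (suc a) (trans (sym (ℕP.+-suc a d)) e))))
      (trans (cong (_+ P (suc a)) (X-< a a<r)) (trans (1+x*y (rcp (u a)) (P (suc a))) (sym (P-step a a<r))))
      where a<r : a < r
            a<r = subst (a <_) e (ℕP.≤-trans (s≤s (ℕP.m≤m+n a d)) (ℕP.≤-reflexive (sym (ℕP.+-suc a d))))

    ΣY-telescope : ∀ d b → b ℕ.+ d ≡ β → Σq< (suc d) (λ t → Y (b ℕ.+ t)) ≡ Q b
    ΣY-telescope zero b e =
      trans (ℚP.+-identityʳ _) (trans (cong Y (trans (ℕP.+-identityʳ b) e'))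
        (trans Y-last (sym (trans (cong Q e') Q-last))))
      where e' : b ≡ β
            e' = trans (sym (ℕP.+-identityʳ b)) e
    ΣY-telescope (suc d) b e =
      trans (cong₂ _+_ (cong Y (ℕP.+-identityʳ b)) (trans (Σq-cong< (suc d) (λ t _ → cong Y (ℕP.+-suc b t)))
          (ΣY-telescope d (suc b) (trans (sym (ℕP.+-suc b d)) e))))
      (trans (cong (_+ Q (suc b)) (Y-< b b<β)) (trans (1+x*y (rcp (v b)) (Q (suc b))) (sym (Q-step b b<β))))
      where b<β : b < β
            b<β = subst (b <_) e (ℕP.≤-trans (s≤s (ℕP.m≤m+n b d)) (ℕP.≤-reflexive (sym (ℕP.+-suc b d))))

    ΣX-from : ∀ a → a < r → Σq< (r ∸ a) (λ t → X (suc a ℕ.+ t)) ≡ P (suc a)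
    ΣX-from a h = trans (cong (λ n → Σq< n (λ t → X (suc a ℕ.+ t))) (ℕP.+-∸-assoc 1 {r} {suc a} h))
                           (ΣX-telescope (r ∸ suc a) (suc a) (ℕP.m+[n∸m]≡n h))

    ΣY-from : ∀ b → b < β → Σq< (β ∸ b) (λ t → Y (suc b ℕ.+ t)) ≡ Q (suc b)
    ΣY-from b h = trans (cong (λ n → Σq< n (λ t → Y (suc b ℕ.+ t))) (ℕP.+-∸-assoc 1 {β} {suc b} h))
                           (ΣY-telescope (β ∸ suc b) (suc b) (ℕP.m+[n∸m]≡n h))

    ΣX : Σq< (suc r) X ≡ P 0
    ΣX = ΣX-telescope r 0 refl

    ΣY : Σq< (suc β) Y ≡ Q 0
    ΣY = ΣY-telescope β 0 refl

    arm : ℕ → ℕ → ℚ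
    arm a b = Σq< (row ν a ∸ suc b) (λ t → π a (suc b ℕ.+ t))

    leg : ℕ → ℕ → ℚ
    leg a b = Σq< (col ν b ∸ suc a) (λ t → π (suc a ℕ.+ t) b)

    ∸≤⇒<+ : ∀ m n t → m ∸ n ≤ t → m < suc n ℕ.+ t
    ∸≤⇒<+ m n t h = s≤s (ℕP.≤-trans (ℕP.m≤n+m∸n m n) (ℕP.+-monoʳ-≤ n h))

    arm≡ : ∀ a b → a ≤ r → b ≤ β → arm a b ≡ X a * Σq< (β ∸ b) (λ t → Y (suc b ℕ.+ t))
    arm≡ a b ha hb =
      trans (Σq-extend (β ∸ b) (row ν a ∸ suc b) _ (ℕP.∸-monoˡ-≤ (suc b) (1+β≤row a ha))
          (λ t h1 _ → π-right a (suc b ℕ.+ t) (∸≤⇒<+ β b t h1)))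
      (trans (Σq-cong< (β ∸ b) (λ t t< → π-in a (suc b ℕ.+ t) ha
          (ℕP.≤-trans (ℕP.+-monoʳ-< b t<) (ℕP.≤-reflexive (ℕP.m+[n∸m]≡n hb)))))
      (sym (Σq-*ˡ (X a) (β ∸ b) (λ t → Y (suc b ℕ.+ t)))))

    leg≡ : ∀ a b → a ≤ r → b ≤ β → leg a b ≡ Σq< (r ∸ a) (λ t → X (suc a ℕ.+ t)) * Y b
    leg≡ a b ha hb =
      trans (Σq-extend (r ∸ a) (col ν b ∸ suc a) _ (ℕP.∸-monoˡ-≤ (suc a) (1+r≤col b hb))
          (λ t h1 _ → π-below (suc a ℕ.+ t) b (∸≤⇒<+ r a t h1)))
      (trans (Σq-cong< (r ∸ a) (λ t t< → π-in (suc a ℕ.+ t) b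
          (ℕP.≤-trans (ℕP.+-monoʳ-< a t<) (ℕP.≤-reflexive (ℕP.m+[n∸m]≡n ha))) hb))
      (sym (Σq-*ʳ (Y b) (r ∸ a) (λ t → X (suc a ℕ.+ t)))))

    walk-step-interior : ∀ a b → a ≤ r → b ≤ β → a < r → b < β → rcp (hook ν a b) * (arm a b + leg a b) ≡ π a b
    walk-step-interior a b ha hb a<r b<β =
      trans (cong₂ (λ z w → rcp z * w) (hook-split a b ha hb)
              (cong₂ _+_ (trans (arm≡ a b ha hb) (cong₂ _*_ (X-< a a<r) (ΣY-from b b<β)))
                         (trans (leg≡ a b ha hb) (cong₂ _*_ (ΣX-from a a<r) (Y-< b b<β)))))
      (trans (reciprocal-sum (rcp (u a ℕ.+ v b)) (rcp (u a)) (rcp (v b)) (ι (u a)) (ι (v b)) (P (suc a))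
          (Q (suc b))
                (rcp-cancel (u a) (1≤u a a<r)) (rcp-cancel (v b) (1≤v b b<β))
                (trans (cong (rcp (u a ℕ.+ v b) *_) (sym (ι-+ (u a) (v b))))
                    (rcp-cancel (u a ℕ.+ v b) (ℕP.≤-trans (1≤u a a<r) (ℕP.m≤m+n _ _)))))
      (sym (trans (π-in a b ha hb) (cong₂ _*_ (X-< a a<r) (Y-< b b<β)))))

    walk-step-cornerRow : ∀ b → b ≤ β → b < β → rcp (hook ν r b) * (arm r b + leg r b) ≡ π r b
    walk-step-cornerRow b hb b<β =
      trans (cong₂ (λ z w → rcp z * w) (trans (hook-split r b ℕP.≤-refl hb) (cong (ℕ._+ v b) hook-corner))
              (cong₂ _+_ (trans (arm≡ r b ℕP.≤-refl hb) (cong₂ _*_ X-last (ΣY-from b b<β)))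
                         (trans (leg≡ r b ℕP.≤-refl hb)
                             (cong (_* Y b) (cong (λ n → Σq< n (λ t → X (suc r ℕ.+ t))) (ℕP.n∸n≡0 r))))))
      (trans (simplify (rcp (v b)) (Q (suc b)) (Y b))
      (sym (trans (π-in r b ℕP.≤-refl hb) (cong₂ _*_ X-last (Y-< b b<β)))))
      where
      open +-*-Solver
      simplify : ∀ x q y → x * (1ℚ * q + 0ℚ * y) ≡ 1ℚ * (x * q)
      simplify = solve 3 (λ x q y → x :* (con 1ℚ :* q :+ con 0ℚ :* y) := con 1ℚ :* (x :* q)) refl

    walk-step-cornerColumn : ∀ a → a ≤ r → a < r → rcp (hook ν a β) * (arm a β + leg a β) ≡ π a β
    walk-step-cornerColumn a ha a<r =
      trans (cong (rcp (hook ν a β) *_)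
              (cong₂ _+_ (trans (arm≡ a β ha ℕP.≤-refl)
                  (cong (X a *_) (cong (λ n → Σq< n (λ t → Y (suc β ℕ.+ t))) (ℕP.n∸n≡0 β))))
                         (trans (leg≡ a β ha ℕP.≤-refl) (cong₂ _*_ (ΣX-from a a<r) Y-last))))
      (trans (cong (rcp (u a) *_) (cong (_+ P (suc a) * 1ℚ) (cong (_* 0ℚ) (X-< a a<r))))
      (trans (simplify (rcp (u a)) (rcp (u a) * P (suc a)) (P (suc a)))
      (sym (trans (π-in a β ha ℕP.≤-refl) (cong₂ _*_ (X-< a a<r) Y-last)))))
      where
      open +-*-Solver
      simplify : ∀ x z p′ → x * (z * 0ℚ + p′ * 1ℚ) ≡ (x * p′) * 1ℚ
      simplify = solve 3 (λ x z p′ → x :* (z :* con 0ℚ :+ p′ :* con 1ℚ) := (x :* p′) :* con 1ℚ) refl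

    walk-step : ∀ a b → a ≤ r → b ≤ β → 1 ≤ hook ν a b → rcp (hook ν a b) * (arm a b + leg a b) ≡ π a b
    walk-step a b ha hb h1 = byPosition (ℕP.m≤n⇒m<n∨m≡n ha) (ℕP.m≤n⇒m<n∨m≡n hb)
      where
      byPosition : (a < r ⊎ a ≡ r) → (b < β ⊎ b ≡ β) → rcp (hook ν a b) * (arm a b + leg a b) ≡ π a b
      byPosition (inj₁ x) (inj₁ y) = walk-step-interior a b ha hb x y
      byPosition (inj₂ e) (inj₁ y) =
        subst (λ a' → rcp (hook ν a' b) * (arm a' b + leg a' b) ≡ π a' b) (sym e) (walk-step-cornerRow b hb y)
      byPosition (inj₁ x) (inj₂ e) =
        subst (λ b' → rcp (hook ν a b') * (arm a b' + leg a b') ≡ π a b') (sym e)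
          (walk-step-cornerColumn a ha x)
      byPosition (inj₂ e1) (inj₂ e2) = ⊥-elim (ℕP.<⇒≱ h1 (ℕP.≤-reflexive (trans (cong₂ (hook ν) e1 e2) hook-corner)))

    walk-outside : ∀ a b → (r < a ⊎ β < b) → (arm a b ≡ 0ℚ) × (leg a b ≡ 0ℚ) × (π a b ≡ 0ℚ)
    walk-outside a b (inj₁ h) =
      Σq-0 (row ν a ∸ suc b) (λ t → π-below a (suc b ℕ.+ t) h) , Σq-0 (col ν b ∸ suc a)
        (λ t → π-below (suc a ℕ.+ t) b (ℕP.<-≤-trans h (ℕP.≤-trans (ℕP.n≤1+n a) (ℕP.m≤m+n (suc a) t)))) ,
        π-below a b h
    walk-outside a b (inj₂ h) =
      Σq-0 (row ν a ∸ suc b) (λ t → π-right a (suc b ℕ.+ t)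
        (ℕP.<-≤-trans h (ℕP.≤-trans (ℕP.n≤1+n b) (ℕP.m≤m+n (suc b) t)))) , Σq-0 (col ν b ∸ suc a)
        (λ t → π-right (suc a ℕ.+ t) b h) , π-right a b h


-- Summing the walk probabilities over all corners gives 1 for every starting box (by induction
-- on the hook length, one walk step at a time); summing over all boxes then expresses |ν| as
-- the sum over corners of the closed-form products.
module HookWalkTotal where

  open import Data.Nat as ℕ using (ℕ; zero; suc; _<_; _≤_; z≤n; s≤s; _∸_; _≡ᵇ_)
  import Data.Nat.Properties as ℕP
  open import Data.Nat.ListAction using (sum)
  open import Data.Bool using (true; false)
  open import Data.List using (List; length)
  open import Data.Rational as ℚ using (ℚ; 0ℚ; 1ℚ; _+_; _*_)
  import Data.Rational.Properties as ℚP
  open import Data.Product using (_×_; _,_)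
  open import Data.Sum using (inj₁; inj₂)
  open import Data.Empty using (⊥-elim)
  open import Relation.Binary.PropositionalEquality
  open import Relation.Nullary using (Dec; yes; no)
  open import Relation.Binary using (tri<; tri≈; tri>)
  open BooleanComparisons
  open YoungDiagrams
  open NatToRational
  open RationalSums
  open HookProducts
  open HookWalk

  module Walk (ν : List ℕ) (p : IsPartition ν) where

    ℓ : ℕ
    ℓ = length ν

    totalWalk : ℕ → ℕ → ℚ
    totalWalk a b = Σq< ℓ (λ r → indq (removable ν r) (walkToCorner ν r a b))

    col-antitone : ∀ {b b'} → b ≤ b' → col ν b' ≤ col ν b
    col-antitone {b} {b'} h with col ν b' ℕP.≤? col ν b
    ... | yes q = q
    ... | no q =
      ⊥-elim (ℕP.<-irrefl refl ((<row⇒<col ν p (col ν b) b)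
        (ℕP.<-≤-trans (s≤s h) (<col⇒<row ν p (col ν b) b' (ℕP.≰⇒> q)))))

    hook-arm-< : ∀ a b t → suc b ℕ.+ t < row ν a → hook ν a (suc b ℕ.+ t) < hook ν a b
    hook-arm-< a b t h =
      ℕP.+-mono-<-≤ (ℕP.∸-monoʳ-< (s≤s (s≤s (ℕP.m≤m+n b t))) h)
        (ℕP.∸-monoˡ-≤ (suc a) (col-antitone (ℕP.≤-trans (ℕP.n≤1+n b) (ℕP.m≤m+n (suc b) t))))

    hook-leg-< : ∀ a b t → suc a ℕ.+ t < col ν b → hook ν (suc a ℕ.+ t) b < hook ν a b
    hook-leg-< a b t h =
      ℕP.+-mono-≤-< (ℕP.∸-monoˡ-≤ (suc b) (row-antitone ν p {a} {suc a ℕ.+ t} (ℕP.≤-trans (ℕP.n≤1+n a)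
        (ℕP.m≤m+n (suc a) t)))) (ℕP.∸-monoʳ-< (s≤s (s≤s (ℕP.m≤m+n a t))) h)

    armLength : ℕ → ℕ → ℕ
    armLength a b = row ν a ∸ suc b

    legLength : ℕ → ℕ → ℕ
    legLength a b = col ν b ∸ suc a

    *-0+0 : ∀ x → x * (0ℚ + 0ℚ) ≡ 0ℚ
    *-0+0 x = trans (cong (x *_) (ℚP.+-identityʳ 0ℚ)) (ℚP.*-zeroʳ x)

    walkToCorner-step : ∀ a b r → 1 ≤ hook ν a b → ∀ bb → removable ν r ≡ bb →
      indq bb (walkToCorner ν r a b) ≡ rcp (hook ν a b) *
          (Σq< (armLength a b) (λ t → indq bb (walkToCorner ν r a (suc b ℕ.+ t))) + Σq< (legLength a b)
          (λ t → indq bb (walkToCorner ν r (suc a ℕ.+ t) b)))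
    walkToCorner-step a b r h1 false e =
      sym (trans (cong (λ z → rcp (hook ν a b) * z) (cong₂ _+_ (Σq-0 (armLength a b) (λ _ → refl))
        (Σq-0 (legLength a b) (λ _ → refl)))) (*-0+0 (rcp (hook ν a b))))
    walkToCorner-step a b r h1 true e = byPosition (a ℕP.≤? r) (b ℕP.≤? Corner.β ν p r e)
      where
      open Corner ν p r e
      Step : Set
      Step =
        walkToCorner ν r a b ≡ rcp (hook ν a b) * (Σq< (armLength a b)
          (λ t → walkToCorner ν r a (suc b ℕ.+ t)) + Σq< (legLength a b)
          (λ t → walkToCorner ν r (suc a ℕ.+ t) b))
      outside : (arm a b ≡ 0ℚ) × (leg a b ≡ 0ℚ) × (π a b ≡ 0ℚ) → Step
      outside (arm≡0 , leg≡0 , π≡0) =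
        trans π≡0 (sym (trans (cong (λ z → rcp (hook ν a b) * z) (cong₂ _+_ arm≡0 leg≡0))
          (*-0+0 (rcp (hook ν a b)))))
      byPosition : Dec (a ≤ r) → Dec (b ≤ β) → Step
      byPosition (yes ha) (yes hb) = sym (walk-step a b ha hb h1)
      byPosition (no ha) _ = outside (walk-outside a b (inj₁ (ℕP.≰⇒> ha)))
      byPosition (yes _) (no hb) = outside (walk-outside a b (inj₂ (ℕP.≰⇒> hb)))

    indq-≡0 : ∀ bb (x : ℚ) → (bb ≡ true → x ≡ 0ℚ) → indq bb x ≡ 0ℚ
    indq-≡0 true x f = f refl
    indq-≡0 false x f = refl

    totalWalk-corner : ∀ a b → b < row ν a → hook ν a b ≡ 0 → totalWalk a b ≡ 1ℚ
    totalWalk-corner a b hb h0 = trans (Σq-cong ℓ atCorner) (Σq-single ℓ a (λ _ → 1ℚ) a<ℓ)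
      where
      arm≡0 : row ν a ∸ suc b ≡ 0
      arm≡0 = ℕP.m+n≡0⇒m≡0 _ h0
      leg≡0 : col ν b ∸ suc a ≡ 0
      leg≡0 = ℕP.m+n≡0⇒n≡0 (row ν a ∸ suc b) h0
      row≡1+b : row ν a ≡ suc b
      row≡1+b = ℕP.≤-antisym (ℕP.m∸n≡0⇒m≤n arm≡0) hb
      a<col : a < col ν b
      a<col = <row⇒<col ν p a b hb
      col≡1+a : col ν b ≡ suc a
      col≡1+a = ℕP.≤-antisym (ℕP.m∸n≡0⇒m≤n leg≡0) a<col
      row-suc≤b : row ν (suc a) ≤ b
      row-suc≤b with row ν (suc a) ℕP.≤? b
      ... | yes q = q
      ... | no q = ⊥-elim (ℕP.<-irrefl refl (subst (suc a <_) col≡1+a (<row⇒<col ν p (suc a) b (ℕP.≰⇒> q))))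
      removable-a : removable ν a ≡ true
      removable-a = <⇒<ᵇ≡true {row ν (suc a)} {row ν a} (ℕP.≤-<-trans row-suc≤b hb)
      a<ℓ : a < ℓ
      a<ℓ = positive-row⇒<length ν a (ℕP.≤-<-trans z≤n hb)
      atCorner : ∀ r → indq (removable ν r) (walkToCorner ν r a b) ≡ indq (r ≡ᵇ a) 1ℚ
      atCorner r with r ℕP.≟ a
      ... | yes refl = trans (cong (λ z → indq z (walkToCorner ν r r b)) removable-a)
                       (trans (π-in r b ℕP.≤-refl (ℕP.≤-reflexive eβ))
                       (trans (cong₂ _*_ X-last (trans (cong Y eβ) Y-last))
                       (trans (ℚP.*-identityˡ 1ℚ) (cong (λ z → indq z 1ℚ) (sym (≡ᵇ-refl r))))))
        where
        open Corner ν p r removable-a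
        eβ : b ≡ β
        eβ = sym (cong (_∸ 1) row≡1+b)
      ... | no ne =
        trans (indq-≡0 (removable ν r) (walkToCorner ν r a b) (λ e → elsewhere r e ne))
          (cong (λ z → indq z 1ℚ) (sym (≢⇒≡ᵇ≡false ne)))
        where
        elsewhere : ∀ r → (e : removable ν r ≡ true) → r ≢ a → walkToCorner ν r a b ≡ 0ℚ
        elsewhere r e ne with ℕP.<-cmp r a
        ... | tri< r<a _ _ = Corner.π-below ν p r e a b r<a
        ... | tri≈ _ q _ = ⊥-elim (ne q)
        ... | tri> _ _ a<r = Corner.π-right ν p r e a b
                (ℕP.<-≤-trans (subst (λ z → row ν r ∸ 1 < z) (ℕP.m+[n∸m]≡n (Corner.1≤row ν p r e))
                    (ℕP.n<1+n _)) (ℕP.≤-trans (row-antitone ν p {suc a} {r} a<r) row-suc≤b))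

    <∸⇒+< : ∀ n m t → t < m ∸ n → n ℕ.+ t < m
    <∸⇒+< zero m t h = h
    <∸⇒+< (suc n) zero t ()
    <∸⇒+< (suc n) (suc m) t h = s≤s (<∸⇒+< n m t h)

    totalWalk≡1 : ∀ K a b → b < row ν a → hook ν a b < K → totalWalk a b ≡ 1ℚ
    totalWalk≡1 zero a b hb ()
    totalWalk≡1 (suc K) a b hb hK = byHook (hook ν a b) refl
      where
      byHook : ∀ h → hook ν a b ≡ h → totalWalk a b ≡ 1ℚ
      byHook zero e = totalWalk-corner a b hb e
      byHook (suc h) e =
        trans (Σq-cong ℓ (λ r → walkToCorner-step a b r h1 (removable ν r) refl))
        (trans (sym (Σq-*ˡ (rcp (hook ν a b)) ℓ _))
        (trans (cong (rcp (hook ν a b) *_) (Σq-+ ℓ _ _))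
        (trans (cong (rcp (hook ν a b) *_) (cong₂ _+_ Σ-arm Σ-leg))
        (trans (cong (rcp (hook ν a b) *_) (sym (ι-+ (armLength a b) (legLength a b))))
        (rcp-cancel (hook ν a b) h1)))))
        where
        h1 : 1 ≤ hook ν a b
        h1 = subst (1 ≤_) (sym e) (s≤s z≤n)
        Σ-arm : Σq< ℓ (λ r → Σq< (armLength a b) (λ t → indq (removable ν r)
            (walkToCorner ν r a (suc b ℕ.+ t)))) ≡ ι (armLength a b)
        Σ-arm = trans (Σq-swap ℓ (armLength a b) _)
              (trans (Σq-cong< (armLength a b) (λ t t< → totalWalk≡1 K a (suc b ℕ.+ t)
                  (<∸⇒+< (suc b) (row ν a) t t<)
                        (ℕP.<-≤-trans (hook-arm-< a b t (<∸⇒+< (suc b) (row ν a) t t<)) (ℕP.≤-pred hK))))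
              (Σq-1 (armLength a b)))
        Σ-leg : Σq< ℓ (λ r → Σq< (legLength a b) (λ t → indq (removable ν r)
            (walkToCorner ν r (suc a ℕ.+ t) b))) ≡ ι (legLength a b)
        Σ-leg = trans (Σq-swap ℓ (legLength a b) _)
              (trans (Σq-cong< (legLength a b) (λ t t< → totalWalk≡1 K (suc a ℕ.+ t) b
                  (<col⇒<row ν p (suc a ℕ.+ t) b (<∸⇒+< (suc a) (col ν b) t t<))
                        (ℕP.<-≤-trans (hook-leg-< a b t (<∸⇒+< (suc a) (col ν b) t t<)) (ℕP.≤-pred hK))))
              (Σq-1 (legLength a b)))

  module Total (ν : List ℕ) (p : IsPartition ν) where
    open Walk ν p

    Σ-boxes-totalWalk : Σq< ℓ (λ a → Σq< (row ν a) (λ b → totalWalk a b)) ≡ ι (sum ν)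
    Σ-boxes-totalWalk =
      trans (Σq-cong< ℓ (λ a _ → trans (Σq-cong< (row ν a) (λ b b< → totalWalk≡1 (suc (hook ν a b)) a b b<
        ℕP.≤-refl)) (Σq-1 (row ν a))))
                (trans (sym (ι-Σ< ℓ (row ν))) (cong ι (Σ<-row≡sum ν)))

    Σ-boxes-walkToCorner : ∀ r (e : removable ν r ≡ true) →
      Σq< ℓ (λ a → Σq< (row ν a) (λ b → walkToCorner ν r a b)) ≡ columnProduct ν r 0 * rowProduct ν r 0
    Σ-boxes-walkToCorner r e =
      trans (Σq-extend (suc r) ℓ _ r<length (λ a h1 _ → Σq-0 (row ν a) (λ b → π-below a b h1)))
      (trans (Σq-cong< (suc r) (λ a a< → inner a (ℕP.≤-pred a<)))
      (trans (sym (Σq-*ʳ (Q 0) (suc r) X)) (cong (_* Q 0) ΣX)))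
      where
      open Corner ν p r e
      inner : ∀ a → a ≤ r → Σq< (row ν a) (λ b → π a b) ≡ X a * Q 0
      inner a ha = trans (Σq-extend (suc β) (row ν a) _ (1+β≤row a ha) (λ b h1 _ → π-right a b h1))
                   (trans (Σq-cong< (suc β) (λ b b< → π-in a b ha (ℕP.≤-pred b<)))
                   (trans (sym (Σq-*ˡ (X a) (suc β) Y)) (cong (X a *_) ΣY)))

    Σ-corners-walkProduct : Σq< ℓ (λ r → indq (removable ν r) (columnProduct ν r 0 * rowProduct ν r 0))
      ≡ ι (sum ν)
    Σ-corners-walkProduct =
      trans (Σq-cong ℓ (λ r → perCorner r (removable ν r) refl))
      (trans (sym (Σq-swap ℓ ℓ _))
      (trans (Σq-cong ℓ (λ a → sym (Σq-swap (row ν a) ℓ _)))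
      Σ-boxes-totalWalk))
      where
      perCorner : ∀ r bb → removable ν r ≡ bb →
        indq bb (columnProduct ν r 0 * rowProduct ν r 0)
        ≡ Σq< ℓ (λ a → Σq< (row ν a) (λ b → indq bb (walkToCorner ν r a b)))
      perCorner r false e = sym (Σq-0 ℓ (λ a → Σq-0 (row ν a) (λ b → refl)))
      perCorner r true e = sym (Σ-boxes-walkToCorner r e)


-- Removing the corner (r, β) lowers by one the hook lengths h of the other boxes in row r and in
-- column β and leaves all other hooks unchanged, so the product of reciprocal hooks gains the
-- factor ∏ h/(h − 1) = ∏ (1 + 1/(h − 1)), which is exactly the closed-form walk product.
module HookRemoval where

  open import Data.Nat as ℕ using (ℕ; zero; suc; _<_; _≤_; z<s; s<s; _∸_; _<ᵇ_; _≡ᵇ_)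
  import Data.Nat.Properties as ℕP
  open import Data.Bool using (true; if_then_else_)
  open import Data.List using (List; length)
  open import Data.Rational as ℚ using (ℚ; 1ℚ; _+_; _*_)
  import Data.Rational.Properties as ℚP
  open import Data.Rational.Solver using (module +-*-Solver)
  open import Data.Empty using (⊥-elim)
  open import Relation.Binary.PropositionalEquality
  open import Relation.Nullary using (yes; no)
  open import Relation.Binary using (tri<; tri≈; tri>)
  open BooleanComparisons
  open YoungDiagrams
  open NatToRational
  open RationalSums
  open HookProducts
  open HookWalk

  inv-suc : ∀ k → inv k ≡ inv (suc k) * (1ℚ + inv k)
  inv-suc k =
    trans (sym (ℚP.*-identityʳ (inv k)))
    (trans (cong (inv k *_) (sym inv-2+k*2+k≡1))
    (trans (regroup (inv k) (inv (suc k)) (ι (suc k)))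
           (cong (inv (suc k) *_) (trans (cong (inv k +_) (inv-cancel k)) (ℚP.+-comm (inv k) 1ℚ)))))
    where
    open +-*-Solver
    regroup : ∀ a b U → a * (b * (1ℚ + U)) ≡ b * (a + a * U)
    regroup = solve 3 (λ a b U → a :* (b :* (con 1ℚ :+ U)) := b :* (a :+ a :* U)) refl
    inv-2+k*2+k≡1 : inv (suc k) * (1ℚ + ι (suc k)) ≡ 1ℚ
    inv-2+k*2+k≡1 = trans (cong (inv (suc k) *_) (sym (ι-suc (suc k)))) (inv-cancel (suc k))

  Πq-change-one : ∀ n β (f g : ℕ → ℚ) c → β < n → (∀ b → b ≢ β → g b ≡ f b) → g β ≡ f β * c →
    Πq< n g ≡ Πq< n f * c
  Πq-change-one (suc n) zero f g c _ same changed =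
    trans (cong₂ _*_ changed (Πq-cong< n (λ i _ → same (suc i) (λ ()))))
        (sym (swap (f 0) c (Πq< n (λ i → f (suc i)))))
    where
    open +-*-Solver
    swap : ∀ f c P → (f * P) * c ≡ (f * c) * P
    swap = solve 3 (λ f c P → (f :* P) :* c := (f :* c) :* P) refl
  Πq-change-one (suc n) (suc β) f g c (s<s β<n) same changed =
    trans (cong₂ _*_ (same 0 (λ ()))
                     (Πq-change-one n β (λ i → f (suc i)) (λ i → g (suc i)) c β<n
                         (λ b ne → same (suc b) (λ q → ne (ℕP.suc-injective q))) changed))
          (sym (ℚP.*-assoc (f 0) _ c))

  <-ext : ∀ c d → (∀ i → i < c → i < d) → (∀ i → i < d → i < c) → c ≡ d
  <-ext c d f g =
    ℕP.≤-antisym (ℕP.≮⇒≥ (λ d<c → ℕP.<-irrefl refl (f d d<c))) (ℕP.≮⇒≥ (λ c<d → ℕP.<-irrefl refl (g c c<d)))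

  module Removal (ν : List ℕ) (p : IsPartition ν) (r : ℕ) (e : removable ν r ≡ true) where
    open Corner ν p r e

    ν′ : List ℕ
    ν′ = removeBox r ν
    p′ : IsPartition ν′
    p′ = removeBox-partition ν r p e

    row-removeBox-other : ∀ a → a ≢ r → row ν′ a ≡ row ν a
    row-removeBox-other a ne = row-removeBox-≢ ν r a p e ne

    row-removeBox-corner : row ν′ r ≡ β
    row-removeBox-corner = ℕP.suc-injective (trans (row-removeBox-≡ ν r p e) (sym 1+β≡row))

    row-suc≤β : row ν (suc r) ≤ β
    row-suc≤β = ℕP.≤-pred (subst (row ν (suc r) <_) (sym 1+β≡row) (<ᵇ≡true⇒< {row ν (suc r)} {row ν r} e))

    col-removeBox-other : ∀ b → b ≢ β → col ν′ b ≡ col ν b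
    col-removeBox-other b ne = <-ext _ _ (λ i h → <row⇒<col ν p i b (to i (<col⇒<row ν′ p′ i b h)))
                           (λ i h → <row⇒<col ν′ p′ i b (from i (<col⇒<row ν p i b h)))
      where
      to : ∀ i → b < row ν′ i → b < row ν i
      to i h with i ℕP.≟ r
      ... | yes refl = ℕP.<-≤-trans h (subst (row ν′ i ≤_) (row-removeBox-≡ ν r p e) (ℕP.n≤1+n _))
      ... | no ne' = subst (b <_) (row-removeBox-other i ne') h
      from : ∀ i → b < row ν i → b < row ν′ i
      from i h with i ℕP.≟ r
      ... | yes refl =
        subst (b <_) (sym row-removeBox-corner) (ℕP.≤∧≢⇒< (ℕP.≤-pred (subst (b <_) (sym 1+β≡row) h)) ne)
      ... | no ne' = subst (b <_) (sym (row-removeBox-other i ne')) h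

    col-removeBox-corner : col ν′ β ≡ r
    col-removeBox-corner =
      <-ext _ _ (λ i h → to i (<col⇒<row ν′ p′ i β h)) (λ i h → <row⇒<col ν′ p′ i β (from i h))
      where
      to : ∀ i → β < row ν′ i → i < r
      to i h with ℕP.<-cmp i r
      ... | tri< q _ _ = q
      ... | tri≈ _ refl _ = ⊥-elim (ℕP.<-irrefl (sym row-removeBox-corner) h)
      ... | tri> _ _ q =
        ⊥-elim (ℕP.<⇒≱ h (ℕP.≤-trans (ℕP.≤-reflexive (row-removeBox-other i (λ q' → ℕP.<⇒≢ q (sym q'))))
          (ℕP.≤-trans (row-antitone ν p q) row-suc≤β)))
      from : ∀ i → i < r → β < row ν′ i
      from i h = subst (β <_) (sym (row-removeBox-other i (ℕP.<⇒≢ h))) (1+β≤row i (ℕP.<⇒≤ h))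

    hook-removeBox-other : ∀ a b → a ≢ r → b ≢ β → hook ν′ a b ≡ hook ν a b
    hook-removeBox-other a b na nb =
      cong₂ (λ x y → (x ∸ suc b) ℕ.+ (y ∸ suc a)) (row-removeBox-other a na) (col-removeBox-other b nb)

    hook-removeBox-cornerRow : ∀ b → b < β → suc (hook ν′ r b) ≡ v b
    hook-removeBox-cornerRow b h =
      trans (cong₂ (λ x y → suc ((x ∸ suc b) ℕ.+ (y ∸ suc r))) row-removeBox-corner
        (col-removeBox-other b (ℕP.<⇒≢ h)))
                    (cong (ℕ._+ (col ν b ∸ suc r)) (trans (sym (ℕP.+-∸-assoc 1 {β} {suc b} h))
                        (cong (_∸ suc b) 1+β≡row)))

    hook-removeBox-cornerColumn : ∀ a → a < r → suc (hook ν′ a β) ≡ u a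
    hook-removeBox-cornerColumn a h =
      trans (cong₂ (λ x y → suc ((x ∸ suc β) ℕ.+ (y ∸ suc a))) (row-removeBox-other a (ℕP.<⇒≢ h))
        col-removeBox-corner)
              (trans (sym (ℕP.+-suc (row ν a ∸ suc β) (r ∸ suc a)))
              (cong ((row ν a ∸ suc β) ℕ.+_) (trans (sym (ℕP.+-∸-assoc 1 {r} {suc a} h))
                  (cong (_∸ suc a) (sym col-β)))))

    inv-pred : ∀ k m → suc k ≡ m → inv k ≡ inv m * (1ℚ + rcp m)
    inv-pred k m E = trans (inv-suc k) (cong (λ z → inv z * (1ℚ + rcp z)) E)

    rowInvHooks : ℕ → ℚ
    rowInvHooks a = Πq< (row ν a) (λ b → inv (hook ν a b))

    rowInvHooks′ : ℕ → ℚ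
    rowInvHooks′ a = Πq< (row ν′ a) (λ b → inv (hook ν′ a b))

    rowInvHooks-above : ∀ a → a < r → rowInvHooks′ a ≡ rowInvHooks a * (1ℚ + rcp (u a))
    rowInvHooks-above a h =
      trans (cong (λ n → Πq< n (λ b → inv (hook ν′ a b))) (row-removeBox-other a (ℕP.<⇒≢ h)))
       (Πq-change-one (row ν a) β (λ b → inv (hook ν a b)) (λ b → inv (hook ν′ a b)) (1ℚ + rcp (u a))
           (1+β≤row a (ℕP.<⇒≤ h))
          (λ b nb → cong inv (hook-removeBox-other a b (ℕP.<⇒≢ h) nb))
              (inv-pred (hook ν′ a β) (u a) (hook-removeBox-cornerColumn a h)))

    rowInvHooks-r : rowInvHooks r ≡ Πq< β (λ b → inv (v b))
    rowInvHooks-r = begin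
      Πq< (row ν r) (λ b → inv (hook ν r b))           ≡⟨ cong (λ n → Πq< n (λ b → inv (hook ν r b)))
          (sym 1+β≡row) ⟩
      Πq< (suc β) (λ b → inv (hook ν r b))             ≡⟨ Πq-snoc β (λ b → inv (hook ν r b)) ⟩
      Πq< β (λ b → inv (v b)) * inv (hook ν r β)       ≡⟨ cong (λ z → Πq< β (λ b → inv (v b)) * inv z)
          hook-corner ⟩
      Πq< β (λ b → inv (v b)) * inv 0                  ≡⟨ cong (Πq< β (λ b → inv (v b)) *_) inv-0 ⟩
      Πq< β (λ b → inv (v b)) * 1ℚ                     ≡⟨ ℚP.*-identityʳ _ ⟩
      Πq< β (λ b → inv (v b))                          ∎
      where open ≡-Reasoning

    rowInvHooks-corner : rowInvHooks′ r ≡ rowInvHooks r * Q 0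
    rowInvHooks-corner =
      trans (cong (λ n → Πq< n (λ b → inv (hook ν′ r b))) row-removeBox-corner)
      (trans (Πq-cong< β (λ b b< → inv-pred (hook ν′ r b) (v b) (hook-removeBox-cornerRow b b<)))
      (trans (Πq-* β (λ b → inv (v b)) (λ b → 1ℚ + rcp (v b)))
             (cong (_* Q 0) (sym rowInvHooks-r))))

    rowInvHooks-below : ∀ a → r < a → rowInvHooks′ a ≡ rowInvHooks a
    rowInvHooks-below a h =
      trans (cong (λ n → Πq< n (λ b → inv (hook ν′ a b))) (row-removeBox-other a a≢r))
            (Πq-cong< (row ν a) (λ b b< → cong inv (hook-removeBox-other a b a≢r
                                   (ℕP.<⇒≢ (ℕP.<-≤-trans b< (ℕP.≤-trans (row-antitone ν p h) row-suc≤β))))))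
      where
      a≢r : a ≢ r
      a≢r q = ℕP.<⇒≢ h (sym q)

    rowFactor : ℕ → ℚ
    rowFactor a = if a <ᵇ r then 1ℚ + rcp (u a) else (if a ≡ᵇ r then Q 0 else 1ℚ)

    rowFactor-< : ∀ a → a < r → rowFactor a ≡ 1ℚ + rcp (u a)
    rowFactor-< a h = if-true (1ℚ + rcp (u a)) _ (<⇒<ᵇ≡true {a} {r} h)

    rowFactor-r : rowFactor r ≡ Q 0
    rowFactor-r =
      trans (if-false (1ℚ + rcp (u r)) _ (≥⇒<ᵇ≡false {r} {r} ℕP.≤-refl)) (if-true (Q 0) 1ℚ (≡ᵇ-refl r))

    rowFactor-> : ∀ a → r < a → rowFactor a ≡ 1ℚ
    rowFactor-> a h = trans (if-false (1ℚ + rcp (u a)) _ (≥⇒<ᵇ≡false {a} {r} (ℕP.<⇒≤ h)))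
                            (if-false (Q 0) 1ℚ (≢⇒≡ᵇ≡false {a} {r} (λ q → ℕP.<⇒≢ h (sym q))))

    rowInvHooks-removeBox : ∀ a → rowInvHooks′ a ≡ rowInvHooks a * rowFactor a
    rowInvHooks-removeBox a with ℕP.<-cmp a r
    ... | tri< h _ _    = trans (rowInvHooks-above a h) (cong (rowInvHooks a *_) (sym (rowFactor-< a h)))
    ... | tri≈ _ refl _ = trans rowInvHooks-corner (cong (rowInvHooks a *_) (sym rowFactor-r))
    ... | tri> _ _ h    = trans (rowInvHooks-below a h)
                                (trans (sym (ℚP.*-identityʳ (rowInvHooks a)))
                                    (cong (rowInvHooks a *_) (sym (rowFactor-> a h))))

    Π-rowFactor : Πq< (length ν) rowFactor ≡ P 0 * Q 0
    Π-rowFactor = begin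
      Πq< (length ν) rowFactor
        ≡⟨ cong (λ n → Πq< n rowFactor) (sym (ℕP.m+[n∸m]≡n (ℕP.<⇒≤ r<length))) ⟩
      Πq< (r ℕ.+ (length ν ∸ r)) rowFactor
        ≡⟨ Πq-split r (length ν ∸ r) rowFactor ⟩
      Πq< r rowFactor * Πq< (length ν ∸ r) (λ t → rowFactor (r ℕ.+ t))
        ≡⟨ cong₂ _*_ (Πq-cong< r (λ a h → rowFactor-< a h))
                     (cong (λ n → Πq< n (λ t → rowFactor (r ℕ.+ t)))
                         (ℕP.+-∸-assoc 1 {length ν} {suc r} r<length)) ⟩
      P 0 * (rowFactor (r ℕ.+ 0) * Πq< (length ν ∸ suc r) (λ t → rowFactor (r ℕ.+ suc t)))
        ≡⟨ cong (λ z → P 0 * z) (cong₂ _*_ (trans (cong rowFactor (ℕP.+-identityʳ r)) rowFactor-r)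
                                        (Πq-1 (length ν ∸ suc r)
                                            (λ t _ → rowFactor-> (r ℕ.+ suc t) (ℕP.m<m+n r z<s)))) ⟩
      P 0 * (Q 0 * 1ℚ)
        ≡⟨ cong (P 0 *_) (ℚP.*-identityʳ (Q 0)) ⟩
      P 0 * Q 0 ∎
      where open ≡-Reasoning

    invHookProduct-removeBox : invHookProduct ν′ ≡ (P 0 * Q 0) * invHookProduct ν
    invHookProduct-removeBox =
      trans (sym (Πq-extend (length ν′) (length ν) rowInvHooks′ (length-removeBox-≤ ν r)
                            (λ a h _ → cong (λ n → Πq< n (λ b → inv (hook ν′ a b))) (row-beyond ν′ a h))))
      (trans (Πq-cong< (length ν) (λ a _ → rowInvHooks-removeBox a))
      (trans (Πq-* (length ν) rowInvHooks rowFactor)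
      (trans (cong (invHookProduct ν *_) Π-rowFactor) (ℚP.*-comm (invHookProduct ν) _))))


module HookLengthFormula where

  open import Data.Nat as ℕ using (ℕ; zero; suc; _!)
  import Data.Nat.Properties as ℕP
  open import Data.Nat.ListAction using (sum)
  open import Data.Bool using (true; false)
  open import Data.List using (List; length)
  open import Data.Rational as ℚ using (ℚ; _*_)
  import Data.Rational.Properties as ℚP
  open import Data.Rational.Solver using (module +-*-Solver)
  open import Relation.Binary.PropositionalEquality
  open import Defs using (fShape)
  open NatSums using (ind)
  open YoungDiagrams
  open Tableaux using (Σ-removable)
  open TableauCounts
  open NatToRational
  open RationalSums
  open HookProducts
  open HookWalk
  open HookWalkTotal
  open HookRemoval

  Σ-removable-invHookProduct : ∀ ν → IsPartition ν →
    Σq< (length ν) (λ r → indq (removable ν r) (invHookProduct (removeBox r ν))) ≡ ι (sum ν) * invHookProduct ν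
  Σ-removable-invHookProduct ν p =
    trans (Σq-cong (length ν) (λ r → removal r (removable ν r) refl))
    (trans (sym (Σq-*ʳ (invHookProduct ν) (length ν) (λ r → indq (removable ν r)
        (columnProduct ν r 0 * rowProduct ν r 0))))
           (cong (_* invHookProduct ν) (Total.Σ-corners-walkProduct ν p)))
    where
    removal : ∀ r t → removable ν r ≡ t →
      indq t (invHookProduct (removeBox r ν)) ≡ indq t (columnProduct ν r 0 * rowProduct ν r 0) * invHookProduct ν
    removal r false e = sym (ℚP.*-zeroˡ (invHookProduct ν))
    removal r true  e = Removal.invHookProduct-removeBox ν p r e

  hookLengthFormula : ∀ n λ′ → IsPartition λ′ → sum λ′ ≡ n → ι (n !) * invHookProduct λ′ ≡ ι (tableauCount n λ′)
  hookLengthFormula zero λ′ p s with sum≡0⇒[] λ′ p s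
  ... | refl = ℚP.*-identityʳ (ι 1)
  hookLengthFormula (suc m) λ′ p s = begin
    ι (suc m !) * H λ′
      ≡⟨ cong (_* H λ′) (ι-* (suc m) (m !)) ⟩
    ι (suc m) * ι (m !) * H λ′
      ≡⟨ exchange (ι (suc m)) (ι (m !)) (H λ′) ⟩
    ι (m !) * (ι (suc m) * H λ′)
      ≡⟨ cong (λ k → ι (m !) * (ι k * H λ′)) (sym s) ⟩
    ι (m !) * (ι (sum λ′) * H λ′)
      ≡⟨ cong (ι (m !) *_) (sym (Σ-removable-invHookProduct λ′ p)) ⟩
    ι (m !) * Σq< ℓ (λ r → indq (removable λ′ r) (H (removeBox r λ′)))
      ≡⟨ Σq-*ˡ (ι (m !)) ℓ _ ⟩
    Σq< ℓ (λ r → ι (m !) * indq (removable λ′ r) (H (removeBox r λ′)))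
      ≡⟨ Σq-cong ℓ (λ r → branch r (removable λ′ r) refl) ⟩
    Σq< ℓ (λ r → ι (ind (removable λ′ r) (tableauCount m (removeBox r λ′))))
      ≡⟨ sym (ι-Σ< ℓ (λ r → ind (removable λ′ r) (tableauCount m (removeBox r λ′)))) ⟩
    ι (Σ-removable λ′ (λ r → tableauCount m (removeBox r λ′)))
      ≡⟨ cong ι (sym (tableauCount-suc m λ′ p)) ⟩
    ι (tableauCount (suc m) λ′) ∎
    where
    open ≡-Reasoning
    H : List ℕ → ℚ
    H = invHookProduct
    ℓ : ℕ
    ℓ = length λ′
    exchange : ∀ x y z → x * y * z ≡ y * (x * z)
    exchange = solve 3 (λ x y z → x :* y :* z := y :* (x :* z)) refl
      where open +-*-Solver
    branch : ∀ r t → removable λ′ r ≡ t →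
      ι (m !) * indq t (H (removeBox r λ′)) ≡ ι (ind t (tableauCount m (removeBox r λ′)))
    branch r false e = trans (ℚP.*-zeroʳ (ι (m !))) (sym ι-0)
    branch r true  e = hookLengthFormula m (removeBox r λ′) (removeBox-partition λ′ r p e)
                                         (ℕP.suc-injective (trans (sum-removeBox λ′ r p e) s))

  fShape≡tableauCount : ∀ n λ′ → IsPartition λ′ → sum λ′ ≡ n → fShape n λ′ ≡ ι (tableauCount n λ′)
  fShape≡tableauCount n λ′ p s =
    trans (cong₂ _*_ (sym (ι-def (n !))) (invHooksFrom≡invHookProduct λ′)) (hookLengthFormula n λ′ p s)


module ExpectedPasses where

  open import Data.Nat as ℕ using (ℕ; _*_; _!)
  open import Data.Nat.Properties using (*-assoc; *-comm; _!≢0)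
  open import Data.Integer using (+_)
  open import Data.Nat.ListAction using (sum)
  open import Data.List using (List; []; _∷_; length; map; upTo; foldr)
  open import Data.List.Properties using (length-upTo)
  open import Data.List.Relation.Unary.All using (All; []; _∷_)
  open import Data.List.Relation.Unary.AllPairs.Properties using (applyUpTo⁺₁)
  open import Data.Product using (_×_; _,_)
  open import Data.Rational as ℚ using (ℚ; 0ℚ; _/_)
  import Data.Rational.Properties as ℚP
  open import Function using (id)
  open import Relation.Binary.PropositionalEquality
  open import Defs using (D; Sym; permutations; Partitions; rhs; fShape; firstColumn)
  open ListSums
  open YoungDiagrams
  open Tableaux
  open TableauCounts
  open PartitionEnumeration
  open PermutationGrowth
  open NatToRational
  open HookLengthFormula using (fShape≡tableauCount)

  average : ℕ → ℕ → ℚ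
  average n t = ((+ t) / (n !)) {{n !≢0}}

  Σ-D≡Σ-Partitions : ∀ n →
    sum (map D (Sym n)) ≡ sumL (Partitions n) (λ λ′ → length λ′ * (tableauCount n λ′ * tableauCount n λ′))
  Σ-D≡Σ-Partitions n = begin
    sumL (permutations (upTo n)) D
      ≡⟨ sym (sumL-pairedPermutations-fst (upTo n) D) ⟩
    sumL (pairedPermutations (upTo n)) (λ (q , _) → D q)
      ≡⟨ sumL-cong-All (pairedPermutations (upTo n)) (D-pairedPermutations (upTo n)
          (applyUpTo⁺₁ id n (λ i<j _ → i<j))) (λ _ e → e) ⟩
    sumL (pairedPermutations (upTo n)) (λ (_ , w) → length (shape w))
      ≡⟨ sumL-pairedPermutations-snd (upTo n) (λ w → length (shape w)) ⟩
    sumL (Tableaux (length (upTo n))) (λ w → tableauCount (length (upTo n)) (shape w) * length (shape w))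
      ≡⟨ cong (λ m → sumL (Tableaux m) (λ w → tableauCount m (shape w) * length (shape w))) (length-upTo n) ⟩
    sumL (Tableaux n) (λ w → tableauCount n (shape w) * length (shape w))
      ≡⟨ sumL-Tableaux-byShape n (λ λ′ → tableauCount n λ′ * length λ′) ⟩
    sumL (Partitions n) (λ λ′ → tableauCount n λ′ * (tableauCount n λ′ * length λ′))
      ≡⟨ sumL-cong (Partitions n) (λ λ′ → trans (sym (*-assoc (tableauCount n λ′) _ _)) (*-comm _ (length λ′))) ⟩
    sumL (Partitions n) (λ λ′ → length λ′ * (tableauCount n λ′ * tableauCount n λ′)) ∎
    where open ≡-Reasoning

  foldr-+-ι : ∀ (ys : List (List ℕ)) (T : List ℕ → ℚ) (k : List ℕ → ℕ) c {P : List ℕ → Set} → All P ys →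
    (∀ y → P y → T y ≡ ι (k y) ℚ.* c) → foldr ℚ._+_ 0ℚ (map T ys) ≡ ι (sumL ys k) ℚ.* c
  foldr-+-ι []       T k c []       term = sym (trans (cong (ℚ._* c) ι-0) (ℚP.*-zeroˡ c))
  foldr-+-ι (y ∷ ys) T k c (p ∷ ps) term =
    trans (cong₂ ℚ._+_ (term y p) (foldr-+-ι ys T k c ps term))
          (trans (sym (ℚP.*-distribʳ-+ c (ι (k y)) (ι (sumL ys k))))
              (cong (ℚ._* c) (sym (ι-+ (k y) (sumL ys k)))))

  rhs≡average : ∀ n →
    rhs n ≡ average n (sumL (Partitions n) (λ λ′ → length λ′ * (tableauCount n λ′ * tableauCount n λ′)))
  rhs≡average n =
    trans (foldr-+-ι (Partitions n) _ (λ λ′ → length λ′ * (f λ′ * f λ′)) 1/n! (Partitions-sound n) summand)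
          (sym (/-ι _ (n !) {{n !≢0}}))
    where
    open ≡-Reasoning
    1/n! : ℚ
    1/n! = ((+ 1) / (n !)) {{n !≢0}}
    f : List ℕ → ℕ
    f = tableauCount n
    summand : ∀ λ′ → IsPartition λ′ × sum λ′ ≡ n →
      ((+ firstColumn λ′) / 1) ℚ.* (fShape n λ′ ℚ.* fShape n λ′) ℚ.* 1/n! ≡ ι (length λ′ * (f λ′ * f λ′)) ℚ.* 1/n!
    summand λ′ (p , s) = cong (ℚ._* 1/n!) (begin
      ((+ length λ′) / 1) ℚ.* (fShape n λ′ ℚ.* fShape n λ′)
        ≡⟨ cong₂ ℚ._*_ (sym (ι-def (length λ′))) (cong₂ ℚ._*_ (fShape≡tableauCount n λ′ p s)
            (fShape≡tableauCount n λ′ p s)) ⟩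
      ι (length λ′) ℚ.* (ι (f λ′) ℚ.* ι (f λ′))
        ≡⟨ sym (trans (ι-* (length λ′) _) (cong (ι (length λ′) ℚ.*_) (ι-* (f λ′) (f λ′)))) ⟩
      ι (length λ′ * (f λ′ * f λ′)) ∎)


mainTheorem6 : (n : ℕ) → expectedD n ≡ rhs n
mainTheorem6 n = trans (cong (average n) (Σ-D≡Σ-Partitions n)) (sym (rhs≡average n))
  where open ExpectedPasses
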